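{- Let $G$ be a finite abelian group with identity $1$, let $S$ be an inverse-closed subset of $G\setminus\{1\}$ with $|S|\ge 3$, let $s\in S$ be such that $H=\langle S\setminus\{s,s^{ -1}\}\rangle\neq G$, let $\Gamma=\mathrm{Cay}(G;S)$ and $\Gamma_0=\mathrm{Cay}(H;S\setminus\{s,s^{ -1}\})$ with adjacency matrix $A$. Suppose $[G:H]=2$, $s$ has order $4$, $G\neq\langle s\rangle$, and $\Gamma$ is distance-regular with $a_1=0$. Let $d=\partial_0(x,Px)$ for some (equivalently every) $x\in H$. Then for every $1\le i\le\lfloor d/2\rfloor$: (i) $a_i^0$ exists and $a_i=a_i^0=0$; (ii) $c_i^0$ exists and $c_i=c_i^0=i$; (iii) there exist polynomials $p_{i-1}(\lambda)$, $q_{i-1}(\lambda)$, $r_{i-2}(\lambda)$ of degrees $i-1$, $i-1$, $i-2$ respectively ($r_{ -1}$ being the zero polynomial), with the leading coefficient of $q_{i-1}$ equal to $i(i+1)$, such that $$c_{i+1}A_{i+1}=\begin{pmatrix} \frac{A^{i+1}+p_{i-1}(A)+q_{i-1}(A)P}{i!} & \frac{((i+1)A^i+r_{i-2}(A))(P+I)}{i!}\\ \frac{((i+1)A^i+r_{i-2}(A))(P+I)}{i!} & \frac{A^{i+1}+p_{i-1}(A)+q_{i-1}(A)P}{i!}\end{pmatrix};$$ (iv) for any $x,y\in H$ with $\partial_0(x,y)=i$ we have $\partial(x,y)=\partial(xs,ys)=i$ and $\partial(x,ys)=\partial(xs,y)=i+1$.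
   Context: $\mathrm{Cay}(G;S)$ has vertex set $G$, $g\sim h$ iff $h=gs'$ for some $s'\in S$. $\partial$ and $\partial_0$ are the path-length distances in $\Gamma$ and $\Gamma_0$. A connected graph is distance-regular if for each $i$ up to the diameter the numbers $c_i(x,y)=|N_{i-1}(x)\cap N(y)|$, $a_i(x,y)=|N_i(x)\cap N(y)|$, $b_i(x,y)=|N_{i+1}(x)\cap N(y)|$ depend only on $i=\partial(x,y)$ ($N_j(x)$ = vertices at distance $j$ from $x$, $N=N_1$); their values are $c_i,a_i,b_i$. For $\Gamma_0$, define $c_i^0(x,y),a_i^0(x,y),b_i^0(x,y)$ in the same way using $\partial_0$; we say $c_i^0$ (resp. $a_i^0$) exists if $c_i^0(x,y)$ (resp. $a_i^0(x,y)$) is the same for all $x,y\in H$ with $\partial_0(x,y)=i$, and denote the common value by $c_i^0$ (resp. $a_i^0$). $A_i$ is the $i$-th distance matrix of $\Gamma$ ($(A_i)_{x,y}=1$ if $\partial(x,y)=i$, else $0$). $P$ is the $H\times H$ matrix with $P_{x,y}=1$ iff $y=xs^2$, and $Px$ denotes $xs^2$; $I$ is the $H\times H$ identity. Block matrices on $G$ are written with respect to an ordering in which the elements $x_1,\dots,x_m$ of $H$ come first and then $x_1s,\dots,x_ms$ in the same order. -}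

module Defs where

open import Data.Nat as ℕ using (ℕ; zero; suc; _!; _≤_; _∸_)
open import Data.Nat.Properties using (_!≢0)
open import Data.Fin using (Fin; zero; suc; _≟_)
open import Data.Bool using (Bool; true; false; _∧_; _∨_; not; if_then_else_)
open import Data.List using (List; []; _∷_; length; last)
open import Data.Maybe using (just)
open import Data.Product using (Σ; _×_)
open import Data.Integer using (+_)
open import Data.Rational as ℚ using (ℚ; 0ℚ; 1ℚ)
open import Relation.Nullary using (¬_)
open import Relation.Nullary.Decidable using (⌊_⌋)
open import Relation.Binary.PropositionalEquality using (_≡_; _≢_)

anyF : ∀ {n} → (Fin n → Bool) → Bool
anyF {zero}  f = false
anyF {suc n} f = f zero ∨ anyF (λ i → f (suc i))

countF : ∀ {n} → (Fin n → Bool) → ℕ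
countF {zero}  f = 0
countF {suc n} f = (if f zero then 1 else 0) ℕ.+ countF (λ i → f (suc i))

sumF : ∀ {n} → (Fin n → ℚ) → ℚ
sumF {zero}  f = 0ℚ
sumF {suc n} f = f zero ℚ.+ sumF (λ i → f (suc i))

_==_ : ∀ {n} → Fin n → Fin n → Bool
x == y = ⌊ x ≟ y ⌋

-- Polynomials (coefficient lists, constant term first)

-- HasDegree- cs k : cs is a polynomial of degree exactly k - 1
-- (for k = 0: cs is the zero polynomial, i.e. degree -1).
HasDegree- : List ℚ → ℕ → Set
HasDegree- cs zero    = cs ≡ []
HasDegree- cs (suc k) = (length cs ≡ suc k) × Σ ℚ (λ a → (last cs ≡ just a) × (a ≢ 0ℚ))

LeadingCoeff : List ℚ → ℚ → Set
LeadingCoeff cs a = last cs ≡ just a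

invFact : ℕ → ℚ
invFact i = ℚ._/_ (+ 1) (i !) {{i !≢0}}

fromℕ : ℕ → ℚ
fromℕ k = ℚ._/_ (+ k) 1

module Grp {n : ℕ} (_∙_ : Fin n → Fin n → Fin n) (ε : Fin n) (_⁻¹ : Fin n → Fin n) where

  pow : Fin n → ℕ → Fin n
  pow g zero    = ε
  pow g (suc k) = g ∙ pow g k

  HasOrder : Fin n → ℕ → Set
  HasOrder g k = (pow g k ≡ ε) × (1 ≤ k) × (∀ j → 1 ≤ j → j ℕ.< k → pow g j ≢ ε)

  data InGen (T : Fin n → Bool) : Fin n → Set where
    gen-e   : InGen T ε
    gen-gen : ∀ {g} → T g ≡ true → InGen T g
    gen-mul : ∀ {g h} → InGen T g → InGen T h → InGen T (g ∙ h)
    gen-inv : ∀ {g} → InGen T g → InGen T (g ⁻¹)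

  remove± : (Fin n → Bool) → Fin n → Fin n → Bool
  remove± T s t = T t ∧ not (t == s) ∧ not (t == (s ⁻¹))

  Adj : (Fin n → Bool) → Fin n → Fin n → Bool
  Adj T g h = anyF (λ t → T t ∧ (h == (g ∙ t)))

  Reach : (Fin n → Bool) → ℕ → Fin n → Fin n → Bool
  Reach T zero    x y = x == y
  Reach T (suc k) x y = Reach T k x y ∨ anyF (λ z → Reach T k x z ∧ Adj T z y)

  IsDist : (Fin n → Bool) → Fin n → Fin n → ℕ → Bool
  IsDist T x y zero    = Reach T zero x y
  IsDist T x y (suc i) = Reach T (suc i) x y ∧ not (Reach T i x y)

  cnt-c : (Fin n → Bool) → ℕ → Fin n → Fin n → ℕ
  cnt-c T zero    x y = 0
  cnt-c T (suc i) x y = countF (λ z → IsDist T x z i ∧ Adj T z y)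

  cnt-a : (Fin n → Bool) → ℕ → Fin n → Fin n → ℕ
  cnt-a T i x y = countF (λ z → IsDist T x z i ∧ Adj T z y)

  cnt-b : (Fin n → Bool) → ℕ → Fin n → Fin n → ℕ
  cnt-b T i x y = countF (λ z → IsDist T x z (suc i) ∧ Adj T z y)

  Connected : (Fin n → Bool) → Set
  Connected T = ∀ x y → Σ ℕ (λ i → IsDist T x y i ≡ true)

  DistanceRegular : (Fin n → Bool) → Set
  DistanceRegular T = Connected T ×
    (∀ i x y x′ y′ → IsDist T x y i ≡ true → IsDist T x′ y′ i ≡ true →
        (cnt-c T i x y ≡ cnt-c T i x′ y′) ×
        (cnt-a T i x y ≡ cnt-a T i x′ y′) ×
        (cnt-b T i x y ≡ cnt-b T i x′ y′))

  -- H × H matrices over ℚ, represented as functions on Fin n whose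
  -- entries are only meaningful for rows/columns in H (boolean Hs).

  Mat : Set
  Mat = Fin n → Fin n → ℚ

  module MatH (Hs : Fin n → Bool) where

    _⊕_ : Mat → Mat → Mat
    (M ⊕ N) x y = M x y ℚ.+ N x y

    _⊙_ : ℚ → Mat → Mat
    (c ⊙ M) x y = c ℚ.* M x y

    _⊗_ : Mat → Mat → Mat
    (M ⊗ N) x y = sumF (λ z → if Hs z then M x z ℚ.* N z y else 0ℚ)

    Id : Mat
    Id x y = if x == y then 1ℚ else 0ℚ

    Zero : Mat
    Zero x y = 0ℚ

    _^^_ : Mat → ℕ → Mat
    M ^^ zero  = Id
    M ^^ suc k = M ⊗ (M ^^ k)

    evalP : List ℚ → Mat → Mat
    evalP []       M = Zero
    evalP (c ∷ cs) M = (c ⊙ Id) ⊕ (M ⊗ evalP cs M)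

  ind : Bool → ℚ
  ind b = if b then 1ℚ else 0ℚ

module Submission where

-- Let d = ∂₀(x, x s²) and 1 ≤ i ≤ d/2.  Every walk of Γ = Cay(G;S) projects to a
-- walk of Γ₀ = Cay(H;S₀) ending at a translate of its endpoint by 1, s, s² or s³
-- (WalkDecomposition); a detour through s² costs at least d, so for x, y ∈ H
-- with ∂₀(x,y) = j ≤ i we get ∂(x,y) = j and ∂(x,ys) = ∂(x,ys³) = j+1
-- (ShortDistances: part (iv)).  Counting the neighbours of a vertex by distance
-- then compares Γ with Γ₀ and, with distance-regularity, yields c_j = j and
-- a_j = 0 for j ≤ i (IntersectionNumbers: parts (i), (ii)).  Read in the
-- adjacency matrix A of Γ₀ and the translation P by s², the same counts are the
-- three-term recurrence of the distance matrices in block form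
-- (CountsAsMatrices, RecurrenceStep); by induction j!·A_j has blocks
-- F_j(A) + G_j(A)P and M_j(A)(P + I), where F, G, M obey an integer recurrence
-- whose degrees and leading coefficients are computed in Coefficients
-- (DistanceMatrixFormula: part (iii)).

open import Defs using (module Grp)
open import Data.Nat as ℕ using (ℕ; suc; _≤_)
open import Data.Fin using (Fin)
open import Data.Bool using (Bool; true; false)
open import Data.Product using (Σ)
open import Algebra.Structures using (IsAbelianGroup)
open import Relation.Binary.PropositionalEquality using (_≡_)

module FinSums where

  open import Defs
  open import Data.Nat as ℕ using (ℕ; zero; suc; _+_; _≤_)
  import Data.Nat.Properties as NP
  import Data.Fin as Fin
  open import Data.Fin using (Fin; zero; suc; _≟_)
  open import Data.Bool using (Bool; true; false; _∧_; _∨_; not; if_then_else_)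
  open import Data.Rational as ℚ using (ℚ; 0ℚ)
  import Data.Rational.Properties as QP
  open import Relation.Binary.PropositionalEquality
  open import Data.Product
  open import Data.Sum
  open import Function using (_∘_)
  open import Relation.Nullary using (¬_; yes; no)
  open import Data.Empty using (⊥-elim)
  import Algebra.Properties.CommutativeMonoid.Sum as CMSum
  import Algebra.Properties.CommutativeSemigroup as CSProps
  open import Algebra.Bundles using (CommutativeMonoid)
  open import Data.Fin.Permutation using (permutation)

  b2n : Bool → ℕ
  b2n b = if b then 1 else 0

  ==-true : ∀ {n} {a b : Fin n} → a ≡ b → (a == b) ≡ true
  ==-true {a = a} {b} e with a ≟ b
  ... | yes _ = refl
  ... | no q = ⊥-elim (q e)

  ==-false : ∀ {n} {a b : Fin n} → ¬ a ≡ b → (a == b) ≡ false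
  ==-false {a = a} {b} e with a ≟ b
  ... | yes p = ⊥-elim (e p)
  ... | no q = refl

  ==-sound : ∀ {n} {a b : Fin n} → (a == b) ≡ true → a ≡ b
  ==-sound {a = a} {b} e with a ≟ b
  ... | yes p = p
  ==-sound {a = a} {b} () | no _

  ==-refl : ∀ {n} (a : Fin n) → (a == a) ≡ true
  ==-refl a = ==-true refl

  ==-sym : ∀ {n} (a b : Fin n) → (a == b) ≡ (b == a)
  ==-sym a b with a ≟ b
  ... | yes p = sym (==-true (sym p))
  ... | no q = sym (==-false (λ e → q (sym e)))

  ==-suc : ∀ {n} (a b : Fin n) → (Fin.suc a == Fin.suc b) ≡ (a == b)
  ==-suc a b with a ≟ b
  ... | yes p = refl
  ... | no q = refl

  countF-cong : ∀ {n} {f g : Fin n → Bool} → (∀ i → f i ≡ g i) → countF f ≡ countF g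
  countF-cong {zero} e = refl
  countF-cong {suc n} e = cong₂ _+_ (cong b2n (e zero)) (countF-cong (e ∘ suc))

  module NSum = CMSum NP.+-0-commutativeMonoid
  module QSum = CMSum QP.+-0-commutativeMonoid

  open CSProps NP.+-commutativeSemigroup using () renaming (interchange to ℕ-interchange)
  open CSProps (CommutativeMonoid.commutativeSemigroup QP.+-0-commutativeMonoid)
    using () renaming (interchange to ℚ-interchange)

  countF-sum : ∀ {n} (f : Fin n → Bool) → countF f ≡ NSum.sum (λ i → b2n (f i))
  countF-sum {zero} f = refl
  countF-sum {suc n} f = cong (b2n (f zero) +_) (countF-sum (λ i → f (suc i)))

  countF-perm : ∀ {n} (f : Fin n → Bool) (g h : Fin n → Fin n) →
    (∀ y → g (h y) ≡ y) → (∀ x → h (g x) ≡ x) → countF f ≡ countF (λ i → f (g i))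
  countF-perm f g h e1 e2 = trans (countF-sum f)
    (trans (NSum.sum-permute (λ i → b2n (f i)) (permutation g h e1 e2))
           (sym (countF-sum (λ i → f (g i)))))

  countF-false : ∀ {n} (f : Fin n → Bool) → (∀ i → f i ≡ false) → countF f ≡ 0
  countF-false {zero} f e = refl
  countF-false {suc n} f e rewrite e zero = countF-false (λ i → f (suc i)) (e ∘ suc)

  countF-split : ∀ {n} (f g : Fin n → Bool) →
    countF f ≡ countF (λ i → f i ∧ g i) + countF (λ i → f i ∧ not (g i))
  countF-split {zero} f g = refl
  countF-split {suc n} f g = trans (cong₂ _+_ (lem (f zero) (g zero)) (countF-split (λ i → f (suc i)) (λ i → g (suc i))))
    (ℕ-interchange (b2n (f zero ∧ g zero)) (b2n (f zero ∧ not (g zero))) _ _)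
    where
    lem : ∀ a b → b2n a ≡ b2n (a ∧ b) + b2n (a ∧ not b)
    lem false b = refl
    lem true false = refl
    lem true true = refl

  countF-point : ∀ {n} (c : Fin n) (f : Fin n → Bool) → countF (λ z → (c == z) ∧ f z) ≡ b2n (f c)
  countF-point {suc n} zero f = trans (cong (b2n (f zero) +_) (countF-false (λ i → (zero == suc i) ∧ f (suc i)) (λ i → refl))) (NP.+-identityʳ _)
  countF-point {suc n} (suc c) f = trans (countF-cong (λ i → cong (_∧ f (suc i)) (==-suc c i))) (countF-point {n} c (λ i → f (suc i)))

  countF-le : ∀ {n} (f g : Fin n → Bool) → (∀ i → f i ≡ true → g i ≡ true) → countF f ≤ countF g
  countF-le {zero} f g h = ℕ.z≤n
  countF-le {suc n} f g h = NP.+-mono-≤ (lem (f zero) (g zero) (h zero)) (countF-le _ _ (h ∘ suc))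
    where
    lem : ∀ a b → (a ≡ true → b ≡ true) → b2n a ≤ b2n b
    lem false b _ = ℕ.z≤n
    lem true b k rewrite k refl = NP.≤-refl

  anyF-intro : ∀ {n} (f : Fin n → Bool) (i : Fin n) → f i ≡ true → anyF f ≡ true
  anyF-intro f zero e rewrite e = refl
  anyF-intro f (suc i) e with f zero
  ... | true = refl
  ... | false = anyF-intro (λ j → f (suc j)) i e

  anyF-elim : ∀ {n} (f : Fin n → Bool) → anyF f ≡ true → Σ (Fin n) (λ i → f i ≡ true)
  anyF-elim {zero} f ()
  anyF-elim {suc n} f e with f zero in eq
  ... | true = zero , eq
  ... | false = let (i , p) = anyF-elim (λ j → f (suc j)) e in suc i , p

  anyF-false : ∀ {n} (f : Fin n → Bool) → (∀ i → f i ≡ false) → anyF f ≡ false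
  anyF-false {zero} f e = refl
  anyF-false {suc n} f e rewrite e zero = anyF-false (λ i → f (suc i)) (e ∘ suc)

  sumF-cong : ∀ {n} {f g : Fin n → ℚ} → (∀ i → f i ≡ g i) → sumF f ≡ sumF g
  sumF-cong {zero} e = refl
  sumF-cong {suc n} e = cong₂ ℚ._+_ (e zero) (sumF-cong (e ∘ suc))

  sumF-sum : ∀ {n} (f : Fin n → ℚ) → sumF f ≡ QSum.sum f
  sumF-sum {zero} f = refl
  sumF-sum {suc n} f = cong (f zero ℚ.+_) (sumF-sum (λ i → f (suc i)))

  sumF-perm : ∀ {n} (f : Fin n → ℚ) (g h : Fin n → Fin n) →
    (∀ y → g (h y) ≡ y) → (∀ x → h (g x) ≡ x) → sumF f ≡ sumF (λ i → f (g i))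
  sumF-perm f g h e1 e2 = trans (sumF-sum f)
    (trans (QSum.sum-permute f (permutation g h e1 e2)) (sym (sumF-sum (λ i → f (g i)))))

  sumF-zero : ∀ {n} (f : Fin n → ℚ) → (∀ i → f i ≡ 0ℚ) → sumF f ≡ 0ℚ
  sumF-zero {zero} f e = refl
  sumF-zero {suc n} f e rewrite e zero = trans (QP.+-identityˡ _) (sumF-zero (λ i → f (suc i)) (e ∘ suc))

  sumF-+ : ∀ {n} (f g : Fin n → ℚ) → sumF (λ i → f i ℚ.+ g i) ≡ sumF f ℚ.+ sumF g
  sumF-+ {zero} f g = sym (QP.+-identityˡ 0ℚ)
  sumF-+ {suc n} f g = trans (cong ((f zero ℚ.+ g zero) ℚ.+_) (sumF-+ (λ i → f (suc i)) (λ i → g (suc i))))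
    (ℚ-interchange (f zero) (g zero) _ _)

  sumF-* : ∀ {n} (c : ℚ) (f : Fin n → ℚ) → sumF (λ i → c ℚ.* f i) ≡ c ℚ.* sumF f
  sumF-* {zero} c f = sym (QP.*-zeroʳ c)
  sumF-* {suc n} c f = trans (cong ((c ℚ.* f zero) ℚ.+_) (sumF-* c (λ i → f (suc i))))
    (sym (QP.*-distribˡ-+ c (f zero) _))

  sumF-*ʳ : ∀ {n} (c : ℚ) (f : Fin n → ℚ) → sumF (λ i → f i ℚ.* c) ≡ sumF f ℚ.* c
  sumF-*ʳ c f = trans (sumF-cong (λ i → QP.*-comm (f i) c)) (trans (sumF-* c f) (QP.*-comm c _))

  sumF-swap : ∀ {n m} (f : Fin n → Fin m → ℚ) →
    sumF (λ i → sumF (λ j → f i j)) ≡ sumF (λ j → sumF (λ i → f i j))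
  sumF-swap {zero} {m} f = sym (sumF-zero (λ j → sumF (λ i → f i j)) (λ j → refl))
  sumF-swap {suc n} {m} f = trans (cong (sumF (f zero) ℚ.+_) (sumF-swap (λ i → f (suc i))))
    (sym (sumF-+ (f zero) (λ j → sumF (λ i → f (suc i) j))))

  sumF-point : ∀ {n} (c : Fin n) (f : Fin n → ℚ) → sumF (λ z → if c == z then f z else 0ℚ) ≡ f c
  sumF-point {suc n} zero f = trans (cong (f zero ℚ.+_) (sumF-zero (λ i → if zero == suc i then f (suc i) else 0ℚ) (λ i → refl))) (QP.+-identityʳ _)
  sumF-point {suc n} (suc c) f = trans (QP.+-identityˡ _) (trans (sumF-cong (λ i → cong (λ b → if b then f (suc i) else 0ℚ) (==-suc c i))) (sumF-point {n} c (λ i → f (suc i))))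

-- The embedding ι : ℤ → ℚ is a ring homomorphism; the polynomial coefficients are
-- computed in ℤ and transported to ℚ along ι.
module RationalEmbedding where

  open import Data.Nat as ℕ using (ℕ; suc)
  open import Data.Integer as ℤ using (ℤ; +_; -[1+_])
  import Data.Integer.Properties as ZP
  open import Data.Rational as ℚ using (ℚ; 0ℚ; 1ℚ)
  import Data.Rational.Properties as QP
  open import Data.Rational.Unnormalised as ℚᵘ using (ℚᵘ; mkℚᵘ; *≡*) renaming (_≃_ to _≃ᵘ_)
  import Data.Rational.Unnormalised.Properties as UP
  import Data.Nat.Coprimality as Cop
  open import Relation.Binary.PropositionalEquality
  open import Data.Integer.Tactic.RingSolver
  open import Relation.Nullary using (¬_)
  open import Defs using (fromℕ; invFact)
  import Data.Nat.Properties

  ι : ℤ → ℚ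
  ι z = z ℚ./ 1

  ι-ᵘ : ∀ z → ℚ.toℚᵘ (ι z) ≃ᵘ mkℚᵘ z 0
  ι-ᵘ (+ n) = UP.≃-reflexive (cong ℚ.toℚᵘ (QP.normalize-coprime {n} {0} (Cop.sym (Cop.1-coprimeTo n))))
  ι-ᵘ -[1+ n ] = UP.≃-reflexive (cong (λ q → ℚ.toℚᵘ (ℚ.- q)) (QP.normalize-coprime {suc n} {0} (Cop.sym (Cop.1-coprimeTo (suc n)))))

  ι-+ : ∀ a b → ι (a ℤ.+ b) ≡ ι a ℚ.+ ι b
  ι-+ a b = QP.toℚᵘ-injective (UP.≃-trans (ι-ᵘ (a ℤ.+ b))
    (UP.≃-trans e (UP.≃-sym (UP.≃-trans (QP.toℚᵘ-homo-+ (ι a) (ι b)) (UP.+-cong (ι-ᵘ a) (ι-ᵘ b))))))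
    where
    e : mkℚᵘ (a ℤ.+ b) 0 ≃ᵘ (mkℚᵘ a 0 ℚᵘ.+ mkℚᵘ b 0)
    e = *≡* (trans (ZP.*-identityʳ _) (sym (trans (ZP.*-identityʳ _) (cong₂ ℤ._+_ (ZP.*-identityʳ a) (ZP.*-identityʳ b)))))

  ι-* : ∀ a b → ι (a ℤ.* b) ≡ ι a ℚ.* ι b
  ι-* a b = QP.toℚᵘ-injective (UP.≃-trans (ι-ᵘ (a ℤ.* b))
    (UP.≃-sym (UP.≃-trans (QP.toℚᵘ-homo-* (ι a) (ι b)) (UP.*-cong (ι-ᵘ a) (ι-ᵘ b)))))

  ι-neg : ∀ a → ι (ℤ.- a) ≡ ℚ.- ι a
  ι-neg a = QP.toℚᵘ-injective (UP.≃-trans (ι-ᵘ (ℤ.- a))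
    (UP.≃-sym (UP.≃-trans (QP.toℚᵘ-homo‿- (ι a)) (UP.-‿cong (ι-ᵘ a)))))

  ι-nz : ∀ a → ¬ a ≡ + 0 → ¬ ι a ≡ 0ℚ
  ι-nz a ne e with UP.≃-trans (UP.≃-sym (ι-ᵘ a)) (UP.≃-reflexive (cong ℚ.toℚᵘ e))
  ... | *≡* eq = ne (trans (sym (ZP.*-identityʳ a)) eq)

  private
    L : ∀ m .{{_ : ℕ.NonZero m}} → ((+ 1) ℚ./ m) ℚ.* ι (+ m) ≡ 1ℚ
    L (suc m') = QP.toℚᵘ-injective (UP.≃-trans (QP.toℚᵘ-homo-* ((+ 1) ℚ./ suc m') (ι (+ suc m')))
      (UP.≃-trans (UP.*-cong (UP.≃-reflexive (cong ℚ.toℚᵘ (QP.normalize-coprime {1} {m'} (Cop.1-coprimeTo (suc m'))))) (ι-ᵘ (+ suc m')))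
        (*≡* (trans (ZP.*-identityʳ _) (trans (ZP.*-identityˡ (+ suc m')) (cong +_ (sym (trans (ℕP.*-identityˡ _) (ℕP.*-identityʳ _)))))))))
      where import Data.Nat.Properties as ℕP

  fact-inv : ∀ i → invFact i ℚ.* fromℕ (i ℕ.!) ≡ 1ℚ
  fact-inv i = L (i ℕ.!) {{i Data.Nat.Properties.!≢0}}

module CayleyGraphs {n : ℕ} (_∙_ : Fin n → Fin n → Fin n) (ε : Fin n) (_⁻¹ : Fin n → Fin n)
  (isAG : IsAbelianGroup _≡_ _∙_ ε _⁻¹) where
  open import Data.Nat as ℕ using (ℕ; zero; suc; _+_; _≤_; _<_; _∸_)
  open import Data.Fin using (Fin; zero; suc; _≟_)
  open import Algebra.Structures using (IsAbelianGroup)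
  open import Relation.Binary.PropositionalEquality

  open import Defs
  open FinSums
  import Data.Nat.Properties as NP
  open import Data.Bool using (Bool; true; false; _∧_; _∨_; not; if_then_else_)
  open import Data.Product
  open import Data.Sum
  open import Function using (_∘_)
  open import Relation.Nullary using (¬_; yes; no)
  import Relation.Nullary
  open import Data.Empty using (⊥-elim; ⊥)
  open import Algebra.Bundles using (AbelianGroup)
  import Algebra.Properties.Group as GP

  open Grp _∙_ ε _⁻¹ public
  open IsAbelianGroup isAG using (assoc; comm; identityˡ; identityʳ; inverseˡ; inverseʳ) public

  private
    AG : AbelianGroup _ _
    AG = record { isAbelianGroup = isAG }
    module G = GP (AbelianGroup.group AG)

  inv-inv : ∀ x → (x ⁻¹) ⁻¹ ≡ x
  inv-inv = G.⁻¹-involutive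

  inv-uniqueʳ : ∀ x y → x ∙ y ≡ ε → y ≡ x ⁻¹
  inv-uniqueʳ = G.inverseʳ-unique

  lcomm : ∀ x y z → x ∙ (y ∙ z) ≡ y ∙ (x ∙ z)
  lcomm x y z = trans (sym (assoc x y z)) (trans (cong (_∙ z) (comm x y)) (assoc y x z))

  rcomm : ∀ x y z → (x ∙ y) ∙ z ≡ (x ∙ z) ∙ y
  rcomm x y z = trans (assoc x y z) (trans (cong (x ∙_) (comm y z)) (sym (assoc x z y)))

  cancelˡ : ∀ x y → (x ⁻¹) ∙ (x ∙ y) ≡ y
  cancelˡ x y = trans (sym (assoc _ _ _)) (trans (cong (_∙ y) (inverseˡ x)) (identityˡ y))

  cancelˡ' : ∀ x y → x ∙ ((x ⁻¹) ∙ y) ≡ y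
  cancelˡ' x y = trans (sym (assoc _ _ _)) (trans (cong (_∙ y) (inverseʳ x)) (identityˡ y))

  cancelʳ : ∀ x y → (x ∙ y) ∙ (y ⁻¹) ≡ x
  cancelʳ x y = trans (assoc _ _ _) (trans (cong (x ∙_) (inverseʳ y)) (identityʳ x))

  cancelʳ' : ∀ x y → (x ∙ (y ⁻¹)) ∙ y ≡ x
  cancelʳ' x y = trans (assoc _ _ _) (trans (cong (x ∙_) (inverseˡ y)) (identityʳ x))

  ∨-introˡ : ∀ {a} b → a ≡ true → a ∨ b ≡ true
  ∨-introˡ b refl = refl

  ∨-introʳ : ∀ a {b} → b ≡ true → a ∨ b ≡ true
  ∨-introʳ false refl = refl
  ∨-introʳ true refl = refl

  ∨-elim : ∀ a b → a ∨ b ≡ true → a ≡ true ⊎ b ≡ true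
  ∨-elim true b e = inj₁ refl
  ∨-elim false b e = inj₂ e

  ∧-intro : ∀ {a b} → a ≡ true → b ≡ true → a ∧ b ≡ true
  ∧-intro refl refl = refl

  ∧-elimˡ : ∀ a b → a ∧ b ≡ true → a ≡ true
  ∧-elimˡ true b e = refl

  ∧-elimʳ : ∀ a b → a ∧ b ≡ true → b ≡ true
  ∧-elimʳ true b e = e

  not-true : ∀ {a} → not a ≡ true → a ≡ false
  not-true {false} e = refl

  not-false : ∀ {a} → a ≡ false → not a ≡ true
  not-false refl = refl

  bcase : ∀ {ℓ} {A : Set ℓ} (b : Bool) → (b ≡ true → A) → (b ≡ false → A) → A
  bcase true f g = f refl
  bcase false f g = g refl

  decCase : ∀ {a b} {A : Set a} {B : Set b} → Relation.Nullary.Dec A → (A → B) → (¬ A → B) → B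
  decCase (yes p) f g = f p
  decCase (no p) f g = g p

  bool-ext : ∀ {a b} → (a ≡ true → b ≡ true) → (b ≡ true → a ≡ true) → a ≡ b
  bool-ext {false} {false} f g = refl
  bool-ext {false} {true} f g = g refl
  bool-ext {true} {false} f g = sym (f refl)
  bool-ext {true} {true} f g = refl

  ∧-elim : ∀ {a b} → a ∧ b ≡ true → a ≡ true × b ≡ true
  ∧-elim {true} {true} e = refl , refl

  true≢false : ∀ {a} → a ≡ true → a ≡ false → ⊥
  true≢false refl ()

  module Cay (T : Fin n → Bool) where

    record R (k : ℕ) (x y : Fin n) : Set where
      constructor mkR
      field unR : Reach T k x y ≡ true
    open R public

    record Dist (x y : Fin n) (m : ℕ) : Set where
      constructor mkD
      field unD : IsDist T x y m ≡ true
    open Dist public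

    Adj-intro : ∀ {t} z → T t ≡ true → Adj T z (z ∙ t) ≡ true
    Adj-intro {t} z e = anyF-intro (λ u → T u ∧ ((z ∙ t) == (z ∙ u))) t (∧-intro e (==-refl _))

    Adj-intro' : ∀ {t z y} → T t ≡ true → y ≡ z ∙ t → Adj T z y ≡ true
    Adj-intro' {z = z} e refl = Adj-intro z e

    Adj-elim : ∀ {z y} → Adj T z y ≡ true → Σ (Fin n) (λ t → T t ≡ true × y ≡ z ∙ t)
    Adj-elim {z} {y} e =
      let (t , p) = anyF-elim (λ u → T u ∧ (y == (z ∙ u))) e
      in t , ∧-elimˡ _ _ p , ==-sound (∧-elimʳ _ _ p)

    R-refl : ∀ k x → R k x x
    R-refl zero x = mkR (==-refl x)
    R-refl (suc k) x = mkR (∨-introˡ _ (unR (R-refl k x)))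

    R-suc : ∀ {k x y} → R k x y → R (suc k) x y
    R-suc (mkR e) = mkR (∨-introˡ _ e)

    R-mono : ∀ {k k' x y} → k ≤ k' → R k x y → R k' x y
    R-mono {k} {k'} {x} {y} le e with NP.m≤n⇒∃[o]m+o≡n le
    ... | o , refl = go o
      where
      go : ∀ o → R (k + o) x y
      go zero = subst (λ j → R j x y) (sym (NP.+-identityʳ k)) e
      go (suc o) = subst (λ j → R j x y) (sym (NP.+-suc k o)) (R-suc (go o))

    R-step : ∀ {k x z y} → R k x z → Adj T z y ≡ true → R (suc k) x y
    R-step {k} {x} {z} {y} (mkR e) a = mkR (∨-introʳ _ (anyF-intro (λ w → Reach T k x w ∧ Adj T w y) z (∧-intro e a)))

    R-inv : ∀ {k x y} → R (suc k) x y → R k x y ⊎ Σ (Fin n) (λ z → R k x z × Adj T z y ≡ true)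
    R-inv {k} {x} {y} (mkR e) with ∨-elim _ _ e
    ... | inj₁ p = inj₁ (mkR p)
    ... | inj₂ p = let (z , q) = anyF-elim (λ w → Reach T k x w ∧ Adj T w y) p
                   in inj₂ (z , mkR (∧-elimˡ _ _ q) , ∧-elimʳ _ _ q)

    R-zero : ∀ {x y} → R 0 x y → x ≡ y
    R-zero (mkR e) = ==-sound e

    R-trans : ∀ {a b x y z} → R a x y → R b y z → R (a + b) x z
    R-trans {a} {zero} {x} e1 e2 with R-zero e2
    ... | refl = subst (λ j → R j x _) (sym (NP.+-identityʳ a)) e1
    R-trans {a} {suc b} {x} {y} {z} e1 e2 with R-inv e2
    ... | inj₁ p = subst (λ j → R j x z) (sym (NP.+-suc a b)) (R-suc (R-trans e1 p))
    ... | inj₂ (w , p , q) = subst (λ j → R j x z) (sym (NP.+-suc a b)) (R-step (R-trans e1 p) q)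

    Adj-transl : ∀ g {z y} → Adj T z y ≡ true → Adj T (g ∙ z) (g ∙ y) ≡ true
    Adj-transl g e with Adj-elim e
    ... | t , p , refl = Adj-intro' p (sym (assoc g _ t))

    R-transl : ∀ g {k x y} → R k x y → R k (g ∙ x) (g ∙ y)
    R-transl g {zero} e with R-zero e
    ... | refl = R-refl 0 _
    R-transl g {suc k} e with R-inv e
    ... | inj₁ p = R-suc (R-transl g p)
    ... | inj₂ (z , p , q) = R-step (R-transl g p) (Adj-transl g q)

    R-transl⁻ : ∀ g {k x y} → R k (g ∙ x) (g ∙ y) → R k x y
    R-transl⁻ g {k} {x} {y} e = subst₂ (R k) (cancelˡ g x) (cancelˡ g y) (R-transl (g ⁻¹) e)

    Dist-R : ∀ {x y m} → Dist x y m → R m x y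
    Dist-R {m = zero} (mkD e) = mkR e
    Dist-R {m = suc m} (mkD e) = mkR (∧-elimˡ _ _ e)

    Dist-min : ∀ {x y m j} → Dist x y m → R j x y → m ≤ j
    Dist-min {m = zero} e r = ℕ.z≤n
    Dist-min {x} {y} {m = suc m} {j} (mkD e) r with suc m ℕ.≤? j
    ... | yes p = p
    ... | no p = ⊥-elim (true≢false (unR (R-mono (NP.≤-pred (NP.≰⇒> p)) r)) (not-true (∧-elimʳ _ _ e)))

    Dist-intro : ∀ {x y m} → R m x y → (∀ j → R j x y → m ≤ j) → Dist x y m
    Dist-intro {m = zero} (mkR r) h = mkD r
    Dist-intro {x} {y} {m = suc m} (mkR r) h = bcase (Reach T m x y)
      (λ eq → ⊥-elim (NP.1+n≰n (h m (mkR eq))))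
      (λ eq → mkD (∧-intro r (not-false eq)))

    Dist-exists : ∀ {k x y} → R k x y → Σ ℕ (λ m → m ≤ k × Dist x y m)
    Dist-exists {zero} (mkR e) = 0 , ℕ.z≤n , mkD e
    Dist-exists {suc k} {x} {y} (mkR e) = bcase (Reach T k x y)
      (λ eq → let (m , le , d) = Dist-exists {k} (mkR eq) in m , NP.m≤n⇒m≤1+n le , d)
      (λ eq → suc k , NP.≤-refl , mkD (∧-intro e (not-false eq)))

    Dist-unique : ∀ {x y m m'} → Dist x y m → Dist x y m' → m ≡ m'
    Dist-unique d d' = NP.≤-antisym (Dist-min d (Dist-R d')) (Dist-min d' (Dist-R d))

    Dist-other : ∀ {x y m m'} → Dist x y m → ¬ m' ≡ m → IsDist T x y m' ≡ false
    Dist-other {x} {y} {m} {m'} d ne = bcase (IsDist T x y m')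
      (λ eq → ⊥-elim (ne (Dist-unique (mkD eq) d))) (λ eq → eq)

    Dist-transl : ∀ g {x y m} → Dist x y m → Dist (g ∙ x) (g ∙ y) m
    Dist-transl g d = Dist-intro (R-transl g (Dist-R d)) (λ j r → Dist-min d (R-transl⁻ g r))

    Dist-transl⁻ : ∀ g {x y m} → Dist (g ∙ x) (g ∙ y) m → Dist x y m
    Dist-transl⁻ g d = Dist-intro (R-transl⁻ g (Dist-R d)) (λ j r → Dist-min d (R-transl g r))

    IsDist-transl : ∀ g x y m → IsDist T (g ∙ x) (g ∙ y) m ≡ IsDist T x y m
    IsDist-transl g x y m = bcase (IsDist T x y m)
      (λ eq1 → trans (unD (Dist-transl g {x} {y} {m} (mkD eq1))) (sym eq1))
      (λ eq1 → bcase (IsDist T (g ∙ x) (g ∙ y) m)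
         (λ eq2 → ⊥-elim (true≢false (unD (Dist-transl⁻ g {x} {y} {m} (mkD eq2))) eq1))
         (λ eq2 → trans eq2 (sym eq1)))

    Dist-pred : ∀ {x z m} → Dist x z (suc m) → Σ (Fin n) (λ w → Dist x w m × Adj T w z ≡ true)
    Dist-pred {x} {z} {m} d with R-inv (Dist-R d)
    ... | inj₁ p = ⊥-elim (NP.1+n≰n (Dist-min d p))
    ... | inj₂ (w , p , a) = w , Dist-intro p (λ j r → NP.≤-pred (Dist-min d (R-step r a))) , a

    Dist-prefix : ∀ {x z m m'} → Dist x z m → m' ≤ m → Σ (Fin n) (λ w → Dist x w m')
    Dist-prefix {x} {z} {m} {m'} d le with NP.m≤n⇒∃[o]m+o≡n le
    ... | o , refl = go o z d
      where
      go : ∀ o z → Dist x z (m' + o) → Σ (Fin n) (λ w → Dist x w m')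
      go zero z d = z , subst (Dist x z) (NP.+-identityʳ m') d
      go (suc o) z d = let (w , dw , _) = Dist-pred (subst (Dist x z) (NP.+-suc m' o) d) in go o w dw

    module Sym (Tinv : ∀ t → T t ≡ true → T (t ⁻¹) ≡ true) where

      Adj-sym : ∀ {z y} → Adj T z y ≡ true → Adj T y z ≡ true
      Adj-sym e with Adj-elim e
      ... | t , p , refl = Adj-intro' (Tinv t p) (sym (cancelʳ _ t))

      R-sym : ∀ {k x y} → R k x y → R k y x
      R-sym {zero} e = mkR (==-true (sym (R-zero e)))
      R-sym {suc k} e with R-inv e
      ... | inj₁ p = R-suc (R-sym p)
      ... | inj₂ (z , p , q) = R-trans {1} (R-step (R-refl 0 _) (Adj-sym q)) (R-sym p)

      Adj-back : ∀ v u → Adj T (v ∙ u) v ≡ T u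
      Adj-back v u = bool-ext to fro
        where
        to : Adj T (v ∙ u) v ≡ true → T u ≡ true
        to a with Adj-elim a
        ... | t , tT , e = subst (λ z → T z ≡ true) (trans (cong _⁻¹ tu) (inv-inv u)) (Tinv t tT)
          where
          ut : u ∙ t ≡ ε
          ut = trans (sym (cancelˡ v (u ∙ t))) (trans (cong ((v ⁻¹) ∙_) (trans (sym (assoc v u t)) (sym e))) (inverseˡ v))
          tu : t ≡ u ⁻¹
          tu = inv-uniqueʳ u t ut
        fro : T u ≡ true → Adj T (v ∙ u) v ≡ true
        fro e = Adj-intro' (Tinv u e) (sym (cancelʳ v u))

      nbr-count : ∀ (f : Fin n → Bool) v → countF (λ z → f z ∧ Adj T z v) ≡ countF (λ u → T u ∧ f (v ∙ u))
      nbr-count f v = trans (countF-perm (λ z → f z ∧ Adj T z v) (v ∙_) ((v ⁻¹) ∙_) (cancelˡ' v) (cancelˡ v))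
        (countF-cong (λ u → trans (cong (f (v ∙ u) ∧_) (Adj-back v u)) (∧-comm (f (v ∙ u)) (T u))))
        where open import Data.Bool.Properties using (∧-comm)

module WalkDecomposition {n : ℕ} (_∙_ : Fin n → Fin n → Fin n) (ε : Fin n) (_⁻¹ : Fin n → Fin n)
  (isAG : IsAbelianGroup _≡_ _∙_ ε _⁻¹)
  (S : Fin n → Bool) (Sε : S ε ≡ false) (Sinv : ∀ g → S g ≡ true → S (g ⁻¹) ≡ true)
  (s : Fin n) (Ss : S s ≡ true) (Hs : Fin n → Bool)
  (H→gen : ∀ g → Hs g ≡ true → Grp.InGen _∙_ ε _⁻¹ (Grp.remove± _∙_ ε _⁻¹ S s) g)
  (gen→H : ∀ g → Grp.InGen _∙_ ε _⁻¹ (Grp.remove± _∙_ ε _⁻¹ S s) g → Hs g ≡ true)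
  (notAll : Σ (Fin n) (λ g → Hs g ≡ false))
  (ord4 : Grp.HasOrder _∙_ ε _⁻¹ s 4)
  (conn : Grp.Connected _∙_ ε _⁻¹ S)
  where
  open import Data.Nat as ℕ using (ℕ; zero; suc; _+_; _≤_; _<_; _∸_)
  open import Data.Fin using (Fin; zero; suc; _≟_)
  open import Algebra.Structures using (IsAbelianGroup)
  open import Relation.Binary.PropositionalEquality
  open import Data.Bool using (Bool; true; false; _∧_; _∨_; not; if_then_else_)
  open import Data.Product
  open import Defs

  open CayleyGraphs _∙_ ε _⁻¹ isAG public
  open FinSums
  import Data.Nat.Properties as NP
  open import Data.Sum
  open import Function using (_∘_)
  open import Relation.Nullary using (¬_)
  open import Data.Empty using (⊥-elim; ⊥)

  S0 : Fin n → Bool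
  S0 = remove± S s

  module C = Cay S
  module C0 = Cay S0

  s2 : Fin n
  s2 = s ∙ s

  pow4 : s ∙ (s ∙ s2) ≡ ε
  pow4 = trans (cong (λ z → s ∙ (s ∙ (s ∙ z))) (sym (identityʳ s))) (proj₁ ord4)

  s4 : s2 ∙ s2 ≡ ε
  s4 = trans (assoc s s s2) pow4

  s⁻¹≡ : s ⁻¹ ≡ s ∙ s2
  s⁻¹≡ = begin
    s ⁻¹ ≡⟨ sym (identityʳ _) ⟩
    (s ⁻¹) ∙ ε ≡⟨ cong ((s ⁻¹) ∙_) (sym pow4) ⟩
    (s ⁻¹) ∙ (s ∙ (s ∙ s2)) ≡⟨ cancelˡ s _ ⟩
    s ∙ s2 ∎
    where open ≡-Reasoning

  s2≢ε : ¬ s2 ≡ ε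
  s2≢ε e = proj₂ (proj₂ ord4) 2 (ℕ.s≤s ℕ.z≤n) (ℕ.s≤s (ℕ.s≤s (ℕ.s≤s ℕ.z≤n)))
    (trans (cong (s ∙_) (identityʳ s)) e)

  s≢s⁻¹ : ¬ s ≡ s ⁻¹
  s≢s⁻¹ e = s2≢ε (trans (cong (s ∙_) e) (inverseʳ s))

  s⁻¹s⁻¹ : (s ⁻¹) ∙ (s ⁻¹) ≡ s2
  s⁻¹s⁻¹ = begin
    (s ⁻¹) ∙ (s ⁻¹) ≡⟨ cong₂ _∙_ s⁻¹≡ s⁻¹≡ ⟩
    (s ∙ s2) ∙ (s ∙ s2) ≡⟨ assoc s s2 _ ⟩
    s ∙ (s2 ∙ (s ∙ s2)) ≡⟨ cong (s ∙_) (lcomm s2 s s2) ⟩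
    s ∙ (s ∙ (s2 ∙ s2)) ≡⟨ cong (λ z → s ∙ (s ∙ z)) s4 ⟩
    s ∙ (s ∙ ε) ≡⟨ cong (s ∙_) (identityʳ s) ⟩
    s2 ∎
    where open ≡-Reasoning

  S0⊆S : ∀ t → S0 t ≡ true → S t ≡ true
  S0⊆S t e = ∧-elimˡ _ _ e

  S0-s : S0 s ≡ false
  S0-s with S s
  ... | true = cong (λ b → not b ∧ not (s == (s ⁻¹))) (==-refl s)
  ... | false = refl

  S0-intro : ∀ t → S t ≡ true → ¬ t ≡ s → ¬ t ≡ s ⁻¹ → S0 t ≡ true
  S0-intro t e p q = ∧-intro e (∧-intro (not-false (==-false p)) (not-false (==-false q)))

  S-split : ∀ t → S t ≡ true → S0 t ≡ true ⊎ (t ≡ s ⊎ t ≡ s ⁻¹)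
  S-split t e = decCase (t ≟ s) (λ p → inj₂ (inj₁ p))
    (λ p → decCase (t ≟ (s ⁻¹)) (λ q → inj₂ (inj₂ q)) (λ q → inj₁ (S0-intro t e p q)))

  S0-ne-s : ∀ t → S0 t ≡ true → ¬ t ≡ s
  S0-ne-s t e refl = true≢false e S0-s

  S0-ne-s⁻¹ : ∀ t → S0 t ≡ true → ¬ t ≡ s ⁻¹
  S0-ne-s⁻¹ t e refl = true≢false (==-true {a = s ⁻¹} refl) (not-true (∧-elimʳ (not ((s ⁻¹) == s)) _ (∧-elimʳ (S (s ⁻¹)) _ e)))

  S0inv : ∀ t → S0 t ≡ true → S0 (t ⁻¹) ≡ true
  S0inv t e = S0-intro (t ⁻¹) (Sinv t (S0⊆S t e))
    (λ p → S0-ne-s⁻¹ t e (trans (sym (inv-inv t)) (cong _⁻¹ p)))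
    (λ p → S0-ne-s t e (trans (sym (inv-inv t)) (trans (cong _⁻¹ p) (inv-inv s))))

  module CS = C.Sym Sinv
  module CS0 = C0.Sym S0inv

  H-mul : ∀ {x y} → Hs x ≡ true → Hs y ≡ true → Hs (x ∙ y) ≡ true
  H-mul {x} {y} a b = gen→H _ (gen-mul (H→gen x a) (H→gen y b))

  H-inv : ∀ {x} → Hs x ≡ true → Hs (x ⁻¹) ≡ true
  H-inv {x} a = gen→H _ (gen-inv (H→gen x a))

  H-ε : Hs ε ≡ true
  H-ε = gen→H _ gen-e

  H-S0 : ∀ {t} → S0 t ≡ true → Hs t ≡ true
  H-S0 {t} e = gen→H t (gen-gen e)

  H-div : ∀ {x y} → Hs x ≡ true → Hs (x ∙ y) ≡ true → Hs y ≡ true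
  H-div {x} {y} a b = subst (λ z → Hs z ≡ true) (cancelˡ x y) (H-mul (H-inv a) b)

  -- s ∉ H, since otherwise S ⊆ H and connectivity of Γ would force H = G
  s∉H : Hs s ≡ false
  s∉H = bcase (Hs s) (λ hs → ⊥-elim (contra hs)) (λ e → e)
    where
    contra : Hs s ≡ true → ⊥
    contra hs = true≢false (reach _ (C.Dist-R {ε} {g} {proj₁ (conn ε g)} (C.mkD (proj₂ (conn ε g))))) hg
      where
      g : Fin n
      g = proj₁ notAll
      hg : Hs g ≡ false
      hg = proj₂ notAll
      HS : ∀ t → S t ≡ true → Hs t ≡ true
      HS t e with S-split t e
      ... | inj₁ p = H-S0 p
      ... | inj₂ (inj₁ refl) = hs
      ... | inj₂ (inj₂ refl) = H-inv hs
      reach : ∀ k {y} → C.R k ε y → Hs y ≡ true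
      reach zero r with C.R-zero r
      ... | refl = H-ε
      reach (suc k) r with C.R-inv r
      ... | inj₁ p = reach k p
      ... | inj₂ (z , p , q) with C.Adj-elim q
      ... | t , tS , refl = H-mul (reach k p) (HS t tS)

  Hs-s : ∀ {w} → Hs w ≡ true → Hs (w ∙ s) ≡ false
  Hs-s {w} hw = bcase (Hs (w ∙ s)) (λ e → ⊥-elim (true≢false (H-div hw e) s∉H)) (λ e → e)

  Hs-s⁻¹ : ∀ {w} → Hs w ≡ true → Hs (w ∙ (s ⁻¹)) ≡ false
  Hs-s⁻¹ {w} hw = bcase (Hs (w ∙ (s ⁻¹)))
    (λ e → ⊥-elim (true≢false (subst (λ z → Hs z ≡ true) (inv-inv s) (H-inv (H-div hw e))) s∉H)) (λ e → e)

  C0⊆C : ∀ {k x y} → C0.R k x y → C.R k x y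
  C0⊆C {zero} (C0.mkR r) = C.mkR r
  C0⊆C {suc k} r with C0.R-inv r
  ... | inj₁ p = C.R-suc (C0⊆C p)
  ... | inj₂ (z , p , q) with C0.Adj-elim q
  ... | t , tS , refl = C.R-step (C0⊆C p) (C.Adj-intro z (S0⊆S t tS))

  H-reach : ∀ {k x y} → Hs x ≡ true → C0.R k x y → Hs y ≡ true
  H-reach {zero} hx r with C0.R-zero r
  ... | refl = hx
  H-reach {suc k} hx r with C0.R-inv r
  ... | inj₁ p = H-reach hx p
  ... | inj₂ (z , p , q) with C0.Adj-elim q
  ... | t , tS , refl = H-mul (H-reach hx p) (H-S0 tS)

  -- the four elements 1, s, s², s⁻¹ = s³ of ⟨s⟩, and the number of s-steps each costs
  data Offset : Set where
    q0 q1 q2 q3 : Offset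

  offset : Offset → Fin n
  offset q0 = ε
  offset q1 = s
  offset q2 = s2
  offset q3 = s ⁻¹

  cost : Offset → ℕ
  cost q0 = 0
  cost q1 = 1
  cost q2 = 2
  cost q3 = 1

  up down : Offset → Offset
  up q0 = q1
  up q1 = q2
  up q2 = q3
  up q3 = q0
  down q0 = q3
  down q1 = q0
  down q2 = q1
  down q3 = q2

  up-cost : ∀ q → cost (up q) ≤ suc (cost q)
  up-cost q0 = ℕ.s≤s ℕ.z≤n
  up-cost q1 = ℕ.s≤s (ℕ.s≤s ℕ.z≤n)
  up-cost q2 = ℕ.s≤s ℕ.z≤n
  up-cost q3 = ℕ.z≤n

  down-cost : ∀ q → cost (down q) ≤ suc (cost q)
  down-cost q0 = ℕ.s≤s ℕ.z≤n
  down-cost q1 = ℕ.z≤n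
  down-cost q2 = ℕ.s≤s ℕ.z≤n
  down-cost q3 = ℕ.s≤s (ℕ.s≤s ℕ.z≤n)

  up-eq : ∀ z q → (z ∙ (s ⁻¹)) ∙ offset (up q) ≡ z ∙ offset q
  up-eq z q0 = trans (cancelʳ' z s) (sym (identityʳ z))
  up-eq z q1 = trans (assoc z _ _) (cong (z ∙_) (cancelˡ s s))
  up-eq z q2 = trans (assoc z _ _) (cong (z ∙_) s⁻¹s⁻¹)
  up-eq z q3 = identityʳ _

  down-eq : ∀ z q → (z ∙ s) ∙ offset (down q) ≡ z ∙ offset q
  down-eq z q0 = trans (cancelʳ z s) (sym (identityʳ z))
  down-eq z q1 = identityʳ _
  down-eq z q2 = assoc z s s
  down-eq z q3 = trans (assoc z s s2) (cong (z ∙_) (sym s⁻¹≡))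

  decomp : ∀ {k x y} → C.R k x y →
    Σ Offset (λ q → Σ ℕ (λ j → C0.R j x (y ∙ offset q) × j + cost q ≤ k))
  decomp {zero} {x} r with C.R-zero r
  ... | refl = q0 , 0 , subst (C0.R 0 x) (sym (identityʳ x)) (C0.R-refl 0 x) , ℕ.z≤n
  decomp {suc k} r with C.R-inv r
  ... | inj₁ p = let (q , j , r0 , le) = decomp p in q , j , r0 , NP.m≤n⇒m≤1+n le
  ... | inj₂ (z , p , a) with C.Adj-elim a | decomp p
  ... | t , tS , refl | q , j , r0 , le with S-split t tS
  ... | inj₁ t0 = q , suc j , C0.R-step r0 (C0.Adj-intro' t0 (rcomm z t (offset q))) , ℕ.s≤s le
  ... | inj₂ (inj₁ refl) = down q , j , subst (C0.R j _) (sym (down-eq z q)) r0 ,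
        NP.≤-trans (NP.+-monoʳ-≤ j (down-cost q)) (NP.≤-trans (NP.≤-reflexive (NP.+-suc j (cost q))) (ℕ.s≤s le))
  ... | inj₂ (inj₂ refl) = up q , j , subst (C0.R j _) (sym (up-eq z q)) r0 ,
        NP.≤-trans (NP.+-monoʳ-≤ j (up-cost q)) (NP.≤-trans (NP.≤-reflexive (NP.+-suc j (cost q))) (ℕ.s≤s le))

  walk-within-H : ∀ {k x w} → Hs x ≡ true → Hs w ≡ true → C.R k x w →
    C0.R k x w ⊎ (2 ≤ k × C0.R (k ∸ 2) x (w ∙ s2))
  walk-within-H {k} {x} {w} hx hw r with decomp r
  ... | q0 , j , r0 , le = inj₁ (C0.R-mono (NP.≤-trans (NP.m≤m+n j 0) le) (subst (C0.R j x) (identityʳ w) r0))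
  ... | q1 , j , r0 , le = ⊥-elim (true≢false (H-reach hx r0) (Hs-s hw))
  ... | q2 , j , r0 , le = inj₂ (NP.≤-trans (NP.m≤n+m 2 j) le ,
        C0.R-mono (NP.≤-trans (NP.≤-reflexive (sym (NP.m+n∸n≡m j 2))) (NP.∸-monoˡ-≤ 2 le)) r0)
  ... | q3 , j , r0 , le = ⊥-elim (true≢false (H-reach hx r0) (Hs-s⁻¹ hw))

  walk-to-coset : ∀ {k x w} → Hs x ≡ true → Hs w ≡ true → C.R k x (w ∙ s) →
    1 ≤ k × (C0.R (k ∸ 1) x w ⊎ C0.R (k ∸ 1) x (w ∙ s2))
  walk-to-coset {k} {x} {w} hx hw r with decomp r
  ... | q0 , j , r0 , le = ⊥-elim (true≢false (H-reach hx (subst (C0.R j x) (identityʳ _) r0)) (Hs-s hw))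
  ... | q1 , j , r0 , le = NP.≤-trans (NP.m≤n+m 1 j) le ,
        inj₂ (C0.R-mono (NP.≤-trans (NP.≤-reflexive (sym (NP.m+n∸n≡m j 1))) (NP.∸-monoˡ-≤ 1 le)) (subst (C0.R j x) (assoc w s s) r0))
  ... | q2 , j , r0 , le = ⊥-elim (true≢false (H-reach hx r0') (Hs-s⁻¹ hw))
    where
    r0' : C0.R j x (w ∙ (s ⁻¹))
    r0' = subst (C0.R j x) (trans (assoc w s s2) (cong (w ∙_) (sym s⁻¹≡))) r0
  ... | q3 , j , r0 , le = NP.≤-trans (NP.m≤n+m 1 j) le ,
        inj₁ (C0.R-mono (NP.≤-trans (NP.≤-reflexive (sym (NP.m+n∸n≡m j 1))) (NP.∸-monoˡ-≤ 1 le)) (subst (C0.R j x) (cancelʳ w s) r0))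

-- Now fix d = ∂₀(x₀, x₀ s²) and i with 2i ≤ d.  Since every detour through s²
-- costs d, short distances in Γ are computed in Γ₀ (part (iv) of the lemma).
module ShortDistances {n : ℕ} (_∙_ : Fin n → Fin n → Fin n) (ε : Fin n) (_⁻¹ : Fin n → Fin n)
  (isAG : IsAbelianGroup _≡_ _∙_ ε _⁻¹)
  (S : Fin n → Bool) (Sε : S ε ≡ false) (Sinv : ∀ g → S g ≡ true → S (g ⁻¹) ≡ true)
  (s : Fin n) (Ss : S s ≡ true) (Hs : Fin n → Bool)
  (H→gen : ∀ g → Hs g ≡ true → Grp.InGen _∙_ ε _⁻¹ (Grp.remove± _∙_ ε _⁻¹ S s) g)
  (gen→H : ∀ g → Grp.InGen _∙_ ε _⁻¹ (Grp.remove± _∙_ ε _⁻¹ S s) g → Hs g ≡ true)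
  (notAll : Σ (Fin n) (λ g → Hs g ≡ false))
  (ord4 : Grp.HasOrder _∙_ ε _⁻¹ s 4)
  (conn : Grp.Connected _∙_ ε _⁻¹ S)
  (d : ℕ) (x₀ : Fin n) (hx₀ : Hs x₀ ≡ true)
  (dx₀ : Grp.IsDist _∙_ ε _⁻¹ (Grp.remove± _∙_ ε _⁻¹ S s) x₀ (x₀ ∙ (s ∙ s)) d ≡ true)
  (i : ℕ) (2i≤d : i ℕ.+ i ≤ d)
  where
  open import Data.Nat as ℕ using (ℕ; zero; suc; _+_; _≤_; _<_; _∸_)
  open import Data.Fin using (Fin; zero; suc; _≟_)
  open import Algebra.Structures using (IsAbelianGroup)
  open import Relation.Binary.PropositionalEquality
  open import Data.Bool using (Bool; true; false; _∧_; _∨_; if_then_else_)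
  open import Data.Product
  open import Defs

  open WalkDecomposition _∙_ ε _⁻¹ isAG S Sε Sinv s Ss Hs H→gen gen→H notAll ord4 conn public
  open FinSums
  import Data.Nat.Properties as NP
  open import Data.Sum
  open import Function using (_∘_)
  open import Relation.Nullary using (¬_; yes; no)
  open import Data.Empty using (⊥-elim; ⊥)

  -- arithmetic: a walk through s² of length < m ≤ i+1 would be shorter than d
  even-detour-absurd : ∀ {j m} → j < m → m ≤ suc i → 2 ≤ j → d ≤ (j ∸ 2) + m → ⊥
  even-detour-absurd {suc (suc j')} {m} jm mi (ℕ.s≤s (ℕ.s≤s _)) dle = NP.<-irrefl refl (NP.≤-<-trans dle lt)
    where
    j'i : suc (suc j') ≤ i
    j'i = NP.≤-pred (NP.≤-trans jm mi)
    lt : j' + m < d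
    lt = NP.≤-<-trans (NP.+-monoʳ-≤ j' mi)
          (NP.<-≤-trans (NP.≤-reflexive (cong suc (NP.+-suc j' i)))
            (NP.≤-trans (NP.+-monoˡ-≤ i j'i) 2i≤d))

  -- the same for a detour that reaches the coset H s
  odd-detour-absurd : ∀ {j m} → j ≤ m → m ≤ i → 1 ≤ j → d ≤ (j ∸ 1) + m → ⊥
  odd-detour-absurd {suc j'} {m} jm mi (ℕ.s≤s _) dle = NP.<-irrefl refl (NP.≤-<-trans dle lt)
    where
    lt : j' + m < d
    lt = NP.<-≤-trans (NP.+-monoˡ-< m jm) (NP.≤-trans (NP.+-mono-≤ mi mi) 2i≤d)

  below-pred-absurd : ∀ {j m} → 1 ≤ j → m ≤ j ∸ 1 → ¬ (suc m ≤ j) → ⊥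
  below-pred-absurd {suc j} (ℕ.s≤s _) le nle = nle (ℕ.s≤s le)

  x₀-to-x₀s² : C0.Dist x₀ (x₀ ∙ s2) d
  x₀-to-x₀s² = C0.mkD dx₀

  s²∈H : Hs s2 ≡ true
  s²∈H = H-div hx₀ (H-reach hx₀ (C0.Dist-R x₀-to-x₀s²))

  dist₀-to-xs² : ∀ {x} → Hs x ≡ true → C0.Dist x (x ∙ s2) d
  dist₀-to-xs² {x} hx = subst₂ (λ a b → C0.Dist a b d) e1 e2 (C0.Dist-transl g x₀-to-x₀s²)
    where
    g = x ∙ (x₀ ⁻¹)
    e1 : g ∙ x₀ ≡ x
    e1 = cancelʳ' x x₀
    e2 : g ∙ (x₀ ∙ s2) ≡ x ∙ s2
    e2 = trans (sym (assoc g x₀ s2)) (cong (_∙ s2) e1)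

  -- a Γ₀-path from x to w followed by one from w s² back to x s² has length ≥ d
  detour-length : ∀ {x w j m} → Hs x ≡ true → C0.R j x w → C0.R m x (w ∙ s2) → d ≤ m + j
  detour-length {x} {w} {j} {m} hx r1 r2 = C0.Dist-min (dist₀-to-xs² hx) (C0.R-trans r2 r3)
    where
    r3 : C0.R j (w ∙ s2) (x ∙ s2)
    r3 = subst₂ (C0.R j) (comm s2 w) (comm s2 x) (C0.R-transl s2 (CS0.R-sym r1))

  s²s²≡ε : ∀ w → (w ∙ s2) ∙ s2 ≡ w
  s²s²≡ε w = trans (assoc w s2 s2) (trans (cong (w ∙_) s4) (identityʳ w))

  dist-within-H : ∀ {x w m} → Hs x ≡ true → Hs w ≡ true → C0.Dist x w m → m ≤ suc i → C.Dist x w m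
  dist-within-H {x} {w} {m} hx hw dm le = C.Dist-intro (C0⊆C (C0.Dist-R dm)) min
    where
    min : ∀ j → C.R j x w → m ≤ j
    min j r with m ℕ.≤? j
    ... | yes p = p
    ... | no p with walk-within-H hx hw r
    ... | inj₁ r0 = C0.Dist-min dm r0
    ... | inj₂ (two , r0) = ⊥-elim (even-detour-absurd (NP.≰⇒> p) le two (detour-length hx (C0.Dist-R dm) r0))

  dist-to-coset : ∀ {x w w' m} → Hs x ≡ true → Hs w ≡ true → C0.Dist x w m → m ≤ i →
    (w' ≡ w ⊎ w' ≡ w ∙ s2) → C.Dist x (w' ∙ s) (suc m)
  dist-to-coset {x} {w} {.w} {m} hx hw dm le (inj₁ refl) =
    C.Dist-intro (C.R-step (C0⊆C (C0.Dist-R dm)) (C.Adj-intro w Ss)) min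
    where
    min : ∀ j → C.R j x (w ∙ s) → suc m ≤ j
    min j r with suc m ℕ.≤? j
    ... | yes p = p
    ... | no p with walk-to-coset hx hw r
    ... | one , inj₁ r0 = ⊥-elim (below-pred-absurd one (C0.Dist-min dm r0) p)
    ... | one , inj₂ r0 = ⊥-elim (odd-detour-absurd (NP.≤-pred (NP.≰⇒> p)) le one (detour-length hx (C0.Dist-R dm) r0))
  dist-to-coset {x} {w} {.(w ∙ s2)} {m} hx hw dm le (inj₂ refl) =
    C.Dist-intro (C.R-step (C0⊆C (C0.Dist-R dm)) (C.Adj-intro' (Sinv s Ss) e)) min
    where
    e : (w ∙ s2) ∙ s ≡ w ∙ (s ⁻¹)
    e = trans (assoc w s2 s) (cong (w ∙_) (trans (comm s2 s) (sym s⁻¹≡)))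
    min : ∀ j → C.R j x ((w ∙ s2) ∙ s) → suc m ≤ j
    min j r with suc m ℕ.≤? j
    ... | yes p = p
    ... | no p with walk-to-coset hx (H-mul hw s²∈H) r
    ... | one , inj₁ r0 = ⊥-elim (odd-detour-absurd (NP.≤-pred (NP.≰⇒> p)) le one (detour-length hx (C0.Dist-R dm) r0))
    ... | one , inj₂ r0 = ⊥-elim (below-pred-absurd one (C0.Dist-min dm (subst (C0.R _ x) (s²s²≡ε w) r0)) p)

module HMatrices {n : ℕ} (_∙_ : Fin n → Fin n → Fin n) (ε : Fin n) (_⁻¹ : Fin n → Fin n)
  (Hs : Fin n → Bool) where
  open import Data.Nat as ℕ using (ℕ; zero; suc)
  open import Data.Fin using (Fin; zero; suc)
  open import Data.Bool using (Bool; true; false; if_then_else_)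

  open import Defs
  open FinSums
  open import Data.Rational as ℚ using (ℚ; 0ℚ; 1ℚ; _+_; _*_)
  import Data.Rational.Properties as QP
  open import Relation.Binary.PropositionalEquality
  open import Data.List using (_∷_; applyUpTo)
  open import Function using (_∘_)

  open Grp _∙_ ε _⁻¹ using (Mat; ind) public
  open Grp.MatH _∙_ ε _⁻¹ Hs public

  g : Bool → ℚ → ℚ
  g b a = if b then a else 0ℚ

  infix 4 _≈_ _≐_
  _≈_ : Mat → Mat → Set
  M ≈ N = ∀ x y → Hs x ≡ true → Hs y ≡ true → M x y ≡ N x y

  _≐_ : Mat → Mat → Set
  M ≐ N = ∀ x y → M x y ≡ N x y

  ≈-sym : ∀ {M N} → M ≈ N → N ≈ M
  ≈-sym e x y hx hy = sym (e x y hx hy)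

  g-* : ∀ b a c → g b a * c ≡ g b (a * c)
  g-* false a c = QP.*-zeroˡ c
  g-* true a c = refl

  *-g : ∀ b a c → c * g b a ≡ g b (c * a)
  *-g false a c = QP.*-zeroʳ c
  *-g true a c = refl

  g-sum : ∀ {m} b (f : Fin m → ℚ) → g b (sumF f) ≡ sumF (λ z → g b (f z))
  g-sum false f = sym (sumF-zero (λ z → g false (f z)) (λ z → refl))
  g-sum true f = refl

  g-g : ∀ a b c → g a (g b c) ≡ g b (g a c)
  g-g false false c = refl
  g-g false true c = refl
  g-g true false c = refl
  g-g true true c = refl

  g-+ : ∀ b x y → g b (x + y) ≡ g b x + g b y
  g-+ false x y = refl
  g-+ true x y = refl

  g-0 : ∀ b → g b 0ℚ ≡ 0ℚ
  g-0 false = refl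
  g-0 true = refl

  ⊗-congˡ : ∀ {M M'} N → M ≈ M' → (M ⊗ N) ≈ (M' ⊗ N)
  ⊗-congˡ {M} {M'} N e x y hx hy = sumF-cong pw
    where
    pw : ∀ z → (if Hs z then M x z * N z y else 0ℚ) ≡ (if Hs z then M' x z * N z y else 0ℚ)
    pw z with Hs z in hz
    ... | true = cong (_* N z y) (e x z hx hz)
    ... | false = refl

  ⊗-congʳ : ∀ M {N N'} → N ≈ N' → (M ⊗ N) ≈ (M ⊗ N')
  ⊗-congʳ M {N} {N'} e x y hx hy = sumF-cong pw
    where
    pw : ∀ z → (if Hs z then M x z * N z y else 0ℚ) ≡ (if Hs z then M x z * N' z y else 0ℚ)
    pw z with Hs z in hz
    ... | true = cong (M x z *_) (e z y hz hy)
    ... | false = refl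

  ⊗-assoc : ∀ M N K → ((M ⊗ N) ⊗ K) ≐ (M ⊗ (N ⊗ K))
  ⊗-assoc M N K x y = begin
    sumF (λ z → g (Hs z) (sumF (λ w → g (Hs w) (M x w * N w z)) * K z y))
      ≡⟨ sumF-cong (λ z → cong (g (Hs z)) (sym (sumF-*ʳ (K z y) (λ w → g (Hs w) (M x w * N w z))))) ⟩
    sumF (λ z → g (Hs z) (sumF (λ w → g (Hs w) (M x w * N w z) * K z y)))
      ≡⟨ sumF-cong (λ z → g-sum (Hs z) (λ w → g (Hs w) (M x w * N w z) * K z y)) ⟩
    sumF (λ z → sumF (λ w → g (Hs z) (g (Hs w) (M x w * N w z) * K z y)))
      ≡⟨ sumF-swap (λ z w → g (Hs z) (g (Hs w) (M x w * N w z) * K z y)) ⟩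
    sumF (λ w → sumF (λ z → g (Hs z) (g (Hs w) (M x w * N w z) * K z y)))
      ≡⟨ sumF-cong (λ w → sumF-cong (λ z → pw w z)) ⟩
    sumF (λ w → sumF (λ z → g (Hs w) (M x w * g (Hs z) (N w z * K z y))))
      ≡⟨ sumF-cong (λ w → sym (g-sum (Hs w) (λ z → M x w * g (Hs z) (N w z * K z y)))) ⟩
    sumF (λ w → g (Hs w) (sumF (λ z → M x w * g (Hs z) (N w z * K z y))))
      ≡⟨ sumF-cong (λ w → cong (g (Hs w)) (sumF-* (M x w) (λ z → g (Hs z) (N w z * K z y)))) ⟩
    sumF (λ w → g (Hs w) (M x w * sumF (λ z → g (Hs z) (N w z * K z y)))) ∎
    where
    open ≡-Reasoning
    pw : ∀ w z → g (Hs z) (g (Hs w) (M x w * N w z) * K z y) ≡ g (Hs w) (M x w * g (Hs z) (N w z * K z y))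
    pw w z = trans (cong (g (Hs z)) (g-* (Hs w) _ _))
      (trans (g-g (Hs z) (Hs w) _) (cong (g (Hs w)) (trans (cong (g (Hs z)) (QP.*-assoc (M x w) (N w z) (K z y))) (sym (*-g (Hs z) _ (M x w))))))

  ⊗-distribˡ : ∀ M N K → (M ⊗ (N ⊕ K)) ≐ ((M ⊗ N) ⊕ (M ⊗ K))
  ⊗-distribˡ M N K x y = trans (sumF-cong pw) (sumF-+ (λ z → g (Hs z) (M x z * N z y)) (λ z → g (Hs z) (M x z * K z y)))
    where
    pw : ∀ z → g (Hs z) (M x z * (N z y + K z y)) ≡ g (Hs z) (M x z * N z y) + g (Hs z) (M x z * K z y)
    pw z = trans (cong (g (Hs z)) (QP.*-distribˡ-+ (M x z) _ _)) (g-+ (Hs z) _ _)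

  ⊗-distribʳ : ∀ M N K → ((M ⊕ N) ⊗ K) ≐ ((M ⊗ K) ⊕ (N ⊗ K))
  ⊗-distribʳ M N K x y = trans (sumF-cong pw) (sumF-+ (λ z → g (Hs z) (M x z * K z y)) (λ z → g (Hs z) (N x z * K z y)))
    where
    pw : ∀ z → g (Hs z) ((M x z + N x z) * K z y) ≡ g (Hs z) (M x z * K z y) + g (Hs z) (N x z * K z y)
    pw z = trans (cong (g (Hs z)) (QP.*-distribʳ-+ (K z y) (M x z) _)) (g-+ (Hs z) _ _)

  ⊙-⊗ : ∀ c M N → ((c ⊙ M) ⊗ N) ≐ (c ⊙ (M ⊗ N))
  ⊙-⊗ c M N x y = trans (sumF-cong pw) (sumF-* c (λ z → g (Hs z) (M x z * N z y)))
    where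
    pw : ∀ z → g (Hs z) ((c * M x z) * N z y) ≡ c * g (Hs z) (M x z * N z y)
    pw z = trans (cong (g (Hs z)) (QP.*-assoc c _ _)) (sym (*-g (Hs z) _ c))

  ⊗-⊙ : ∀ c M N → (M ⊗ (c ⊙ N)) ≐ (c ⊙ (M ⊗ N))
  ⊗-⊙ c M N x y = trans (sumF-cong pw) (sumF-* c (λ z → g (Hs z) (M x z * N z y)))
    where
    pw : ∀ z → g (Hs z) (M x z * (c * N z y)) ≡ c * g (Hs z) (M x z * N z y)
    pw z = trans (cong (g (Hs z)) (trans (sym (QP.*-assoc (M x z) c _)) (trans (cong (_* N z y) (QP.*-comm (M x z) c)) (QP.*-assoc c _ _))))
      (sym (*-g (Hs z) _ c))

  Zero-⊗ : ∀ M → (Zero ⊗ M) ≐ Zero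
  Zero-⊗ M x y = sumF-zero _ (λ z → trans (cong (g (Hs z)) (QP.*-zeroˡ (M z y))) (g-0 (Hs z)))

  ⊗-Zero : ∀ M → (M ⊗ Zero) ≐ Zero
  ⊗-Zero M x y = sumF-zero _ (λ z → trans (cong (g (Hs z)) (QP.*-zeroʳ (M x z))) (g-0 (Hs z)))

  Id-⊗ : ∀ M → (Id ⊗ M) ≈ M
  Id-⊗ M x y hx hy = trans (sumF-cong pw) (trans (sumF-point x (λ z → g (Hs z) (M z y))) (cong (λ b → g b (M x y)) hx))
    where
    pw : ∀ z → g (Hs z) ((if x == z then 1ℚ else 0ℚ) * M z y) ≡ (if x == z then g (Hs z) (M z y) else 0ℚ)
    pw z with x == z
    ... | true = cong (g (Hs z)) (QP.*-identityˡ _)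
    ... | false = trans (cong (g (Hs z)) (QP.*-zeroˡ (M z y))) (g-0 (Hs z))

  ⊗-Id : ∀ M → (M ⊗ Id) ≈ M
  ⊗-Id M x y hx hy = trans (sumF-cong pw) (trans (sumF-point y (λ z → g (Hs z) (M x z))) (cong (λ b → g b (M x y)) hy))
    where
    pw : ∀ z → g (Hs z) (M x z * (if z == y then 1ℚ else 0ℚ)) ≡ (if y == z then g (Hs z) (M x z) else 0ℚ)
    pw z rewrite ==-sym z y with y == z
    ... | true = cong (g (Hs z)) (QP.*-identityʳ _)
    ... | false = trans (cong (g (Hs z)) (QP.*-zeroʳ (M x z))) (g-0 (Hs z))

  open import Data.Rational.Solver
  open +-*-Solver

  polyAt : Mat → ℕ → (ℕ → ℚ) → Mat
  polyAt X D f = evalP (applyUpTo f D) X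

  shift : (ℕ → ℚ) → ℕ → ℚ
  shift f zero = 0ℚ
  shift f (suc t) = f t

  PA-cong : ∀ X D {f h : ℕ → ℚ} → (∀ t → f t ≡ h t) → polyAt X D f ≐ polyAt X D h
  PA-cong X zero e x y = refl
  PA-cong X (suc D) {f} {h} e x y =
    cong₂ _+_ (cong (λ c → c * Id x y) (e 0)) (sumF-cong (λ z → cong (λ v → g (Hs z) (X x z * v)) (PA-cong X D (λ t → e (suc t)) z y)))

  PA-zero : ∀ X D (f : ℕ → ℚ) → (∀ t → f t ≡ 0ℚ) → polyAt X D f ≐ Zero
  PA-zero X zero f e x y = refl
  PA-zero X (suc D) f e x y = trans (cong₂ _+_ (trans (cong (_* Id x y) (e 0)) (QP.*-zeroˡ (Id x y)))
    (trans (sumF-cong (λ z → cong (λ v → g (Hs z) (X x z * v)) (PA-zero X D (λ t → f (suc t)) (λ t → e (suc t)) z y))) (⊗-Zero X x y)))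
    (QP.+-identityˡ 0ℚ)

  PA-+ : ∀ X D (f h : ℕ → ℚ) → polyAt X D (λ t → f t + h t) ≐ (polyAt X D f ⊕ polyAt X D h)
  PA-+ X zero f h x y = sym (QP.+-identityˡ 0ℚ)
  PA-+ X (suc D) f h x y = begin
    (f 0 + h 0) * Id x y + (X ⊗ polyAt X D (λ t → f (suc t) + h (suc t))) x y
      ≡⟨ cong ((f 0 + h 0) * Id x y +_) (trans (sumF-cong (λ z → cong (λ v → g (Hs z) (X x z * v)) (PA-+ X D (λ t → f (suc t)) (λ t → h (suc t)) z y))) (⊗-distribˡ X (polyAt X D (λ t → f (suc t))) (polyAt X D (λ t → h (suc t))) x y)) ⟩
    (f 0 + h 0) * Id x y + ((X ⊗ polyAt X D (λ t → f (suc t))) x y + (X ⊗ polyAt X D (λ t → h (suc t))) x y)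
      ≡⟨ solve 5 (λ a b i u v → (a :+ b) :* i :+ (u :+ v) := (a :* i :+ u) :+ (b :* i :+ v)) refl (f 0) (h 0) (Id x y) ((X ⊗ polyAt X D (λ t → f (suc t))) x y) ((X ⊗ polyAt X D (λ t → h (suc t))) x y) ⟩
    (f 0 * Id x y + (X ⊗ polyAt X D (λ t → f (suc t))) x y) + (h 0 * Id x y + (X ⊗ polyAt X D (λ t → h (suc t))) x y) ∎
    where open ≡-Reasoning

  PA-* : ∀ X D (c : ℚ) (f : ℕ → ℚ) → polyAt X D (λ t → c * f t) ≐ (c ⊙ polyAt X D f)
  PA-* X zero c f x y = sym (QP.*-zeroʳ c)
  PA-* X (suc D) c f x y = begin
    (c * f 0) * Id x y + (X ⊗ polyAt X D (λ t → c * f (suc t))) x y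
      ≡⟨ cong ((c * f 0) * Id x y +_) (trans (sumF-cong (λ z → cong (λ v → g (Hs z) (X x z * v)) (PA-* X D c (λ t → f (suc t)) z y))) (⊗-⊙ c X (polyAt X D (λ t → f (suc t))) x y)) ⟩
    (c * f 0) * Id x y + c * (X ⊗ polyAt X D (λ t → f (suc t))) x y
      ≡⟨ solve 4 (λ c a i u → (c :* a) :* i :+ c :* u := c :* (a :* i :+ u)) refl c (f 0) (Id x y) ((X ⊗ polyAt X D (λ t → f (suc t))) x y) ⟩
    c * (f 0 * Id x y + (X ⊗ polyAt X D (λ t → f (suc t))) x y) ∎
    where open ≡-Reasoning

  PA-ext1 : ∀ X D (f : ℕ → ℚ) → f D ≡ 0ℚ → polyAt X (suc D) f ≐ polyAt X D f
  PA-ext1 X zero f e x y = trans (cong₂ _+_ (trans (cong (_* Id x y) e) (QP.*-zeroˡ (Id x y))) (⊗-Zero X x y)) (QP.+-identityˡ 0ℚ)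
  PA-ext1 X (suc D) f e x y = cong (f 0 * Id x y +_)
    (sumF-cong (λ z → cong (λ v → g (Hs z) (X x z * v)) (PA-ext1 X D (λ t → f (suc t)) e z y)))

  PA-shift : ∀ X D (f : ℕ → ℚ) → polyAt X (suc D) (shift f) ≐ (X ⊗ polyAt X D f)
  PA-shift X D f x y = trans (cong (_+ (X ⊗ polyAt X D f) x y) (QP.*-zeroˡ (Id x y))) (QP.+-identityˡ _)

  PA-top : ∀ X D (f : ℕ → ℚ) → polyAt X (suc D) f ≐ (polyAt X D f ⊕ (f D ⊙ (X ^^ D)))
  PA-top X zero f x y = trans (cong (f 0 * Id x y +_) (⊗-Zero X x y)) (trans (QP.+-identityʳ (f 0 * Id x y)) (sym (QP.+-identityˡ (f 0 * Id x y))))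
  PA-top X (suc D) f x y = begin
    f 0 * Id x y + (X ⊗ polyAt X (suc D) (λ t → f (suc t))) x y
      ≡⟨ cong (f 0 * Id x y +_) (trans (sumF-cong (λ z → cong (λ v → g (Hs z) (X x z * v)) (PA-top X D (λ t → f (suc t)) z y)))
           (trans (⊗-distribˡ X (polyAt X D (λ t → f (suc t))) (f (suc D) ⊙ (X ^^ D)) x y) (cong ((X ⊗ polyAt X D (λ t → f (suc t))) x y +_) (⊗-⊙ (f (suc D)) X (X ^^ D) x y)))) ⟩
    f 0 * Id x y + ((X ⊗ polyAt X D (λ t → f (suc t))) x y + f (suc D) * (X ⊗ (X ^^ D)) x y)
      ≡⟨ sym (QP.+-assoc (f 0 * Id x y) ((X ⊗ polyAt X D (λ t → f (suc t))) x y) (f (suc D) * (X ⊗ (X ^^ D)) x y)) ⟩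
    (f 0 * Id x y + (X ⊗ polyAt X D (λ t → f (suc t))) x y) + f (suc D) * (X ⊗ (X ^^ D)) x y ∎
    where open ≡-Reasoning

  PA-comm : ∀ X D (f : ℕ → ℚ) → (polyAt X D f ⊗ X) ≈ (X ⊗ polyAt X D f)
  PA-comm X zero f x y hx hy = trans (Zero-⊗ X x y) (sym (⊗-Zero X x y))
  PA-comm X (suc D) f x y hx hy = begin
    ((((f 0) ⊙ Id) ⊕ (X ⊗ Y)) ⊗ X) x y ≡⟨ ⊗-distribʳ ((f 0) ⊙ Id) (X ⊗ Y) X x y ⟩
    (((f 0) ⊙ Id) ⊗ X) x y + ((X ⊗ Y) ⊗ X) x y ≡⟨ cong₂ _+_ (trans (⊙-⊗ (f 0) Id X x y) (cong (f 0 *_) (Id-⊗ X x y hx hy))) (⊗-assoc X Y X x y) ⟩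
    f 0 * X x y + (X ⊗ (Y ⊗ X)) x y ≡⟨ cong (f 0 * X x y +_) (⊗-congʳ X (PA-comm X D (λ t → f (suc t))) x y hx hy) ⟩
    f 0 * X x y + (X ⊗ (X ⊗ Y)) x y ≡⟨ sym (cong₂ _+_ (trans (⊗-⊙ (f 0) X Id x y) (cong (f 0 *_) (⊗-Id X x y hx hy))) refl) ⟩
    (X ⊗ ((f 0) ⊙ Id)) x y + (X ⊗ (X ⊗ Y)) x y ≡⟨ sym (⊗-distribˡ X ((f 0) ⊙ Id) (X ⊗ Y) x y) ⟩
    (X ⊗ (((f 0) ⊙ Id) ⊕ (X ⊗ Y))) x y ∎
    where
    open ≡-Reasoning
    Y : Mat
    Y = polyAt X D (λ t → f (suc t))

module Coefficients (bs : ℕ → ℕ) where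
  open import Data.Nat as ℕ using (ℕ; zero; suc; _∸_; pred)

  open import Data.Integer as ℤ using (ℤ; +_; -[1+_]; _+_; _*_; -_; _-_)
  import Data.Integer.Properties as ZP
  import Data.Nat.Properties as NP
  open import Data.Product
  open import Relation.Binary.PropositionalEquality
  open import Data.Integer.Solver
  open +-*-Solver

  record Tri : Set where
    constructor tri
    field Fc Gc Mc : ℕ → ℤ
  open Tri public

  shz : (ℕ → ℤ) → ℕ → ℤ
  shz f zero = + 0
  shz f (suc t) = f t

  cf : ℕ → ℤ
  cf j = + (j ℕ.* bs (j ∸ 1))

  next : ℕ → Tri → Tri → Tri
  next j cur prev = tri
    (λ t → shz (Fc cur) t + (+ 2 * Mc cur t - cf j * Fc prev t))
    (λ t → shz (Gc cur) t + (+ 2 * Mc cur t - cf j * Gc prev t))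
    (λ t → shz (Mc cur) t + ((Fc cur t + Gc cur t) - cf j * Mc prev t))

  δ0 : ℕ → ℤ
  δ0 zero = + 1
  δ0 (suc _) = + 0

  T0 Tz : Tri
  T0 = tri δ0 (λ _ → + 0) (λ _ → + 0)
  Tz = tri (λ _ → + 0) (λ _ → + 0) (λ _ → + 0)

  lev : ℕ → Tri × Tri
  lev zero = T0 , next 0 T0 Tz
  lev (suc j) = proj₂ (lev j) , next (suc j) (proj₂ (lev j)) (proj₁ (lev j))

  T : ℕ → Tri
  T j = proj₁ (lev j)

  F G M : ℕ → ℕ → ℤ
  F j = Fc (T j)
  G j = Gc (T j)
  M j = Mc (T j)

  F1 : ∀ t → F 1 t ≡ shz δ0 t
  F1 t = ZP.+-identityʳ (shz δ0 t)

  G1 : ∀ t → G 1 t ≡ + 0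
  G1 zero = refl
  G1 (suc t) = refl

  M1 : ∀ t → M 1 t ≡ δ0 t
  M1 zero = refl
  M1 (suc t) = refl

  record Vanishing (j : ℕ) : Set where
    field
      vF : ∀ t → F j (suc j ℕ.+ t) ≡ + 0
      vF1 : F j j ≡ + 1
      vG : ∀ t → G j (pred j ℕ.+ t) ≡ + 0
      vM : ∀ t → M j (j ℕ.+ t) ≡ + 0
  open Vanishing

  van0 : Vanishing 0
  van0 = record { vF = λ t → refl ; vF1 = refl ; vG = λ t → refl ; vM = λ t → refl }

  van1 : Vanishing 1
  van1 = record { vF = λ t → trans (F1 (2 ℕ.+ t)) refl ; vF1 = F1 1 ; vG = G1 ; vM = λ t → M1 (1 ℕ.+ t) }

  rec-zero : ∀ (a b c : ℤ) → a ≡ + 0 → b ≡ + 0 → c ≡ + 0 → ∀ k → a + (+ 2 * b - k * c) ≡ + 0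
  rec-zero a b c refl refl refl k = solve 1 (λ k → con (+ 0) :+ (con (+ 2) :* con (+ 0) :- k :* con (+ 0)) := con (+ 0)) refl k

  recM-zero : ∀ (a b c e : ℤ) → a ≡ + 0 → b ≡ + 0 → c ≡ + 0 → e ≡ + 0 → ∀ k → a + ((b + c) - k * e) ≡ + 0
  recM-zero a b c e refl refl refl refl k = solve 1 (λ k → con (+ 0) :+ ((con (+ 0) :+ con (+ 0)) :- k :* con (+ 0)) := con (+ 0)) refl k

  eq1 : ∀ j t → j ℕ.+ suc (suc t) ≡ suc (suc (j ℕ.+ t))
  eq1 j t = trans (NP.+-suc j (suc t)) (cong suc (NP.+-suc j t))

  eq2 : ∀ j → j ℕ.+ 1 ≡ suc j
  eq2 j = trans (NP.+-suc j 0) (cong suc (NP.+-identityʳ j))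

  G-high : ∀ j → Vanishing j → ∀ t → G j (suc (j ℕ.+ t)) ≡ + 0
  G-high zero V t = refl
  G-high (suc j') V t = subst (λ u → G (suc j') u ≡ + 0) (eq1 j' t) (vG V (suc (suc t)))

  vanStep : ∀ j → Vanishing j → Vanishing (suc j) → Vanishing (suc (suc j))
  vanStep j V W = record
    { vF = λ t → rec-zero _ _ _ (vF W t)
                   (subst (λ u → M (suc j) (suc u) ≡ + 0) (eq1 j t) (vM W (suc (suc t))))
                   (subst (λ u → F j (suc u) ≡ + 0) (eq1 j t) (vF V (suc (suc t)))) (cf (suc j))
    ; vF1 = trans (cong (λ z → z + (+ 2 * M (suc j) (suc (suc j)) - cf (suc j) * F j (suc (suc j)))) (vF1 W))
             (o1 _ _ (subst (λ u → M (suc j) (suc u) ≡ + 0) (eq2 j) (vM W 1))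
                     (subst (λ u → F j (suc u) ≡ + 0) (eq2 j) (vF V 1)) (cf (suc j)))
    ; vG = λ t → rec-zero _ _ _ (vG W t) (vM W t) (G-high j V t) (cf (suc j))
    ; vM = λ t → recM-zero _ _ _ _ (vM W t) (vF W t)
                   (subst (λ u → G (suc j) u ≡ + 0) (eq1 j t) (vG W (suc (suc t))))
                   (subst (λ u → M j u ≡ + 0) (eq1 j t) (vM V (suc (suc t)))) (cf (suc j))
    }
    where
    o1 : ∀ (b c : ℤ) → b ≡ + 0 → c ≡ + 0 → ∀ k → + 1 + (+ 2 * b - k * c) ≡ + 1
    o1 b c refl refl k = solve 1 (λ k → con (+ 1) :+ (con (+ 2) :* con (+ 0) :- k :* con (+ 0)) := con (+ 1)) refl k

  vanPair : ∀ j → Vanishing j × Vanishing (suc j)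
  vanPair zero = van0 , van1
  vanPair (suc j) = let (V , W) = vanPair j in W , vanStep j V W

  vanishing : ∀ j → Vanishing j
  vanishing j = proj₁ (vanPair j)

  F-parity : ∀ j' → F (suc j') j' ≡ + 0
  F-parity zero = refl
  F-parity (suc j) = rec-zero _ _ _ (F-parity j) (subst (λ u → M (suc j) u ≡ + 0) (NP.+-identityʳ (suc j)) (vM (vanishing (suc j)) 0))
                 (subst (λ u → F j u ≡ + 0) (cong suc (NP.+-identityʳ j)) (vF (vanishing j) 0)) (cf (suc j))

  M-lead : ∀ j' → M (suc j') j' ≡ + (suc j')
  M-lead zero = refl
  M-lead (suc j) = trans (cong₂ (λ a b → a + ((F (suc j) (suc j) + b) - cf (suc j) * M j (suc j))) (M-lead j)
                        (subst (λ u → G (suc j) u ≡ + 0) (eq2 j) (vG (vanishing (suc j)) 1)))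
    (trans (cong₂ (λ a b → + suc j + ((a + + 0) - cf (suc j) * b)) (vF1 (vanishing (suc j))) (subst (λ u → M j u ≡ + 0) (eq2 j) (vM (vanishing j) 1)))
      (trans (solve 2 (λ a k → a :+ ((con (+ 1) :+ con (+ 0)) :- k :* con (+ 0)) := a :+ con (+ 1)) refl (+ suc j) (cf (suc j)))
        (trans (sym (ZP.pos-+ (suc j) 1)) (cong +_ (trans (NP.+-suc (suc j) 0) (cong suc (NP.+-identityʳ (suc j))))))))

  M-parity : ∀ j'' → M (suc (suc j'')) j'' ≡ + 0
  M-parity zero = recM-zero _ _ _ _ refl refl refl refl (cf 1)
  M-parity (suc j) = recM-zero _ _ _ _ (M-parity j) (F-parity (suc j))
                 (subst (λ u → G (suc (suc j)) u ≡ + 0) (NP.+-identityʳ (suc j)) (vG (vanishing (suc (suc j))) 0))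
                 (subst (λ u → M (suc j) u ≡ + 0) (NP.+-identityʳ (suc j)) (vM (vanishing (suc j)) 0)) (cf (suc (suc j)))

  module NatAr where
    import Data.Nat.Solver as NS
    open NS.+-*-Solver renaming (solve to nsolve; _:+_ to _⊞_; _:*_ to _⊠_; _:=_ to _≐_; con to c)
    lead-sum : ∀ j → suc j ℕ.* suc (suc j) ℕ.+ 2 ℕ.* suc (suc j) ≡ suc (suc j) ℕ.* suc (suc (suc j))
    lead-sum = nsolve 1 (λ j → (c 1 ⊞ j) ⊠ (c 2 ⊞ j) ⊞ c 2 ⊠ (c 2 ⊞ j) ≐ (c 2 ⊞ j) ⊠ (c 3 ⊞ j)) refl
  open NatAr

  G-lead : ∀ j'' → G (suc (suc j'')) j'' ≡ + (suc j'' ℕ.* suc (suc j''))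
  G-lead zero = solve 1 (λ k → con (+ 0) :+ (con (+ 2) :* con (+ 1) :- k :* con (+ 0)) := con (+ 2)) refl (cf 1)
  G-lead (suc j) = trans (cong₂ (λ a b → a + (+ 2 * b - cf (suc (suc j)) * G (suc j) (suc j))) (G-lead j) (M-lead (suc j)))
    (trans (cong (λ b → + (suc j ℕ.* suc (suc j)) + (+ 2 * + suc (suc j) - cf (suc (suc j)) * b))
              (subst (λ u → G (suc j) u ≡ + 0) (eq2 j) (vG (vanishing (suc j)) 1)))
      (trans (solve 3 (λ a b k → a :+ (con (+ 2) :* b :- k :* con (+ 0)) := a :+ con (+ 2) :* b) refl (+ (suc j ℕ.* suc (suc j))) (+ suc (suc j)) (cf (suc (suc j))))
        (trans (cong (λ z → (+ (suc j ℕ.* suc (suc j))) + z) (sym (ZP.pos-* 2 (suc (suc j)))))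
          (trans (sym (ZP.pos-+ (suc j ℕ.* suc (suc j)) (2 ℕ.* suc (suc j))))
            (cong +_ (lead-sum j))))))

  -- When b_j ≥ 3 below level I, the coefficients that become the leading
  -- coefficients of p and r are strictly negative, in particular nonzero.
  module Sign (I : ℕ) (b≥3 : ∀ j → suc j ℕ.≤ I → 3 ℕ.≤ bs j) where

    split2 : ∀ b → 3 ℕ.≤ b → b ≡ 2 ℕ.+ (b ∸ 2)
    split2 b h = sym (NP.m+[n∸m]≡n (NP.≤-trans (NP.n≤1+n 2) h))

    split1 : ∀ b → 3 ℕ.≤ b → b ≡ 1 ℕ.+ (b ∸ 1)
    split1 b h = sym (NP.m+[n∸m]≡n (NP.≤-trans (ℕ.s≤s ℕ.z≤n) h))

    pos1 : ∀ b k → k ℕ.+ 1 ℕ.≤ b → 1 ℕ.≤ b ∸ k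
    pos1 b k h = NP.≤-trans (NP.≤-reflexive (sym (NP.m+n∸m≡n k 1))) (NP.∸-monoˡ-≤ k h)

    F-lead-neg : ∀ j' → suc j' ℕ.≤ I → Σ ℕ (λ l → 1 ℕ.≤ l × F (suc (suc j')) j' ≡ - (+ l))
    F-lead-neg zero h = bs 0 ∸ 2 , pos1 (bs 0) 2 (b≥3 0 h) , eq
      where
      B : ℕ
      B = bs 0 ∸ 2
      eq : + 0 + (+ 2 * + 1 - + (1 ℕ.* bs 0) * + 1) ≡ - (+ B)
      eq = trans (cong (λ z → + 0 + (+ 2 * + 1 - + z * + 1)) (trans (NP.*-identityˡ (bs 0)) (split2 (bs 0) (b≥3 0 h))))
        (trans (cong (λ z → + 0 + (+ 2 * + 1 - z * + 1)) (ZP.pos-+ 2 B))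
          (solve 1 (λ b → con (+ 0) :+ (con (+ 2) :* con (+ 1) :- (con (+ 2) :+ b) :* con (+ 1)) := :- b) refl (+ B)))
    F-lead-neg (suc j) h = l ℕ.+ suc (suc j) ℕ.* B , NP.≤-trans l1 (NP.m≤m+n l _) ,
      trans (cong₂ (λ a b → a + (+ 2 * b - cf (suc (suc j)) * F (suc j) (suc j))) (proj₂ (proj₂ IH)) (M-lead (suc j)))
        (trans (cong (λ b → - (+ l) + (+ 2 * + suc (suc j) - cf (suc (suc j)) * b)) (vF1 (vanishing (suc j))))
          (trans (cong (λ z → - (+ l) + (+ 2 * + suc (suc j) - + (suc (suc j) ℕ.* z) * + 1)) (split2 (bs (suc j)) bj))
            (trans (cong (λ z → - (+ l) + (+ 2 * + suc (suc j) - z * + 1)) (trans (ZP.pos-* (suc (suc j)) (2 ℕ.+ B)) (cong (+ suc (suc j) *_) (ZP.pos-+ 2 B))))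
              (trans (solve 3 (λ L m b → :- L :+ (con (+ 2) :* m :- (m :* (con (+ 2) :+ b)) :* con (+ 1)) := :- (L :+ m :* b)) refl (+ l) (+ suc (suc j)) (+ B))
                (cong -_ (trans (cong (λ z → (+ l) + z) (sym (ZP.pos-* (suc (suc j)) B))) (sym (ZP.pos-+ l (suc (suc j) ℕ.* B)))))))))
      where
      IH : Σ ℕ (λ l → 1 ℕ.≤ l × F (suc (suc j)) j ≡ - (+ l))
      IH = F-lead-neg j (NP.≤-trans (NP.n≤1+n _) h)
      l : ℕ
      l = proj₁ IH
      l1 : 1 ℕ.≤ l
      l1 = proj₁ (proj₂ IH)
      bj : 3 ℕ.≤ bs (suc j)
      bj = b≥3 (suc j) h
      B : ℕ
      B = bs (suc j) ∸ 2

    M-lead-neg : ∀ j'' → suc (suc j'') ℕ.≤ I → Σ ℕ (λ r → 1 ℕ.≤ r × M (suc (suc (suc j''))) j'' ≡ - (+ r))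
    M-lead-neg zero h = l ℕ.+ 2 ℕ.* B , NP.≤-trans l1 (NP.m≤m+n l _) ,
      trans (cong₂ (λ a b → + 0 + ((a + b) - cf 2 * + 1)) (proj₂ (proj₂ F0)) (G-lead 0))
        (trans (cong (λ z → + 0 + ((- (+ l) + + 2) - + (2 ℕ.* z) * + 1)) (split1 (bs 1) b1))
          (trans (cong (λ z → + 0 + ((- (+ l) + + 2) - z * + 1)) (trans (ZP.pos-* 2 (1 ℕ.+ B)) (cong (+ 2 *_) (ZP.pos-+ 1 B))))
            (trans (solve 2 (λ L b → con (+ 0) :+ ((:- L :+ con (+ 2)) :- (con (+ 2) :* (con (+ 1) :+ b)) :* con (+ 1)) := :- (L :+ con (+ 2) :* b)) refl (+ l) (+ B))
              (cong -_ (trans (cong (λ z → (+ l) + z) (sym (ZP.pos-* 2 B))) (sym (ZP.pos-+ l (2 ℕ.* B))))))))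
      where
      F0 : Σ ℕ (λ l → 1 ℕ.≤ l × F 2 0 ≡ - (+ l))
      F0 = F-lead-neg 0 (NP.≤-trans (ℕ.s≤s ℕ.z≤n) h)
      l : ℕ
      l = proj₁ F0
      l1 : 1 ℕ.≤ l
      l1 = proj₁ (proj₂ F0)
      b1 : 3 ℕ.≤ bs 1
      b1 = b≥3 1 h
      B : ℕ
      B = bs 1 ∸ 1
    M-lead-neg (suc j) h = r ℕ.+ l ℕ.+ suc (suc j) ℕ.* suc (suc (suc j)) ℕ.* B ,
      NP.≤-trans r1 (NP.≤-trans (NP.m≤m+n r l) (NP.m≤m+n (r ℕ.+ l) _)) ,
      trans (cong₂ (λ a b → a + ((b + G (suc (suc (suc j))) (suc j)) - cf (suc (suc (suc j))) * M (suc (suc j)) (suc j))) (proj₂ (proj₂ IH)) (proj₂ (proj₂ FF)))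
        (trans (cong₂ (λ a b → - (+ r) + ((- (+ l) + a) - cf (suc (suc (suc j))) * b)) (G-lead (suc j)) (M-lead (suc j)))
          (trans (cong (λ z → - (+ r) + ((- (+ l) + + (suc (suc j) ℕ.* suc (suc (suc j)))) - + (suc (suc (suc j)) ℕ.* z) * + suc (suc j))) (split1 (bs (suc (suc j))) bj))
            (trans (cong₂ (λ u v → - (+ r) + ((- (+ l) + u) - v * + suc (suc j)))
                     (ZP.pos-* (suc (suc j)) (suc (suc (suc j))))
                     (trans (ZP.pos-* (suc (suc (suc j))) (1 ℕ.+ B)) (cong (+ suc (suc (suc j)) *_) (ZP.pos-+ 1 B))))
              (trans (solve 5 (λ R L a b c → :- R :+ ((:- L :+ a :* b) :- (b :* (con (+ 1) :+ c)) :* a) := :- (R :+ L :+ a :* b :* c)) refl (+ r) (+ l) (+ suc (suc j)) (+ suc (suc (suc j))) (+ B))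
                (cong -_ (sym (trans (ZP.pos-+ (r ℕ.+ l) _) (cong₂ _+_ (ZP.pos-+ r l)
                   (trans (ZP.pos-* (suc (suc j) ℕ.* suc (suc (suc j))) B) (cong (_* + B) (ZP.pos-* (suc (suc j)) (suc (suc (suc j))))))))))))))
      where
      IH : Σ ℕ (λ r → 1 ℕ.≤ r × M (suc (suc (suc j))) j ≡ - (+ r))
      IH = M-lead-neg j (NP.≤-trans (NP.n≤1+n _) h)
      r : ℕ
      r = proj₁ IH
      r1 : 1 ℕ.≤ r
      r1 = proj₁ (proj₂ IH)
      FF : Σ ℕ (λ l → 1 ℕ.≤ l × F (suc (suc (suc j))) (suc j) ≡ - (+ l))
      FF = F-lead-neg (suc j) (NP.≤-trans (NP.n≤1+n _) h)
      l : ℕ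
      l = proj₁ FF
      bj : 3 ℕ.≤ bs (suc (suc j))
      bj = b≥3 (suc (suc j)) h
      B : ℕ
      B = bs (suc (suc j)) ∸ 1

module Setting {n : ℕ} (_∙_ : Fin n → Fin n → Fin n) (ε : Fin n) (_⁻¹ : Fin n → Fin n)
  (isAG : IsAbelianGroup _≡_ _∙_ ε _⁻¹)
  (S : Fin n → Bool) (Sε : S ε ≡ false) (Sinv : ∀ g → S g ≡ true → S (g ⁻¹) ≡ true)
  (s : Fin n) (Ss : S s ≡ true) (Hs : Fin n → Bool)
  (H→gen : ∀ g → Hs g ≡ true → Grp.InGen _∙_ ε _⁻¹ (Grp.remove± _∙_ ε _⁻¹ S s) g)
  (gen→H : ∀ g → Grp.InGen _∙_ ε _⁻¹ (Grp.remove± _∙_ ε _⁻¹ S s) g → Hs g ≡ true)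
  (notAll : Σ (Fin n) (λ g → Hs g ≡ false))
  (ord4 : Grp.HasOrder _∙_ ε _⁻¹ s 4)
  (d : ℕ) (x₀ : Fin n) (hx₀ : Hs x₀ ≡ true)
  (dx₀ : Grp.IsDist _∙_ ε _⁻¹ (Grp.remove± _∙_ ε _⁻¹ S s) x₀ (x₀ ∙ (s ∙ s)) d ≡ true)
  (i : ℕ) (2i≤d : i ℕ.+ i ≤ d)
  (DR : Grp.DistanceRegular _∙_ ε _⁻¹ S)
  (a1 : ∀ x y → Grp.IsDist _∙_ ε _⁻¹ S x y 1 ≡ true → Grp.cnt-a _∙_ ε _⁻¹ S 1 x y ≡ 0)
  where

  module IntersectionNumbers where
    open import Data.Nat as ℕ using (ℕ; zero; suc; _+_; _≤_; _<_; _∸_)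
    open import Data.Fin using (Fin; zero; suc; _≟_)
    open import Relation.Binary.PropositionalEquality
    open import Data.Bool using (Bool; true; false; _∧_; _∨_; not; if_then_else_)
    open import Data.Product
    open import Defs

    open ShortDistances _∙_ ε _⁻¹ isAG S Sε Sinv s Ss Hs H→gen gen→H notAll ord4 (proj₁ DR) d x₀ hx₀ dx₀ i 2i≤d public
    open FinSums
    import Data.Nat.Properties as NP
    open import Data.Sum
    open import Function using (_∘_)
    open import Relation.Nullary using (¬_; yes; no)
    open import Data.Empty using (⊥-elim; ⊥)
    open import Data.Bool.Properties using (∧-identityʳ)
    open import Data.Nat using (_*_)

    N : Fin n → Fin n → ℕ → ℕ
    N x v m = countF (λ u → S u ∧ IsDist S x (v ∙ u) m)

    N0 : Fin n → Fin n → ℕ → ℕ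
    N0 x v m = countF (λ u → S0 u ∧ IsDist S0 x (v ∙ u) m)

    cntc≡N : ∀ x v m → cnt-c S (suc m) x v ≡ N x v m
    cntc≡N x v m = CS.nbr-count (λ z → IsDist S x z m) v

    cnta≡N : ∀ x v m → cnt-a S m x v ≡ N x v m
    cnta≡N x v m = CS.nbr-count (λ z → IsDist S x z m) v

    cntb≡N : ∀ x v m → cnt-b S m x v ≡ N x v (suc m)
    cntb≡N x v m = CS.nbr-count (λ z → IsDist S x z (suc m)) v

    cntc≡N0 : ∀ x v m → cnt-c S0 (suc m) x v ≡ N0 x v m
    cntc≡N0 x v m = CS0.nbr-count (λ z → IsDist S0 x z m) v

    cnta≡N0 : ∀ x v m → cnt-a S0 m x v ≡ N0 x v m
    cnta≡N0 x v m = CS0.nbr-count (λ z → IsDist S0 x z m) v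

    restrict-to-S₀ : ∀ a b c → (c ≡ true → a ≡ true) → (a ∧ b) ∧ c ≡ c ∧ b
    restrict-to-S₀ false b false h = refl
    restrict-to-S₀ false b true h with h refl
    ... | ()
    restrict-to-S₀ true false false h = refl
    restrict-to-S₀ true true false h = refl
    restrict-to-S₀ true false true h = refl
    restrict-to-S₀ true true true h = refl

    restrict-to-s : ∀ a b c x → (x ≡ true → a ≡ true) → (x ≡ true → c ≡ false) → ((a ∧ b) ∧ not c) ∧ x ≡ x ∧ b
    restrict-to-s false b c false h1 h2 = refl
    restrict-to-s false b c true h1 h2 with h1 refl
    ... | ()
    restrict-to-s true false c false h1 h2 = refl
    restrict-to-s true true false false h1 h2 = refl
    restrict-to-s true true true false h1 h2 = refl
    restrict-to-s true b true true h1 h2 with h2 refl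
    ... | ()
    restrict-to-s true false false true h1 h2 = refl
    restrict-to-s true true false true h1 h2 = refl

    restrict-to-s⁻¹ : ∀ a b c x y → (a ≡ true → c ≡ false → x ≡ false → y ≡ true) → (y ≡ true → a ≡ true) →
      (y ≡ true → c ≡ false) → (y ≡ true → x ≡ false) → ((a ∧ b) ∧ not c) ∧ not x ≡ y ∧ b
    restrict-to-s⁻¹ a b c x true h0 h1 h2 h3 with h1 refl | h2 refl | h3 refl
    restrict-to-s⁻¹ true false false false true h0 h1 h2 h3 | refl | refl | refl = refl
    restrict-to-s⁻¹ true true false false true h0 h1 h2 h3 | refl | refl | refl = refl
    restrict-to-s⁻¹ false b c x false h0 h1 h2 h3 = refl
    restrict-to-s⁻¹ true false c x false h0 h1 h2 h3 = refl
    restrict-to-s⁻¹ true true true x false h0 h1 h2 h3 = refl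
    restrict-to-s⁻¹ true true false true false h0 h1 h2 h3 = refl
    restrict-to-s⁻¹ true true false false false h0 h1 h2 h3 with h0 refl refl refl
    ... | ()

    S-count : ∀ (f : Fin n → Bool) →
      countF (λ u → S u ∧ f u) ≡ countF (λ u → S0 u ∧ f u) + (b2n (f s) + b2n (f (s ⁻¹)))
    S-count f = trans (countF-split (λ u → S u ∧ f u) S0)
      (cong₂ _+_ (countF-cong p1)
        (trans (countF-split (λ u → (S u ∧ f u) ∧ not (S0 u)) (s ==_))
          (cong₂ _+_ (trans (countF-cong p2) (countF-point s f))
                     (trans (countF-cong p3) (countF-point (s ⁻¹) f)))))
      where
      p1 : ∀ u → (S u ∧ f u) ∧ S0 u ≡ S0 u ∧ f u
      p1 u = restrict-to-S₀ (S u) (f u) (S0 u) (S0⊆S u)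
      p2 : ∀ u → ((S u ∧ f u) ∧ not (S0 u)) ∧ (s == u) ≡ (s == u) ∧ f u
      p2 u = restrict-to-s (S u) (f u) (S0 u) (s == u)
        (λ e → subst (λ z → S z ≡ true) (==-sound e) Ss)
        (λ e → subst (λ z → S0 z ≡ false) (==-sound e) S0-s)
      p3 : ∀ u → ((S u ∧ f u) ∧ not (S0 u)) ∧ not (s == u) ≡ ((s ⁻¹) == u) ∧ f u
      p3 u = restrict-to-s⁻¹ (S u) (f u) (S0 u) (s == u) ((s ⁻¹) == u) (ch u)
        (λ e → subst (λ z → S z ≡ true) (==-sound e) (Sinv s Ss))
        (λ e → bcase (S0 u) (λ h → ⊥-elim (S0-ne-s⁻¹ u h (sym (==-sound e)))) (λ h → h))
        (λ e → ==-false (λ q → s≢s⁻¹ (trans q (sym (==-sound e)))))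
        where
        ch : ∀ u → S u ≡ true → S0 u ≡ false → (s == u) ≡ false → ((s ⁻¹) == u) ≡ true
        ch u h1 h2 h3 with S-split u h1
        ... | inj₁ p = ⊥-elim (true≢false p h2)
        ... | inj₂ (inj₁ refl) = ⊥-elim (true≢false (==-refl s) h3)
        ... | inj₂ (inj₂ refl) = ==-refl _

    valency-S₀ : countF S ≡ countF S0 + 2
    valency-S₀ = trans (countF-cong (λ u → sym (∧-identityʳ (S u))))
      (trans (S-count (λ _ → true)) (cong (_+ 2) (countF-cong (λ u → ∧-identityʳ (S0 u)))))

    -- a path of length k + j with k ≤ j+1 ≤ i is shorter than d
    far-absurd : ∀ {k j} → k ≤ suc j → suc j ≤ i → d ≤ k + j → ⊥
    far-absurd {k} {j} kj ji dle = NP.<-irrefl refl (NP.≤-<-trans dle lt)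
      where
      lt : k + j < d
      lt = NP.≤-trans (ℕ.s≤s (NP.+-monoˡ-≤ j kj))
             (NP.≤-trans (NP.≤-reflexive (cong suc (sym (NP.+-suc j j)))) (NP.≤-trans (NP.+-mono-≤ ji ji) 2i≤d))

    near-absurd : ∀ {k j} → 2 ≤ k → k ≤ suc j → j ≤ k ∸ 2 → ⊥
    near-absurd {suc (suc k')} (ℕ.s≤s (ℕ.s≤s _)) (ℕ.s≤s kj) jk = NP.<-irrefl refl (NP.<-≤-trans kj jk)

    n≢2+n : ∀ (m : ℕ) → ¬ m ≡ suc (suc m)
    n≢2+n zero ()
    n≢2+n (suc m) q = n≢2+n m (NP.suc-injective q)

    squeeze-level : ∀ {m j'} → m ≤ suc (suc j') → j' ≤ m → ¬ m ≡ j' → ¬ m ≡ suc j' → m ≡ suc (suc j')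
    squeeze-level {m} {j'} h1 h2 n1 n2 with m NP.≟ suc (suc j')
    ... | yes p = p
    ... | no p = ⊥-elim (n1 (NP.≤-antisym (NP.≤-pred (NP.≤∧≢⇒< (NP.≤-pred (NP.≤∧≢⇒< h1 p)) n2)) h2))

    isd-eq : ∀ {x w m'} → C0.Dist x w m' → C.Dist x w m' → ∀ m → IsDist S x w m ≡ IsDist S0 x w m
    isd-eq {x} {w} {m'} d0 d1 m = bool-ext
      (λ e → subst (λ k → IsDist S0 x w k ≡ true) (sym (C.Dist-unique (C.mkD {x} {w} {m} e) d1)) (C0.unD d0))
      (λ e → subst (λ k → IsDist S x w k ≡ true) (sym (C0.Dist-unique (C0.mkD {x} {w} {m} e) d0)) (C.unD d1))

    isd-odd : ∀ {x w m'} → C.Dist x (w ∙ s) (suc m') → C0.Dist x w m' → ∀ m → IsDist S x (w ∙ s) (suc m) ≡ IsDist S0 x w m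
    isd-odd {x} {w} {m'} d1 d0 m = bool-ext
      (λ e → subst (λ k → IsDist S0 x w k ≡ true) (sym (NP.suc-injective (C.Dist-unique (C.mkD {x} {w ∙ s} {suc m} e) d1))) (C0.unD d0))
      (λ e → subst (λ k → IsDist S x (w ∙ s) (suc k) ≡ true) (sym (C0.Dist-unique (C0.mkD {x} {w} {m} e) d0)) (C.unD d1))

    nbr-dist : ∀ {x y j u} → C0.Dist x y j → S0 u ≡ true →
      Σ ℕ (λ m' → m' ≤ suc j × C0.Dist x (y ∙ u) m' × j ≤ suc m')
    nbr-dist {x} {y} {j} {u} dy su =
      let (m' , le , dm) = C0.Dist-exists (C0.R-step (C0.Dist-R dy) (C0.Adj-intro y su))
          adj = trans (CS0.Adj-back y u) su
      in m' , le , dm , C0.Dist-min dy (C0.R-step (C0.Dist-R dm) adj)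

    s2s≡ : ∀ y → (y ∙ s2) ∙ s ≡ y ∙ (s ⁻¹)
    s2s≡ y = trans (assoc y s2 s) (cong (y ∙_) (trans (comm s2 s) (sym s⁻¹≡)))

    ys-dist : ∀ {x y j} → Hs x ≡ true → Hs y ≡ true → C0.Dist x y j → j ≤ i → C.Dist x (y ∙ s) (suc j)
    ys-dist hx hy dy le = dist-to-coset hx hy dy le (inj₁ refl)

    ys⁻-dist : ∀ {x y j} → Hs x ≡ true → Hs y ≡ true → C0.Dist x y j → j ≤ i → C.Dist x (y ∙ (s ⁻¹)) (suc j)
    ys⁻-dist {x} {y} {j} hx hy dy le = subst (λ z → C.Dist x z (suc j)) (s2s≡ y) (dist-to-coset hx hy dy le (inj₂ refl))

    nbrs-H : ∀ {x y j} → Hs x ≡ true → Hs y ≡ true → C0.Dist x y j → j ≤ i → ∀ m →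
      N x y m ≡ N0 x y m + (b2n (IsDist S x (y ∙ s) m) + b2n (IsDist S x (y ∙ (s ⁻¹)) m))
    nbrs-H {x} {y} {j} hx hy dy le m = trans (S-count (λ u → IsDist S x (y ∙ u) m))
      (cong (_+ (b2n (IsDist S x (y ∙ s) m) + b2n (IsDist S x (y ∙ (s ⁻¹)) m))) (countF-cong pw))
      where
      pw : ∀ u → S0 u ∧ IsDist S x (y ∙ u) m ≡ S0 u ∧ IsDist S0 x (y ∙ u) m
      pw u with S0 u in su
      ... | false = refl
      ... | true = let (m' , le' , dm , _) = nbr-dist dy su in
          isd-eq dm (dist-within-H hx (H-mul hy (H-S0 su)) dm (NP.≤-trans le' (ℕ.s≤s le))) m

    nbrs-H-off : ∀ {x y j} → Hs x ≡ true → Hs y ≡ true → C0.Dist x y j → j ≤ i → ∀ m → ¬ m ≡ suc j → N x y m ≡ N0 x y m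
    nbrs-H-off {x} {y} hx hy dy le m ne = trans (nbrs-H hx hy dy le m)
      (trans (cong₂ (λ a b → N0 x y m + (b2n a + b2n b)) (C.Dist-other (ys-dist hx hy dy le) ne) (C.Dist-other (ys⁻-dist hx hy dy le) ne))
        (NP.+-identityʳ _))

    nbrs-H-top : ∀ {x y j} → Hs x ≡ true → Hs y ≡ true → C0.Dist x y j → j ≤ i → N x y (suc j) ≡ N0 x y (suc j) + 2
    nbrs-H-top {x} {y} {j} hx hy dy le = trans (nbrs-H hx hy dy le (suc j))
      (cong₂ (λ a b → N0 x y (suc j) + (b2n a + b2n b)) (C.unD (ys-dist hx hy dy le)) (C.unD (ys⁻-dist hx hy dy le)))

    coset-far : ∀ {x w j} → Hs x ≡ true → Hs w ≡ true → C0.Dist x w j → suc j ≤ i → ∀ k → k ≤ suc j →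
      IsDist S x (w ∙ s2) k ≡ false
    coset-far {x} {w} {j} hx hw dw le k kle = bcase (IsDist S x (w ∙ s2) k) contra (λ e → e)
      where
      contra : IsDist S x (w ∙ s2) k ≡ true → IsDist S x (w ∙ s2) k ≡ false
      contra e with walk-within-H hx (H-mul hw s²∈H) (C.Dist-R (C.mkD {x} {w ∙ s2} {k} e))
      ... | inj₁ r0 = ⊥-elim (far-absurd kle le (detour-length hx (C0.Dist-R dw) r0))
      ... | inj₂ (two , r0) = ⊥-elim (near-absurd two kle (C0.Dist-min dw (subst (C0.R _ x) (s²s²≡ε w) r0)))

    nbrs-coset : ∀ {x w j} → Hs x ≡ true → Hs w ≡ true → C0.Dist x w j → suc j ≤ i → ∀ m →
      N x (w ∙ s) (suc m) ≡ N0 x w m + (b2n (IsDist S x (w ∙ s2) (suc m)) + b2n (IsDist S x w (suc m)))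
    nbrs-coset {x} {w} {j} hx hw dw le m = trans (S-count (λ u → IsDist S x ((w ∙ s) ∙ u) (suc m)))
      (cong₂ _+_ (countF-cong pw)
        (cong₂ _+_ (cong (λ z → b2n (IsDist S x z (suc m))) (assoc w s s))
                   (cong (λ z → b2n (IsDist S x z (suc m))) (cancelʳ w s))))
      where
      pw : ∀ u → S0 u ∧ IsDist S x ((w ∙ s) ∙ u) (suc m) ≡ S0 u ∧ IsDist S0 x (w ∙ u) m
      pw u with S0 u in su
      ... | false = refl
      ... | true = let (m' , le' , dm , _) = nbr-dist dw su in
          trans (cong (λ z → IsDist S x z (suc m)) (rcomm w s u))
            (isd-odd (dist-to-coset hx (H-mul hw (H-S0 su)) dm (NP.≤-trans le' le) (inj₁ refl)) dm m)

    exclude-level : ∀ a b c → (a ≡ true → c ≡ true → b ≡ false) → (a ∧ not b) ∧ c ≡ a ∧ c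
    exclude-level false b c h = refl
    exclude-level true b false h with b
    ... | true = refl
    ... | false = refl
    exclude-level true true true h with h refl refl
    ... | ()
    exclude-level true false true h = refl

    remaining-level : ∀ a b c e → (a ≡ true → b ≡ false → c ≡ false → e ≡ true) → (a ≡ true → e ≡ true → b ≡ false) →
      (a ≡ true → e ≡ true → c ≡ false) → (a ∧ not b) ∧ not c ≡ a ∧ e
    remaining-level false b c e h1 h2 h3 = refl
    remaining-level true b c true h1 h2 h3 with h2 refl refl | h3 refl refl
    ... | refl | refl = refl
    remaining-level true true c false h1 h2 h3 = refl
    remaining-level true false true false h1 h2 h3 = refl
    remaining-level true false false false h1 h2 h3 with h1 refl refl refl
    ... | ()

    nbrs₀-partition : ∀ {x w j'} → C0.Dist x w (suc j') →
      countF S0 ≡ N0 x w j' + (N0 x w (suc j') + N0 x w (suc (suc j')))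
    nbrs₀-partition {x} {w} {j'} dw = trans (countF-split S0 A)
      (cong (N0 x w j' +_) (trans (countF-split (λ u → S0 u ∧ not (A u)) B)
        (cong₂ _+_ (countF-cong (λ u → exclude-level (S0 u) (A u) (B u) (h1 u))) (countF-cong (λ u → remaining-level (S0 u) (A u) (B u) (C u) (h2 u) (h3 u) (h4 u))))))
      where
      A B C : Fin n → Bool
      A u = IsDist S0 x (w ∙ u) j'
      B u = IsDist S0 x (w ∙ u) (suc j')
      C u = IsDist S0 x (w ∙ u) (suc (suc j'))
      h1 : ∀ u → S0 u ≡ true → B u ≡ true → A u ≡ false
      h1 u _ e = C0.Dist-other (C0.mkD {x} {w ∙ u} {suc j'} e) (λ q → NP.1+n≢n (sym q))
      h3 : ∀ u → S0 u ≡ true → C u ≡ true → A u ≡ false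
      h3 u _ e = C0.Dist-other (C0.mkD {x} {w ∙ u} {suc (suc j')} e) (n≢2+n j')
      h4 : ∀ u → S0 u ≡ true → C u ≡ true → B u ≡ false
      h4 u _ e = C0.Dist-other (C0.mkD {x} {w ∙ u} {suc (suc j')} e) (λ q → NP.1+n≢n (sym q))
      h2 : ∀ u → S0 u ≡ true → A u ≡ false → B u ≡ false → C u ≡ true
      h2 u su na nb = let (m' , le , dm , lo) = nbr-dist dw su in
        subst (λ k → IsDist S0 x (w ∙ u) k ≡ true)
          (squeeze-level le (NP.≤-pred lo) (λ q → true≢false (subst (λ k → IsDist S0 x (w ∙ u) k ≡ true) q (C0.unD dm)) na)
                                (λ q → true≢false (subst (λ k → IsDist S0 x (w ∙ u) k ≡ true) q (C0.unD dm)) nb))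
          (C0.unD dm)

    -- a vertex of H at Γ₀-distance j from x₀, for every j ≤ i, on a geodesic from x₀ to x₀ s²
    geodesic-vertex : ∀ j → j ≤ i → Σ (Fin n) (λ w → Hs w ≡ true × C0.Dist x₀ w j)
    geodesic-vertex j le = let (w , dw) = C0.Dist-prefix x₀-to-x₀s² (NP.≤-trans le (NP.≤-trans (NP.m≤m+n i i) 2i≤d))
                   in w , H-reach hx₀ (C0.Dist-R dw) , dw

    geo : ∀ j → j ≤ i → Fin n
    geo j le = proj₁ (geodesic-vertex j le)

    geo∈H : ∀ j (le : j ≤ i) → Hs (geo j le) ≡ true
    geo∈H j le = proj₁ (proj₂ (geodesic-vertex j le))

    geo-dist : ∀ j (le : j ≤ i) → C0.Dist x₀ (geo j le) j
    geo-dist j le = proj₂ (proj₂ (geodesic-vertex j le))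

    DRc : ∀ {j x y x' y'} → C.Dist x y j → C.Dist x' y' j → cnt-c S j x y ≡ cnt-c S j x' y'
    DRc {j} {x} {y} {x'} {y'} a b = proj₁ (proj₂ DR j x y x' y' (C.unD a) (C.unD b))

    DRa : ∀ {j x y x' y'} → C.Dist x y j → C.Dist x' y' j → cnt-a S j x y ≡ cnt-a S j x' y'
    DRa {j} {x} {y} {x'} {y'} a b = proj₁ (proj₂ (proj₂ DR j x y x' y' (C.unD a) (C.unD b)))

    DRb : ∀ {j x y x' y'} → C.Dist x y j → C.Dist x' y' j → cnt-b S j x y ≡ cnt-b S j x' y'
    DRb {j} {x} {y} {x'} {y'} a b = proj₂ (proj₂ (proj₂ DR j x y x' y' (C.unD a) (C.unD b)))

    adj1 : ∀ {x y} → C.Dist x y 1 → Adj S x y ≡ true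
    adj1 dd with C.R-inv (C.Dist-R dd)
    ... | inj₁ p = ⊥-elim (NP.1+n≰n (C.Dist-min dd p))
    ... | inj₂ (z , p , q) with C.R-zero p
    ... | refl = q

    -- c_j = j and a_j = 0 for 1 ≤ j ≤ i; by induction, computing at a vertex w s with w ∈ H
    small-c-a : ∀ j' → suc j' ≤ i → ∀ x' y' → C.Dist x' y' (suc j') →
      cnt-c S (suc j') x' y' ≡ suc j' × cnt-a S (suc j') x' y' ≡ 0
    small-c-a zero le x' y' dd = trans (countF-point x' (λ z → Adj S z y')) (cong b2n (adj1 dd)) , a1 x' y' (C.unD dd)
    small-c-a (suc j'') le x' y' dd = trans (DRc dd dws) cw , trans (DRa dd dws) aw
      where
      jj : ℕ
      jj = suc j''
      jji : jj ≤ i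
      jji = NP.≤-trans (NP.n≤1+n jj) le
      IH : ∀ x' y' → C.Dist x' y' jj → cnt-c S jj x' y' ≡ jj × cnt-a S jj x' y' ≡ 0
      IH = small-c-a j'' jji
      w : Fin n
      w = geo jj jji
      hw : Hs w ≡ true
      hw = geo∈H jj jji
      dw : C0.Dist x₀ w jj
      dw = geo-dist jj jji
      dws : C.Dist x₀ (w ∙ s) (suc jj)
      dws = dist-to-coset hx₀ hw dw jji (inj₁ refl)
      dwS : C.Dist x₀ w jj
      dwS = dist-within-H hx₀ hw dw (NP.≤-trans jji (NP.n≤1+n i))
      cw : cnt-c S (suc jj) x₀ (w ∙ s) ≡ suc jj
      cw = begin
        cnt-c S (suc jj) x₀ (w ∙ s) ≡⟨ cntc≡N x₀ (w ∙ s) jj ⟩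
        N x₀ (w ∙ s) (suc j'') ≡⟨ nbrs-coset hx₀ hw dw le j'' ⟩
        N0 x₀ w j'' + (b2n (IsDist S x₀ (w ∙ s2) (suc j'')) + b2n (IsDist S x₀ w (suc j'')))
          ≡⟨ cong₂ (λ a b → N0 x₀ w j'' + (b2n a + b2n b)) (coset-far hx₀ hw dw le (suc j'') (NP.n≤1+n _)) (C.unD dwS) ⟩
        N0 x₀ w j'' + 1 ≡⟨ cong (_+ 1) (sym (nbrs-H-off hx₀ hw dw jji j'' (n≢2+n j''))) ⟩
        N x₀ w j'' + 1 ≡⟨ cong (_+ 1) (sym (cntc≡N x₀ w j'')) ⟩
        cnt-c S jj x₀ w + 1 ≡⟨ cong (_+ 1) (proj₁ (IH x₀ w dwS)) ⟩
        jj + 1 ≡⟨ NP.+-comm jj 1 ⟩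
        suc jj ∎
        where open ≡-Reasoning
      aw : cnt-a S (suc jj) x₀ (w ∙ s) ≡ 0
      aw = begin
        cnt-a S (suc jj) x₀ (w ∙ s) ≡⟨ cnta≡N x₀ (w ∙ s) (suc jj) ⟩
        N x₀ (w ∙ s) (suc jj) ≡⟨ nbrs-coset hx₀ hw dw le jj ⟩
        N0 x₀ w jj + (b2n (IsDist S x₀ (w ∙ s2) (suc jj)) + b2n (IsDist S x₀ w (suc jj)))
          ≡⟨ cong₂ (λ a b → N0 x₀ w jj + (b2n a + b2n b)) (coset-far hx₀ hw dw le (suc jj) NP.≤-refl) (C.Dist-other dwS NP.1+n≢n) ⟩
        N0 x₀ w jj + 0 ≡⟨ NP.+-identityʳ _ ⟩
        N0 x₀ w jj ≡⟨ sym (nbrs-H-off hx₀ hw dw jji jj (λ q → NP.1+n≢n (sym q))) ⟩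
        N x₀ w jj ≡⟨ sym (cnta≡N x₀ w jj) ⟩
        cnt-a S jj x₀ w ≡⟨ proj₂ (IH x₀ w dwS) ⟩
        0 ∎
        where open ≡-Reasoning

    x≡xu : ∀ {x u} → x ≡ x ∙ u → u ≡ ε
    x≡xu {x} {u} e = trans (sym (cancelˡ x u)) (trans (cong ((x ⁻¹) ∙_) (sym e)) (inverseˡ x))

    dist1 : ∀ x {u} → S u ≡ true → C.Dist x (x ∙ u) 1
    dist1 x {u} su = C.Dist-intro (C.R-step (C.R-refl 0 x) (C.Adj-intro x su)) min
      where
      min : ∀ j → C.R j x (x ∙ u) → 1 ≤ j
      min zero r = ⊥-elim (true≢false (subst (λ z → S z ≡ true) (x≡xu (C.R-zero r)) su) Sε)
      min (suc j) r = ℕ.s≤s ℕ.z≤n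

    -- b_j + j = |S| for j < i, from the partition of the neighbours of a vertex at level j
    b+j≡valency : ∀ j → suc j ≤ i → ∀ x' y' → C.Dist x' y' j → cnt-b S j x' y' + j ≡ countF S
    b+j≡valency zero le x' y' dd with C.R-zero (C.Dist-R dd)
    ... | refl = trans (NP.+-identityʳ _) (trans (cntb≡N x' x' 0) (countF-cong pw))
      where
      pw : ∀ u → S u ∧ IsDist S x' (x' ∙ u) 1 ≡ S u
      pw u with S u in su
      ... | false = refl
      ... | true = C.unD (dist1 x' su)
    b+j≡valency (suc j') le x' y' dd = trans (cong (_+ suc j') (DRb dd dwS)) bw
      where
      j'i : suc j' ≤ i
      j'i = NP.≤-trans (NP.n≤1+n _) le
      w : Fin n
      w = geo (suc j') j'i
      hw : Hs w ≡ true
      hw = geo∈H (suc j') j'i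
      dw : C0.Dist x₀ w (suc j')
      dw = geo-dist (suc j') j'i
      dwS : C.Dist x₀ w (suc j')
      dwS = dist-within-H hx₀ hw dw (NP.≤-trans j'i (NP.n≤1+n i))
      X : ℕ
      X = N0 x₀ w (suc (suc j'))
      e1 : N0 x₀ w j' ≡ suc j'
      e1 = trans (sym (nbrs-H-off hx₀ hw dw j'i j' (n≢2+n j')))
             (trans (sym (cntc≡N x₀ w j')) (proj₁ (small-c-a j' j'i x₀ w dwS)))
      e2 : N0 x₀ w (suc j') ≡ 0
      e2 = trans (sym (nbrs-H-off hx₀ hw dw j'i (suc j') (λ q → NP.1+n≢n (sym q))))
             (trans (sym (cnta≡N x₀ w (suc j'))) (proj₂ (small-c-a j' j'i x₀ w dwS)))
      bw : cnt-b S (suc j') x₀ w + suc j' ≡ countF S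
      bw = begin
        cnt-b S (suc j') x₀ w + suc j' ≡⟨ cong (_+ suc j') (trans (cntb≡N x₀ w (suc j')) (nbrs-H-top hx₀ hw dw j'i)) ⟩
        (X + 2) + suc j' ≡⟨ ar X j' ⟩
        (suc j' + (0 + X)) + 2 ≡⟨ cong (λ z → z + 2) (sym (cong₂ (λ a b → a + (b + X)) e1 e2)) ⟩
        (N0 x₀ w j' + (N0 x₀ w (suc j') + X)) + 2 ≡⟨ cong (_+ 2) (sym (nbrs₀-partition dw)) ⟩
        countF S0 + 2 ≡⟨ sym valency-S₀ ⟩
        countF S ∎
        where
        open ≡-Reasoning
        ar : ∀ a b → (a + 2) + suc b ≡ (suc b + (0 + a)) + 2
        ar a b = trans (NP.+-comm (a + 2) (suc b)) (sym (NP.+-assoc (suc b) a 2))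

    no-nbr-at-level : ∀ {x v m} j' → C.Dist x v m →
      ¬ m ≡ suc (suc j') → ¬ m ≡ suc j' → ¬ m ≡ j' → N x v (suc j') ≡ 0
    no-nbr-at-level {x} {v} {m} j' dm n1 n2 n3 = countF-false _ pw
      where
      pw : ∀ u → S u ∧ IsDist S x (v ∙ u) (suc j') ≡ false
      pw u with S u in su
      ... | false = refl
      ... | true = bcase (IsDist S x (v ∙ u) (suc j')) (λ e → ⊥-elim (contra e)) (λ e → e)
        where
        contra : IsDist S x (v ∙ u) (suc j') ≡ true → ⊥
        contra e = n1 (squeeze-level (C.Dist-min dm r1) (NP.≤-pred (C.Dist-min du r2)) n3 n2)
          where
          du : C.Dist x (v ∙ u) (suc j')
          du = C.mkD e
          r1 : C.R (suc (suc j')) x v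
          r1 = C.R-step (C.Dist-R du) (trans (CS.Adj-back v u) su)
          r2 : C.R (suc m) x (v ∙ u)
          r2 = C.R-step (C.Dist-R dm) (C.Adj-intro v su)

    three-term : ∀ j' (cc bb : ℕ) →
      (∀ x y → C.Dist x y (suc (suc j')) → cnt-c S (suc (suc j')) x y ≡ cc) →
      (∀ x y → C.Dist x y (suc j') → cnt-a S (suc j') x y ≡ 0) →
      (∀ x y → C.Dist x y j' → cnt-b S j' x y ≡ bb) →
      ∀ x v → N x v (suc j') ≡ cc * b2n (IsDist S x v (suc (suc j'))) + bb * b2n (IsDist S x v j')
    three-term j' cc bb hc ha hb x v = go (proj₁ (proj₁ DR x v)) (C.mkD (proj₂ (proj₁ DR x v)))
      where
      rhs : ℕ → ℕ → ℕ
      rhs a b = cc * a + bb * b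
      go : ∀ m → C.Dist x v m → N x v (suc j') ≡ rhs (b2n (IsDist S x v (suc (suc j')))) (b2n (IsDist S x v j'))
      go m dm with m NP.≟ suc (suc j') | m NP.≟ suc j' | m NP.≟ j'
      ... | yes refl | _ | _ = begin
          N x v (suc j') ≡⟨ sym (cntc≡N x v (suc j')) ⟩
          cnt-c S (suc (suc j')) x v ≡⟨ hc x v dm ⟩
          cc ≡⟨ sym (trans (cong₂ _+_ (NP.*-identityʳ cc) (NP.*-zeroʳ bb)) (NP.+-identityʳ cc)) ⟩
          rhs 1 0 ≡⟨ cong₂ (λ a b → rhs (b2n a) (b2n b)) (sym (C.unD dm)) (sym (C.Dist-other dm (n≢2+n j'))) ⟩
          rhs (b2n (IsDist S x v (suc (suc j')))) (b2n (IsDist S x v j')) ∎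
        where open ≡-Reasoning
      ... | no _ | yes refl | _ = begin
          N x v (suc j') ≡⟨ sym (cnta≡N x v (suc j')) ⟩
          cnt-a S (suc j') x v ≡⟨ ha x v dm ⟩
          0 ≡⟨ sym (cong₂ _+_ (NP.*-zeroʳ cc) (NP.*-zeroʳ bb)) ⟩
          rhs 0 0 ≡⟨ cong₂ (λ a b → rhs (b2n a) (b2n b)) (sym (C.Dist-other dm NP.1+n≢n)) (sym (C.Dist-other dm (λ q → NP.1+n≢n (sym q)))) ⟩
          rhs (b2n (IsDist S x v (suc (suc j')))) (b2n (IsDist S x v j')) ∎
        where open ≡-Reasoning
      ... | no _ | no _ | yes refl = begin
          N x v (suc m) ≡⟨ sym (cntb≡N x v m) ⟩
          cnt-b S m x v ≡⟨ hb x v dm ⟩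
          bb ≡⟨ sym (cong₂ _+_ (NP.*-zeroʳ cc) (NP.*-identityʳ bb)) ⟩
          rhs 0 1 ≡⟨ cong₂ (λ a b → rhs (b2n a) (b2n b)) (sym (C.Dist-other dm (λ q → n≢2+n m (sym q)))) (sym (C.unD dm)) ⟩
          rhs (b2n (IsDist S x v (suc (suc m)))) (b2n (IsDist S x v m)) ∎
        where open ≡-Reasoning
      ... | no n1 | no n2 | no n3 = begin
          N x v (suc j') ≡⟨ no-nbr-at-level j' dm n1 n2 n3 ⟩
          0 ≡⟨ sym (cong₂ _+_ (NP.*-zeroʳ cc) (NP.*-zeroʳ bb)) ⟩
          rhs 0 0 ≡⟨ cong₂ (λ a b → rhs (b2n a) (b2n b)) (sym (C.Dist-other dm (λ q → n1 (sym q)))) (sym (C.Dist-other dm (λ q → n3 (sym q)))) ⟩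
          rhs (b2n (IsDist S x v (suc (suc j')))) (b2n (IsDist S x v j')) ∎
        where open ≡-Reasoning

    three-term₀ : ∀ x v → N x v 0 ≡ b2n (IsDist S x v 1)
    three-term₀ x v = trans (sym (cntc≡N x v 0)) (go (proj₁ (proj₁ DR x v)) (C.mkD (proj₂ (proj₁ DR x v))))
      where
      go : ∀ m → C.Dist x v m → cnt-c S 1 x v ≡ b2n (IsDist S x v 1)
      go m dm with m NP.≟ 1
      ... | yes refl = trans (countF-point x (λ z → Adj S z v)) (cong b2n (trans (adj1 dm) (sym (C.unD dm))))
      ... | no ne = trans (countF-point x (λ z → Adj S z v)) (cong b2n (trans nadj (sym (C.Dist-other dm (λ q → ne (sym q))))))
        where
        nadj : Adj S x v ≡ false
        nadj = bcase (Adj S x v) (λ a → ⊥-elim (ne (NP.≤-antisym (C.Dist-min dm (C.R-step (C.R-refl 0 x) a)) (lo m dm a)))) (λ a → a)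
          where
          adjxx : Adj S x x ≡ false
          adjxx = trans (cong (λ z → Adj S z x) (sym (identityʳ x))) (trans (CS.Adj-back x ε) Sε)
          lo : ∀ k → C.Dist x v k → Adj S x v ≡ true → 1 ≤ k
          lo zero dk a = ⊥-elim (true≢false (subst (λ z → Adj S x z ≡ true) (sym (C.R-zero (C.Dist-R dk))) a) adjxx)
          lo (suc _) _ _ = ℕ.s≤s ℕ.z≤n

  module CountsAsMatrices where
    open import Data.Nat as ℕ using (ℕ; zero; suc; _≤_; _<_; _∸_)
    open import Data.Fin using (Fin; zero; suc; _≟_)
    open import Relation.Binary.PropositionalEquality
    open import Data.Bool using (Bool; true; false; _∧_; _∨_; if_then_else_)
    open import Data.Product
    open import Defs

    open IntersectionNumbers public
    open HMatrices _∙_ ε _⁻¹ Hs public hiding (g; Mat; ind)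
    open FinSums
    open RationalEmbedding
    import Data.Integer as ℤ
    import Data.Integer.Properties as ZP
    open import Data.Rational as ℚ using (ℚ; 0ℚ; _+_; _*_)
    import Data.Rational.Properties as QP
    open import Data.Sum
    open import Function using (_∘_)
    open import Relation.Nullary using (¬_)
    open import Data.Rational.Solver
    open +-*-Solver

    gd : Bool → ℚ → ℚ
    gd b a = if b then a else 0ℚ

    A : Mat
    A x y = ind (Adj S0 x y)

    P : Mat
    P x y = ind (y == (x ∙ (s ∙ s)))

    fromℕ-+ : ∀ a b → fromℕ (a ℕ.+ b) ≡ fromℕ a + fromℕ b
    fromℕ-+ a b = trans (cong ι (ZP.pos-+ a b)) (ι-+ (ℤ.+ a) (ℤ.+ b))

    fromℕ-* : ∀ a b → fromℕ (a ℕ.* b) ≡ fromℕ a * fromℕ b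
    fromℕ-* a b = trans (cong ι (ZP.pos-* a b)) (ι-* (ℤ.+ a) (ℤ.+ b))

    fromℕ-b2n : ∀ b → fromℕ (b2n b) ≡ ind b
    fromℕ-b2n false = refl
    fromℕ-b2n true = refl

    fromℕ-countF : ∀ {m} (f : Fin m → Bool) → fromℕ (countF f) ≡ sumF (λ u → ind (f u))
    fromℕ-countF {zero} f = refl
    fromℕ-countF {suc m} f = trans (fromℕ-+ (b2n (f zero)) _) (cong₂ _+_ (fromℕ-b2n (f zero)) (fromℕ-countF (λ u → f (suc u))))

    s2-inv : ∀ y z → (y ≡ z ∙ s2) → z ≡ y ∙ s2
    s2-inv y z e = trans (sym (s²s²≡ε z)) (cong (_∙ s2) (sym e))

    ==-s2 : ∀ y z → (y == (z ∙ s2)) ≡ ((y ∙ s2) == z)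
    ==-s2 y z = bool-ext (λ e → ==-true (sym (s2-inv y z (==-sound e))))
                         (λ e → ==-true (s2-inv z y (sym (==-sound e))))

    sum-point' : ∀ (c : Fin n) (F : Fin n → ℚ) → Hs c ≡ true →
      sumF (λ z → gd (Hs z) (F z * ind (c == z))) ≡ F c
    sum-point' c F hc = trans (sumF-cong pw) (trans (sumF-point c (λ z → gd (Hs z) (F z))) (cong (λ b → gd b (F c)) hc))
      where
      pw : ∀ z → gd (Hs z) (F z * ind (c == z)) ≡ (if c == z then gd (Hs z) (F z) else 0ℚ)
      pw z with c == z
      ... | true = cong (gd (Hs z)) (QP.*-identityʳ (F z))
      ... | false = trans (cong (gd (Hs z)) (QP.*-zeroʳ (F z))) (g-0 (Hs z))

    ⊗P : ∀ M x y → Hs y ≡ true → (M ⊗ P) x y ≡ M x (y ∙ s2)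
    ⊗P M x y hy = trans (sumF-cong (λ z → cong (λ b → gd (Hs z) (M x z * ind b)) (==-s2 y z)))
      (sum-point' (y ∙ s2) (M x) (H-mul hy s²∈H))

    P⊗ : ∀ M x y → Hs x ≡ true → (P ⊗ M) x y ≡ M (x ∙ s2) y
    P⊗ M x y hx = trans (sumF-cong (λ z → cong (gd (Hs z)) (QP.*-comm (ind (z == (x ∙ s2))) (M z y))))
      (trans (sumF-cong (λ z → cong (λ b → gd (Hs z) (M z y * ind b)) (==-sym z (x ∙ s2))))
        (sum-point' (x ∙ s2) (λ z → M z y) (H-mul hx s²∈H)))

    ⊗PI : ∀ M x y → Hs x ≡ true → Hs y ≡ true → (M ⊗ (P ⊕ Id)) x y ≡ M x (y ∙ s2) + M x y
    ⊗PI M x y hx hy = trans (⊗-distribˡ M P Id x y) (cong₂ _+_ (⊗P M x y hy) (⊗-Id M x y hx hy))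

    Adj-transl-eq : ∀ T g z y → Adj T (g ∙ z) (g ∙ y) ≡ Adj T z y
    Adj-transl-eq T g z y = bool-ext
      (λ e → subst₂ (λ a b → Adj T a b ≡ true) (cancelˡ g z) (cancelˡ g y) (Cay.Adj-transl T (g ⁻¹) e))
      (λ e → Cay.Adj-transl T g e)

    -- A and P commute, since translation by s² is an automorphism of Γ₀
    AP≈PA : (A ⊗ P) ≈ (P ⊗ A)
    AP≈PA x y hx hy = trans (⊗P A x y hy) (trans (cong ind eq) (sym (P⊗ A x y hx)))
      where
      e1 : s2 ∙ (x ∙ s2) ≡ x
      e1 = trans (comm s2 _) (s²s²≡ε x)
      e2 : s2 ∙ y ≡ y ∙ s2
      e2 = comm s2 y
      eq : Adj S0 x (y ∙ s2) ≡ Adj S0 (x ∙ s2) y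
      eq = trans (cong₂ (Adj S0) (sym e1) (sym e2)) (Adj-transl-eq S0 s2 (x ∙ s2) y)

    ⊗A : ∀ M x y → Hs y ≡ true → (M ⊗ A) x y ≡ sumF (λ u → gd (S0 u) (M x (y ∙ u)))
    ⊗A M x y hy = trans (sumF-perm (λ z → gd (Hs z) (M x z * A z y)) (y ∙_) ((y ⁻¹) ∙_) (cancelˡ' y) (cancelˡ y))
      (sumF-cong pw)
      where
      pw : ∀ u → gd (Hs (y ∙ u)) (M x (y ∙ u) * ind (Adj S0 (y ∙ u) y)) ≡ gd (S0 u) (M x (y ∙ u))
      pw u rewrite CS0.Adj-back y u with S0 u in su
      ... | true rewrite H-mul hy (H-S0 su) = QP.*-identityʳ _
      ... | false = trans (cong (gd (Hs (y ∙ u))) (QP.*-zeroʳ (M x (y ∙ u)))) (g-0 (Hs (y ∙ u)))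

    -- the two blocks of A_m indexed by H × H and H × H s
    D00 D01 : ℕ → Mat
    D00 m x y = ind (IsDist S x y m)
    D01 m x y = ind (IsDist S x (y ∙ s) m)

    ind-∧ : ∀ a b → ind (a ∧ b) ≡ gd a (ind b)
    ind-∧ false b = refl
    ind-∧ true b = refl

    nbrs-matrix₀₀ : ∀ m x y → Hs y ≡ true → fromℕ (N x y m) ≡ (D00 m ⊗ A) x y + (D01 m x (y ∙ s2) + D01 m x y)
    nbrs-matrix₀₀ m x y hy = begin
      fromℕ (N x y m) ≡⟨ cong fromℕ (S-count f) ⟩
      fromℕ (countF (λ u → S0 u ∧ f u) ℕ.+ (b2n (f s) ℕ.+ b2n (f (s ⁻¹))))
        ≡⟨ trans (fromℕ-+ (countF (λ u → S0 u ∧ f u)) (b2n (f s) ℕ.+ b2n (f (s ⁻¹)))) (cong (fromℕ (countF (λ u → S0 u ∧ f u)) +_) (fromℕ-+ (b2n (f s)) (b2n (f (s ⁻¹))))) ⟩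
      fromℕ (countF (λ u → S0 u ∧ f u)) + (fromℕ (b2n (f s)) + fromℕ (b2n (f (s ⁻¹))))
        ≡⟨ cong₂ _+_ (trans (fromℕ-countF (λ u → S0 u ∧ f u)) (trans (sumF-cong (λ u → ind-∧ (S0 u) (f u))) (sym (⊗A (D00 m) x y hy))))
                     (cong₂ _+_ (fromℕ-b2n (f s)) (trans (fromℕ-b2n (f (s ⁻¹))) (cong (λ z → ind (IsDist S x z m)) (sym (s2s≡ y))))) ⟩
      (D00 m ⊗ A) x y + (D01 m x y + D01 m x (y ∙ s2)) ≡⟨ cong ((D00 m ⊗ A) x y +_) (QP.+-comm (D01 m x y) _) ⟩
      (D00 m ⊗ A) x y + (D01 m x (y ∙ s2) + D01 m x y) ∎
      where
      open ≡-Reasoning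
      f : Fin n → Bool
      f u = IsDist S x (y ∙ u) m

    nbrs-matrix₀₁ : ∀ m x y → Hs y ≡ true → fromℕ (N x (y ∙ s) m) ≡ (D01 m ⊗ A) x y + (D00 m x (y ∙ s2) + D00 m x y)
    nbrs-matrix₀₁ m x y hy = begin
      fromℕ (N x (y ∙ s) m) ≡⟨ cong fromℕ (S-count f) ⟩
      fromℕ (countF (λ u → S0 u ∧ f u) ℕ.+ (b2n (f s) ℕ.+ b2n (f (s ⁻¹))))
        ≡⟨ trans (fromℕ-+ (countF (λ u → S0 u ∧ f u)) (b2n (f s) ℕ.+ b2n (f (s ⁻¹)))) (cong (fromℕ (countF (λ u → S0 u ∧ f u)) +_) (fromℕ-+ (b2n (f s)) (b2n (f (s ⁻¹))))) ⟩
      fromℕ (countF (λ u → S0 u ∧ f u)) + (fromℕ (b2n (f s)) + fromℕ (b2n (f (s ⁻¹))))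
        ≡⟨ cong₂ _+_ (trans (fromℕ-countF (λ u → S0 u ∧ f u))
                       (trans (sumF-cong (λ u → trans (ind-∧ (S0 u) (f u)) (cong (λ z → gd (S0 u) (ind (IsDist S x z m))) (rcomm y s u))))
                         (sym (⊗A (D01 m) x y hy))))
                     (cong₂ _+_ (trans (fromℕ-b2n (f s)) (cong (λ z → ind (IsDist S x z m)) (assoc y s s)))
                                (trans (fromℕ-b2n (f (s ⁻¹))) (cong (λ z → ind (IsDist S x z m)) (cancelʳ y s)))) ⟩
      (D01 m ⊗ A) x y + (D00 m x (y ∙ s2) + D00 m x y) ∎
      where
      open ≡-Reasoning
      f : Fin n → Bool
      f u = IsDist S x ((y ∙ s) ∙ u) m

    three-termℚ : ∀ j' (cc bb : ℕ) →
      (∀ x y → C.Dist x y (suc (suc j')) → cnt-c S (suc (suc j')) x y ≡ cc) →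
      (∀ x y → C.Dist x y (suc j') → cnt-a S (suc j') x y ≡ 0) →
      (∀ x y → C.Dist x y j' → cnt-b S j' x y ≡ bb) →
      ∀ x v → fromℕ (N x v (suc j')) ≡ fromℕ cc * ind (IsDist S x v (suc (suc j'))) + fromℕ bb * ind (IsDist S x v j')
    three-termℚ j' cc bb hc ha hb x v = trans (cong fromℕ (three-term j' cc bb hc ha hb x v))
      (trans (fromℕ-+ (cc ℕ.* b2n (IsDist S x v (suc (suc j')))) (bb ℕ.* b2n (IsDist S x v j')))
        (cong₂ _+_ (trans (fromℕ-* cc (b2n (IsDist S x v (suc (suc j'))))) (cong (fromℕ cc *_) (fromℕ-b2n (IsDist S x v (suc (suc j'))))))
                   (trans (fromℕ-* bb (b2n (IsDist S x v j'))) (cong (fromℕ bb *_) (fromℕ-b2n (IsDist S x v j'))))))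

    three-term₀ℚ : ∀ x v → fromℕ (N x v 0) ≡ ind (IsDist S x v 1)
    three-term₀ℚ x v = trans (cong fromℕ (three-term₀ x v)) (fromℕ-b2n (IsDist S x v 1))

  module RecurrenceStep where
    open import Data.Nat as ℕ using (ℕ; zero; suc; _≤_; _<_; _∸_)
    open import Data.Fin using (Fin; zero; suc; _≟_)
    open import Relation.Binary.PropositionalEquality
    open import Data.Bool using (true; _∧_; _∨_; if_then_else_)
    open import Data.Product
    open import Defs

    open CountsAsMatrices public
    open FinSums
    open RationalEmbedding
    open import Data.Rational as ℚ using (ℚ; 0ℚ; _+_; _*_; -_)
    import Data.Rational.Properties as QP
    open import Data.Sum
    open import Function using (_∘_)
    open import Relation.Nullary using (¬_)
    open import Data.Rational.Solver
    open +-*-Solver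

    -- all coefficient sequences are cut at length i+2, which covers every level ≤ i+1
    polyLen : ℕ
    polyLen = suc (suc i)

    evalA : (ℕ → ℚ) → Mat
    evalA = polyAt A polyLen

    -- f(A) + g(A) P, the shape of the H × H block
    diagBlock : (ℕ → ℚ) → (ℕ → ℚ) → Mat
    diagBlock f g x y = evalA f x y + evalA g x (y ∙ s2)

    -- m(A) (P + I), the shape of the H × H s block
    offBlock : (ℕ → ℚ) → Mat
    offBlock m x y = evalA m x (y ∙ s2) + evalA m x y

    ⊗-congʳ≐ : ∀ M {N N'} → N ≐ N' → (M ⊗ N) ≐ (M ⊗ N')
    ⊗-congʳ≐ M e x y = sumF-cong (λ z → cong (λ v → gd (Hs z) (M x z * v)) (e z y))

    A-evalA-shift : ∀ f → f (suc i) ≡ 0ℚ → (A ⊗ evalA f) ≐ evalA (shift f)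
    A-evalA-shift f e x y = trans (⊗-congʳ≐ A (PA-ext1 A (suc i) f e) x y) (sym (PA-shift A (suc i) f x y))

    evalA-A : ∀ f → f (suc i) ≡ 0ℚ → ∀ x y → Hs x ≡ true → Hs y ≡ true → (evalA f ⊗ A) x y ≡ evalA (shift f) x y
    evalA-A f e x y hx hy = trans (PA-comm A polyLen f x y hx hy) (A-evalA-shift f e x y)

    diagBlock-A : ∀ f g → f (suc i) ≡ 0ℚ → g (suc i) ≡ 0ℚ → ∀ x y → Hs x ≡ true → Hs y ≡ true →
      (diagBlock f g ⊗ A) x y ≡ diagBlock (shift f) (shift g) x y
    diagBlock-A f g ef eg x y hx hy = begin
      (diagBlock f g ⊗ A) x y ≡⟨ ⊗-congˡ A (λ x' y' hx' hy' → cong (evalA f x' y' +_) (sym (⊗P (evalA g) x' y' hy'))) x y hx hy ⟩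
      ((evalA f ⊕ (evalA g ⊗ P)) ⊗ A) x y ≡⟨ ⊗-distribʳ (evalA f) (evalA g ⊗ P) A x y ⟩
      (evalA f ⊗ A) x y + ((evalA g ⊗ P) ⊗ A) x y ≡⟨ cong₂ _+_ (evalA-A f ef x y hx hy) e2 ⟩
      evalA (shift f) x y + evalA (shift g) x (y ∙ s2) ∎
      where
      open ≡-Reasoning
      hy2 : Hs (y ∙ s2) ≡ true
      hy2 = H-mul hy s²∈H
      e2 : ((evalA g ⊗ P) ⊗ A) x y ≡ evalA (shift g) x (y ∙ s2)
      e2 = trans (⊗-assoc (evalA g) P A x y) (trans (⊗-congʳ (evalA g) (≈-sym AP≈PA) x y hx hy)
            (trans (sym (⊗-assoc (evalA g) A P x y)) (trans (⊗P (evalA g ⊗ A) x y hy) (evalA-A g eg x (y ∙ s2) hx hy2))))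

    P+I-A-comm : ((P ⊕ Id) ⊗ A) ≈ (A ⊗ (P ⊕ Id))
    P+I-A-comm x y hx hy = trans (⊗-distribʳ P Id A x y) (trans (cong₂ _+_ (sym (AP≈PA x y hx hy)) (trans (Id-⊗ A x y hx hy) (sym (⊗-Id A x y hx hy))))
      (sym (⊗-distribˡ A P Id x y)))

    offBlock-A : ∀ m → m (suc i) ≡ 0ℚ → ∀ x y → Hs x ≡ true → Hs y ≡ true → (offBlock m ⊗ A) x y ≡ offBlock (shift m) x y
    offBlock-A m em x y hx hy = begin
      (offBlock m ⊗ A) x y ≡⟨ ⊗-congˡ A (λ x' y' hx' hy' → sym (⊗PI (evalA m) x' y' hx' hy')) x y hx hy ⟩
      ((evalA m ⊗ (P ⊕ Id)) ⊗ A) x y ≡⟨ ⊗-assoc (evalA m) (P ⊕ Id) A x y ⟩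
      (evalA m ⊗ ((P ⊕ Id) ⊗ A)) x y ≡⟨ ⊗-congʳ (evalA m) P+I-A-comm x y hx hy ⟩
      (evalA m ⊗ (A ⊗ (P ⊕ Id))) x y ≡⟨ sym (⊗-assoc (evalA m) A (P ⊕ Id) x y) ⟩
      ((evalA m ⊗ A) ⊗ (P ⊕ Id)) x y ≡⟨ ⊗PI (evalA m ⊗ A) x y hx hy ⟩
      (evalA m ⊗ A) x (y ∙ s2) + (evalA m ⊗ A) x y ≡⟨ cong₂ _+_ (evalA-A m em x (y ∙ s2) hx (H-mul hy s²∈H)) (evalA-A m em x y hx hy) ⟩
      evalA (shift m) x (y ∙ s2) + evalA (shift m) x y ∎
      where open ≡-Reasoning

    evalA-lin₃ : ∀ (a b c : ℕ → ℚ) (β κ : ℚ) x y → evalA (λ t → a t + (β * b t + κ * c t)) x y ≡ evalA a x y + (β * evalA b x y + κ * evalA c x y)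
    evalA-lin₃ a b c β κ x y = trans (PA-+ A polyLen a (λ t → β * b t + κ * c t) x y)
      (cong (evalA a x y +_) (trans (PA-+ A polyLen (λ t → β * b t) (λ t → κ * c t) x y) (cong₂ _+_ (PA-* A polyLen β b x y) (PA-* A polyLen κ c x y))))

    evalA-lin₄ : ∀ (a b c e : ℕ → ℚ) (κ : ℚ) x y → evalA (λ t → a t + ((b t + c t) + κ * e t)) x y ≡ evalA a x y + ((evalA b x y + evalA c x y) + κ * evalA e x y)
    evalA-lin₄ a b c e κ x y = trans (PA-+ A polyLen a (λ t → (b t + c t) + κ * e t) x y)
      (cong (evalA a x y +_) (trans (PA-+ A polyLen (λ t → b t + c t) (λ t → κ * e t) x y) (cong₂ _+_ (PA-+ A polyLen b c x y) (PA-* A polyLen κ e x y))))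

    move-right : ∀ (a b c : ℚ) → a ≡ b + c → b ≡ a + (- c)
    move-right a b c e = trans (solve 2 (λ b c → b := (b :+ c) :+ (:- c)) refl b c) (cong (_+ (- c)) (sym e))

    module Step (j cc : ℕ) (κ : ℚ) (f g m f' g' m' : ℕ → ℚ)
      (ef : f (suc i) ≡ 0ℚ) (eg : g (suc i) ≡ 0ℚ) (em : m (suc i) ≡ 0ℚ)
      (Pr : Fin n → Fin n → ℚ)
      (hc00 : ∀ x y → Hs x ≡ true → Hs y ≡ true → fromℕ (j ℕ.!) * D00 j x y ≡ diagBlock f g x y)
      (hc01 : ∀ x y → Hs x ≡ true → Hs y ≡ true → fromℕ (j ℕ.!) * D01 j x y ≡ offBlock m x y)
      (hp00 : ∀ x y → Hs x ≡ true → Hs y ≡ true → fromℕ (j ℕ.!) * Pr x y ≡ κ * diagBlock f' g' x y)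
      (hp01 : ∀ x y → Hs x ≡ true → Hs y ≡ true → fromℕ (j ℕ.!) * Pr x (y ∙ s) ≡ κ * offBlock m' x y)
      (hcnt : ∀ x v → fromℕ (N x v j) ≡ fromℕ cc * ind (IsDist S x v (suc j)) + Pr x v)
      where

      σ : ℚ
      σ = fromℕ (j ℕ.!)

      F⁺ G⁺ M⁺ : ℕ → ℚ
      F⁺ t = shift f t + (fromℕ 2 * m t + (- κ) * f' t)
      G⁺ t = shift g t + (fromℕ 2 * m t + (- κ) * g' t)
      M⁺ t = shift m t + ((f t + g t) + (- κ) * m' t)

      step00 : ∀ x y → Hs x ≡ true → Hs y ≡ true → σ * (fromℕ cc * D00 (suc j) x y) ≡ diagBlock F⁺ G⁺ x y
      step00 x y hx hy = begin
        σ * (fromℕ cc * D00 (suc j) x y)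
          ≡⟨ cong (σ *_) (move-right _ _ _ (hcnt x y)) ⟩
        σ * (fromℕ (N x y j) + (- Pr x y))
          ≡⟨ cong (λ z → σ * (z + (- Pr x y))) (nbrs-matrix₀₀ j x y hy) ⟩
        σ * (((D00 j ⊗ A) x y + (D01 j x (y ∙ s2) + D01 j x y)) + (- Pr x y))
          ≡⟨ solve 5 (λ σ a b c p → σ :* ((a :+ (b :+ c)) :+ (:- p)) := σ :* a :+ (σ :* b :+ σ :* c) :+ (:- (σ :* p))) refl σ _ _ _ _ ⟩
        σ * (D00 j ⊗ A) x y + (σ * D01 j x (y ∙ s2) + σ * D01 j x y) + (- (σ * Pr x y))
          ≡⟨ cong₂ (λ a b → a + b + (- (σ * Pr x y))) e1 (cong₂ _+_ e2 (hc01 x y hx hy)) ⟩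
        diagBlock (shift f) (shift g) x y + (offBlock m x y + offBlock m x y) + (- (σ * Pr x y))
          ≡⟨ cong (λ z → diagBlock (shift f) (shift g) x y + (offBlock m x y + offBlock m x y) + (- z)) (hp00 x y hx hy) ⟩
        diagBlock (shift f) (shift g) x y + (offBlock m x y + offBlock m x y) + (- (κ * diagBlock f' g' x y))
          ≡⟨ solve 7 (λ a b c e u v k → (a :+ b) :+ ((c :+ e) :+ (c :+ e)) :+ (:- (k :* (u :+ v)))
                     := (a :+ (con (fromℕ 2) :* e :+ (:- k) :* u)) :+ (b :+ (con (fromℕ 2) :* c :+ (:- k) :* v))) refl
                     (evalA (shift f) x y) (evalA (shift g) x (y ∙ s2)) (evalA m x (y ∙ s2)) (evalA m x y) (evalA f' x y) (evalA g' x (y ∙ s2)) κ ⟩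
        (evalA (shift f) x y + (fromℕ 2 * evalA m x y + (- κ) * evalA f' x y)) + (evalA (shift g) x (y ∙ s2) + (fromℕ 2 * evalA m x (y ∙ s2) + (- κ) * evalA g' x (y ∙ s2)))
          ≡⟨ sym (cong₂ _+_ (evalA-lin₃ (shift f) m f' (fromℕ 2) (- κ) x y) (evalA-lin₃ (shift g) m g' (fromℕ 2) (- κ) x (y ∙ s2))) ⟩
        diagBlock F⁺ G⁺ x y ∎
        where
        open ≡-Reasoning
        e1 : σ * (D00 j ⊗ A) x y ≡ diagBlock (shift f) (shift g) x y
        e1 = trans (sym (⊙-⊗ σ (D00 j) A x y)) (trans (⊗-congˡ A hc00 x y hx hy) (diagBlock-A f g ef eg x y hx hy))
        e2 : σ * D01 j x (y ∙ s2) ≡ offBlock m x y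
        e2 = trans (hc01 x (y ∙ s2) hx (H-mul hy s²∈H)) (trans (cong (λ z → evalA m x z + evalA m x (y ∙ s2)) (s²s²≡ε y)) (QP.+-comm (evalA m x y) (evalA m x (y ∙ s2))))

      step01 : ∀ x y → Hs x ≡ true → Hs y ≡ true → σ * (fromℕ cc * D01 (suc j) x y) ≡ offBlock M⁺ x y
      step01 x y hx hy = begin
        σ * (fromℕ cc * D01 (suc j) x y)
          ≡⟨ cong (σ *_) (move-right _ _ _ (hcnt x (y ∙ s))) ⟩
        σ * (fromℕ (N x (y ∙ s) j) + (- Pr x (y ∙ s)))
          ≡⟨ cong (λ z → σ * (z + (- Pr x (y ∙ s)))) (nbrs-matrix₀₁ j x y hy) ⟩
        σ * (((D01 j ⊗ A) x y + (D00 j x (y ∙ s2) + D00 j x y)) + (- Pr x (y ∙ s)))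
          ≡⟨ solve 5 (λ σ a b c p → σ :* ((a :+ (b :+ c)) :+ (:- p)) := σ :* a :+ (σ :* b :+ σ :* c) :+ (:- (σ :* p))) refl σ _ _ _ _ ⟩
        σ * (D01 j ⊗ A) x y + (σ * D00 j x (y ∙ s2) + σ * D00 j x y) + (- (σ * Pr x (y ∙ s)))
          ≡⟨ cong₂ (λ a b → a + b + (- (σ * Pr x (y ∙ s)))) e1 (cong₂ _+_ e2 (hc00 x y hx hy)) ⟩
        offBlock (shift m) x y + ((evalA f x (y ∙ s2) + evalA g x y) + diagBlock f g x y) + (- (σ * Pr x (y ∙ s)))
          ≡⟨ cong (λ z → offBlock (shift m) x y + ((evalA f x (y ∙ s2) + evalA g x y) + diagBlock f g x y) + (- z)) (hp01 x y hx hy) ⟩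
        offBlock (shift m) x y + ((evalA f x (y ∙ s2) + evalA g x y) + diagBlock f g x y) + (- (κ * offBlock m' x y))
          ≡⟨ solve 9 (λ a b c e u v p q k → (a :+ b) :+ ((c :+ e) :+ (u :+ v)) :+ (:- (k :* (p :+ q)))
                     := (a :+ ((c :+ v) :+ (:- k) :* p)) :+ (b :+ ((u :+ e) :+ (:- k) :* q))) refl
                     (evalA (shift m) x (y ∙ s2)) (evalA (shift m) x y) (evalA f x (y ∙ s2)) (evalA g x y) (evalA f x y) (evalA g x (y ∙ s2))
                     (evalA m' x (y ∙ s2)) (evalA m' x y) κ ⟩
        (evalA (shift m) x (y ∙ s2) + ((evalA f x (y ∙ s2) + evalA g x (y ∙ s2)) + (- κ) * evalA m' x (y ∙ s2)))
          + (evalA (shift m) x y + ((evalA f x y + evalA g x y) + (- κ) * evalA m' x y))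
          ≡⟨ sym (cong₂ _+_ (evalA-lin₄ (shift m) f g m' (- κ) x (y ∙ s2)) (evalA-lin₄ (shift m) f g m' (- κ) x y)) ⟩
        offBlock M⁺ x y ∎
        where
        open ≡-Reasoning
        e1 : σ * (D01 j ⊗ A) x y ≡ offBlock (shift m) x y
        e1 = trans (sym (⊙-⊗ σ (D01 j) A x y)) (trans (⊗-congˡ A hc01 x y hx hy) (offBlock-A m em x y hx hy))
        e2 : σ * D00 j x (y ∙ s2) ≡ evalA f x (y ∙ s2) + evalA g x y
        e2 = trans (hc00 x (y ∙ s2) hx (H-mul hy s²∈H)) (cong (λ z → evalA f x (y ∙ s2) + evalA g x z) (s²s²≡ε y))

  module DistanceMatrixFormula where
    open import Data.Nat as ℕ using (ℕ; zero; suc; _≤_; _<_; _∸_)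
    open import Data.Fin using (Fin; zero; suc; _≟_)
    open import Relation.Binary.PropositionalEquality
    open import Data.Bool using (true; _∧_; _∨_; if_then_else_)
    open import Data.Product
    open import Defs

    open RecurrenceStep public
    open FinSums
    open RationalEmbedding
    import Data.Nat.Properties as NP
    import Data.Integer as ℤ
    open import Data.Rational as ℚ using (ℚ; 0ℚ; 1ℚ; _+_; _*_; -_)
    import Data.Rational.Properties as QP
    open import Data.Sum
    open import Function using (_∘_)
    open import Relation.Nullary using (¬_)
    open import Data.Rational.Solver
    open +-*-Solver

    -- b_j = |S| − j, by b+j≡valency
    bs : ℕ → ℕ
    bs j = countF S ∸ j

    module CF = Coefficients bs
    open CF using (Tri; tri; Fc; Gc; Mc; next; T; vanishing; Vanishing)

    Fq Gq Mq : ℕ → ℕ → ℚ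
    Fq j t = ι (CF.F j t)
    Gq j t = ι (CF.G j t)
    Mq j t = ι (CF.M j t)

    κ : ℕ → ℚ
    κ j = ι (CF.cf j)

    ι-sh : ∀ (f : ℕ → ℤ.ℤ) t → ι (CF.shz f t) ≡ shift (ι ∘ f) t
    ι-sh f zero = refl
    ι-sh f (suc t) = refl

    ι-rec : ∀ (k : ℤ.ℤ) a b c → ι (a ℤ.+ (ℤ.+ 2 ℤ.* b ℤ.- k ℤ.* c)) ≡ ι a + (fromℕ 2 * ι b + (- ι k) * ι c)
    ι-rec k a b c = trans (ι-+ a _) (cong (ι a +_) (trans (ι-+ (ℤ.+ 2 ℤ.* b) _)
      (cong₂ _+_ (ι-* (ℤ.+ 2) b) (trans (ι-neg (k ℤ.* c)) (trans (cong -_ (ι-* k c)) (QP.neg-distribˡ-* (ι k) (ι c)))))))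

    ι-recM : ∀ (k : ℤ.ℤ) a b c e → ι (a ℤ.+ ((b ℤ.+ c) ℤ.- k ℤ.* e)) ≡ ι a + ((ι b + ι c) + (- ι k) * ι e)
    ι-recM k a b c e = trans (ι-+ a _) (cong (ι a +_) (trans (ι-+ (b ℤ.+ c) _)
      (cong₂ _+_ (ι-+ b c) (trans (ι-neg (k ℤ.* e)) (trans (cong -_ (ι-* k e)) (QP.neg-distribˡ-* (ι k) (ι e)))))))

    recF : ∀ j (cur prev : Tri) t → ι (Fc (next j cur prev) t) ≡ shift (ι ∘ Fc cur) t + (fromℕ 2 * ι (Mc cur t) + (- κ j) * ι (Fc prev t))
    recF j cur prev t = trans (ι-rec (CF.cf j) (CF.shz (Fc cur) t) (Mc cur t) (Fc prev t)) (cong (_+ (fromℕ 2 * ι (Mc cur t) + (- κ j) * ι (Fc prev t))) (ι-sh (Fc cur) t))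

    recG : ∀ j (cur prev : Tri) t → ι (Gc (next j cur prev) t) ≡ shift (ι ∘ Gc cur) t + (fromℕ 2 * ι (Mc cur t) + (- κ j) * ι (Gc prev t))
    recG j cur prev t = trans (ι-rec (CF.cf j) (CF.shz (Gc cur) t) (Mc cur t) (Gc prev t)) (cong (_+ (fromℕ 2 * ι (Mc cur t) + (- κ j) * ι (Gc prev t))) (ι-sh (Gc cur) t))

    recM : ∀ j (cur prev : Tri) t → ι (Mc (next j cur prev) t) ≡ shift (ι ∘ Mc cur) t + ((ι (Fc cur t) + ι (Gc cur t)) + (- κ j) * ι (Mc prev t))
    recM j cur prev t = trans (ι-recM (CF.cf j) (CF.shz (Mc cur) t) (Fc cur t) (Gc cur t) (Mc prev t)) (cong (_+ ((ι (Fc cur t) + ι (Gc cur t)) + (- κ j) * ι (Mc prev t))) (ι-sh (Mc cur) t))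

    vanF : ∀ j → j ≤ i → Fq j (suc i) ≡ 0ℚ
    vanF j le = cong ι (subst (λ u → CF.F j u ≡ ℤ.+ 0) (cong suc (NP.m+[n∸m]≡n le)) (Vanishing.vF (vanishing j) (i ∸ j)))

    vanM : ∀ j → j ≤ i → Mq j (suc i) ≡ 0ℚ
    vanM j le = cong ι (subst (λ u → CF.M j u ≡ ℤ.+ 0) (NP.m+[n∸m]≡n (NP.≤-trans le (NP.n≤1+n i))) (Vanishing.vM (vanishing j) (suc i ∸ j)))

    vanG : ∀ j → j ≤ i → Gq j (suc i) ≡ 0ℚ
    vanG j le = cong ι (subst (λ u → CF.G j u ≡ ℤ.+ 0) (NP.m+[n∸m]≡n (NP.≤-trans (NP.pred-mono-≤ le) (NP.≤-trans (NP.pred[n]≤n {i}) (NP.n≤1+n i)))) (Vanishing.vG (vanishing j) (suc i ∸ ℕ.pred j)))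

    BlockFormula : ℕ → Set
    BlockFormula j = (∀ x y → Hs x ≡ true → Hs y ≡ true → fromℕ (j ℕ.!) * D00 j x y ≡ diagBlock (Fq j) (Gq j) x y)
         × (∀ x y → Hs x ≡ true → Hs y ≡ true → fromℕ (j ℕ.!) * D01 j x y ≡ offBlock (Mq j) x y)

    zeroSeq : ℕ → ℚ
    zeroSeq _ = 0ℚ

    evalA-zero : ∀ f → (∀ t → f t ≡ 0ℚ) → ∀ x y → evalA f x y ≡ 0ℚ
    evalA-zero f e x y = PA-zero A polyLen f e x y

    blockFormula₀ : BlockFormula 0
    blockFormula₀ = h00 , h01
      where
      h00 : ∀ x y → Hs x ≡ true → Hs y ≡ true → fromℕ 1 * D00 0 x y ≡ diagBlock (Fq 0) (Gq 0) x y
      h00 x y hx hy = trans (QP.*-identityˡ (D00 0 x y))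
        (sym (trans (cong₂ _+_ (cong (1ℚ * Id x y +_) (trans (⊗-congʳ≐ A (PA-zero A (suc i) (λ t → Fq 0 (suc t)) (λ t → refl)) x y) (⊗-Zero A x y)))
                               (evalA-zero (Gq 0) (λ t → refl) x (y ∙ s2)))
               (trans (QP.+-identityʳ _) (trans (QP.+-identityʳ _) (QP.*-identityˡ _)))))
      h01 : ∀ x y → Hs x ≡ true → Hs y ≡ true → fromℕ 1 * D01 0 x y ≡ offBlock (Mq 0) x y
      h01 x y hx hy = trans (cong (λ b → 1ℚ * ind b) (==-false ne))
        (sym (cong₂ _+_ (evalA-zero (Mq 0) (λ t → refl) x (y ∙ s2)) (evalA-zero (Mq 0) (λ t → refl) x y)))
        where
        ne : ¬ x ≡ y ∙ s
        ne e = true≢false (subst (λ z → Hs z ≡ true) e hx) (Hs-s hy)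

    blockFormula₁ : BlockFormula 1
    blockFormula₁ = (λ x y hx hy → trans (sym (QP.*-identityˡ _)) (trans (S.step00 x y hx hy) (cong₂ _+_ (PA-cong A polyLen eF x y) (PA-cong A polyLen eG x (y ∙ s2)))))
        , (λ x y hx hy → trans (sym (QP.*-identityˡ _)) (trans (S.step01 x y hx hy) (cong₂ _+_ (PA-cong A polyLen eM x (y ∙ s2)) (PA-cong A polyLen eM x y))))
      where
      hp : ∀ {R : ℚ} → fromℕ 1 * 0ℚ ≡ κ 0 * R
      hp {R} = trans (QP.*-zeroʳ (fromℕ 1)) (sym (QP.*-zeroˡ R))
      hcnt : ∀ x v → fromℕ (N x v 0) ≡ fromℕ 1 * ind (IsDist S x v 1) + 0ℚ
      hcnt x v = trans (three-term₀ℚ x v) (sym (trans (QP.+-identityʳ (fromℕ 1 * ind (IsDist S x v 1))) (QP.*-identityˡ (ind (IsDist S x v 1)))))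
      module S = Step 0 1 (κ 0) (Fq 0) (Gq 0) (Mq 0) zeroSeq zeroSeq zeroSeq (vanF 0 ℕ.z≤n) (vanG 0 ℕ.z≤n) (vanM 0 ℕ.z≤n)
        (λ _ _ → 0ℚ) (proj₁ blockFormula₀) (proj₂ blockFormula₀) (λ x y _ _ → hp {diagBlock zeroSeq zeroSeq x y}) (λ x y _ _ → hp {offBlock zeroSeq x y}) hcnt
      eF : ∀ t → S.F⁺ t ≡ Fq 1 t
      eF t = sym (recF 0 CF.T0 CF.Tz t)
      eG : ∀ t → S.G⁺ t ≡ Gq 1 t
      eG t = sym (recG 0 CF.T0 CF.Tz t)
      eM : ∀ t → S.M⁺ t ≡ Mq 1 t
      eM t = sym (recM 0 CF.T0 CF.Tz t)

    b≡valency-j : ∀ j → suc j ≤ i → ∀ x y → C.Dist x y j → cnt-b S j x y ≡ bs j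
    b≡valency-j j le x y dd = trans (sym (NP.m+n∸n≡m (cnt-b S j x y) j)) (cong (_∸ j) (b+j≡valency j le x y dd))

    fact-step : ∀ (a b c D R : ℚ) → b * D ≡ R → (a * b) * (c * D) ≡ (a * c) * R
    fact-step a b c D R e = trans (solve 4 (λ a b c D → (a :* b) :* (c :* D) := (a :* c) :* (b :* D)) refl a b c D) (cong ((a * c) *_) e)

    fact-step' : ∀ (a b c D : ℚ) → (a * b) * D ≡ b * (a * D)
    fact-step' = solve 4 (λ a b c D → (a :* b) :* D := b :* (a :* D)) refl

    module StepAt (j : ℕ) (le : suc j ≤ i) (cc : ℕ) (CJ : BlockFormula j) (CJ1 : BlockFormula (suc j))
      (hc : ∀ x y → C.Dist x y (suc (suc j)) → cnt-c S (suc (suc j)) x y ≡ cc) where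

      Pr : Fin n → Fin n → ℚ
      Pr x v = fromℕ (bs j) * ind (IsDist S x v j)

      hp00 : ∀ x y → Hs x ≡ true → Hs y ≡ true → fromℕ (suc j ℕ.!) * Pr x y ≡ κ (suc j) * diagBlock (Fq j) (Gq j) x y
      hp00 x y hx hy = trans (cong (_* Pr x y) (fromℕ-* (suc j) (j ℕ.!)))
        (trans (fact-step (fromℕ (suc j)) (fromℕ (j ℕ.!)) (fromℕ (bs j)) (D00 j x y) _ (proj₁ CJ x y hx hy))
          (cong (_* diagBlock (Fq j) (Gq j) x y) (sym (fromℕ-* (suc j) (bs j)))))

      hp01 : ∀ x y → Hs x ≡ true → Hs y ≡ true → fromℕ (suc j ℕ.!) * Pr x (y ∙ s) ≡ κ (suc j) * offBlock (Mq j) x y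
      hp01 x y hx hy = trans (cong (_* Pr x (y ∙ s)) (fromℕ-* (suc j) (j ℕ.!)))
        (trans (fact-step (fromℕ (suc j)) (fromℕ (j ℕ.!)) (fromℕ (bs j)) (D01 j x y) _ (proj₂ CJ x y hx hy))
          (cong (_* offBlock (Mq j) x y) (sym (fromℕ-* (suc j) (bs j)))))

      hcnt : ∀ x v → fromℕ (N x v (suc j)) ≡ fromℕ cc * ind (IsDist S x v (suc (suc j))) + Pr x v
      hcnt = three-termℚ j cc (bs j) hc (λ x y dd → proj₂ (small-c-a j le x y dd)) (b≡valency-j j le)

      module S = Step (suc j) cc (κ (suc j)) (Fq (suc j)) (Gq (suc j)) (Mq (suc j)) (Fq j) (Gq j) (Mq j)
        (vanF (suc j) le) (vanG (suc j) le) (vanM (suc j) le) Pr (proj₁ CJ1) (proj₂ CJ1) hp00 hp01 hcnt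

      eF : ∀ t → S.F⁺ t ≡ Fq (suc (suc j)) t
      eF t = sym (recF (suc j) (T (suc j)) (T j) t)
      eG : ∀ t → S.G⁺ t ≡ Gq (suc (suc j)) t
      eG t = sym (recG (suc j) (T (suc j)) (T j) t)
      eM : ∀ t → S.M⁺ t ≡ Mq (suc (suc j)) t
      eM t = sym (recM (suc j) (T (suc j)) (T j) t)

      res00 : ∀ x y → Hs x ≡ true → Hs y ≡ true →
        fromℕ (suc j ℕ.!) * (fromℕ cc * D00 (suc (suc j)) x y) ≡ diagBlock (Fq (suc (suc j))) (Gq (suc (suc j))) x y
      res00 x y hx hy = trans (S.step00 x y hx hy) (cong₂ _+_ (PA-cong A polyLen eF x y) (PA-cong A polyLen eG x (y ∙ s2)))

      res01 : ∀ x y → Hs x ≡ true → Hs y ≡ true →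
        fromℕ (suc j ℕ.!) * (fromℕ cc * D01 (suc (suc j)) x y) ≡ offBlock (Mq (suc (suc j))) x y
      res01 x y hx hy = trans (S.step01 x y hx hy) (cong₂ _+_ (PA-cong A polyLen eM x (y ∙ s2)) (PA-cong A polyLen eM x y))

    blockFormula-step : ∀ j → suc (suc j) ≤ i → BlockFormula j → BlockFormula (suc j) → BlockFormula (suc (suc j))
    blockFormula-step j le CJ CJ1 = (λ x y hx hy → trans (e (D00 (suc (suc j)) x y)) (SA.res00 x y hx hy))
                     , (λ x y hx hy → trans (e (D01 (suc (suc j)) x y)) (SA.res01 x y hx hy))
      where
      module SA = StepAt j (NP.≤-trans (NP.n≤1+n _) le) (suc (suc j)) CJ CJ1 (λ x y dd → proj₁ (small-c-a (suc j) le x y dd))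
      e : ∀ D → fromℕ (suc (suc j) ℕ.!) * D ≡ fromℕ (suc j ℕ.!) * (fromℕ (suc (suc j)) * D)
      e D = trans (cong (_* D) (fromℕ-* (suc (suc j)) (suc j ℕ.!))) (fact-step' (fromℕ (suc (suc j))) (fromℕ (suc j ℕ.!)) 0ℚ D)

    blockFormula-pair : ∀ j → suc j ≤ i → BlockFormula j × BlockFormula (suc j)
    blockFormula-pair zero le = blockFormula₀ , blockFormula₁
    blockFormula-pair (suc j) le = let (a , b) = blockFormula-pair j (NP.≤-trans (NP.n≤1+n _) le) in b , blockFormula-step j le a b

module Lemma7p2Parts {n : ℕ} (_∙_ : Fin n → Fin n → Fin n) (ε : Fin n) (_⁻¹ : Fin n → Fin n)
  (isAG : IsAbelianGroup _≡_ _∙_ ε _⁻¹)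
  (S : Fin n → Bool) (Sε : S ε ≡ false) (Sinv : ∀ g → S g ≡ true → S (g ⁻¹) ≡ true)
  (s : Fin n) (Ss : S s ≡ true) (Hs : Fin n → Bool)
  (H→gen : ∀ g → Hs g ≡ true → Grp.InGen _∙_ ε _⁻¹ (Grp.remove± _∙_ ε _⁻¹ S s) g)
  (gen→H : ∀ g → Grp.InGen _∙_ ε _⁻¹ (Grp.remove± _∙_ ε _⁻¹ S s) g → Hs g ≡ true)
  (notAll : Σ (Fin n) (λ g → Hs g ≡ false))
  (ord4 : Grp.HasOrder _∙_ ε _⁻¹ s 4)
  (d : ℕ) (x₀ : Fin n) (hx₀ : Hs x₀ ≡ true)
  (dx₀ : Grp.IsDist _∙_ ε _⁻¹ (Grp.remove± _∙_ ε _⁻¹ S s) x₀ (x₀ ∙ (s ∙ s)) d ≡ true)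
  (i' : ℕ) (2i≤d : suc i' ℕ.+ suc i' ≤ d)
  (DR : Grp.DistanceRegular _∙_ ε _⁻¹ S)
  (a1 : ∀ x y → Grp.IsDist _∙_ ε _⁻¹ S x y 1 ≡ true → Grp.cnt-a _∙_ ε _⁻¹ S 1 x y ≡ 0)
  where
  open import Data.Nat as ℕ using (ℕ; zero; suc; _≤_; _<_; _∸_)
  open import Data.Fin using (Fin; zero; suc; _≟_)
  open import Algebra.Structures using (IsAbelianGroup)
  open import Relation.Binary.PropositionalEquality
  open import Data.Bool using (Bool; true; false; _∧_; _∨_; if_then_else_)
  open import Data.Product
  open import Defs

  open Setting _∙_ ε _⁻¹ isAG S Sε Sinv s Ss Hs H→gen gen→H notAll ord4 d x₀ hx₀ dx₀ (suc i') 2i≤d DR a1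
  open DistanceMatrixFormula public
  open FinSums
  open RationalEmbedding
  import Data.Nat.Properties as NP
  import Data.Integer as ℤ
  open import Data.Rational as ℚ using (ℚ; 0ℚ; 1ℚ; _+_; _*_; -_)
  import Data.Rational.Properties as QP
  open import Data.Sum
  open import Data.List using (List; _∷_; applyUpTo; last)
  import Data.List.Properties as LP
  open import Data.Maybe using (just)
  open import Function using (_∘_)
  open import Relation.Nullary using (¬_)
  open import Data.Rational.Solver
  open +-*-Solver

  i : ℕ
  i = suc i'

  -- |S₀| ≥ i, counting the neighbours of a vertex at Γ₀-distance i
  i≤valency₀ : i ≤ countF S0
  i≤valency₀ = subst (_≤ countF S0) e (countF-le _ S0 (λ u h → proj₁ (∧-elim h)))
    where
    w : Fin n
    w = geo i NP.≤-refl
    hw : Hs w ≡ true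
    hw = geo∈H i NP.≤-refl
    dw : C0.Dist x₀ w i
    dw = geo-dist i NP.≤-refl
    dwS : C.Dist x₀ w i
    dwS = dist-within-H hx₀ hw dw (NP.n≤1+n i)
    e : N0 x₀ w i' ≡ i
    e = trans (sym (nbrs-H-off hx₀ hw dw NP.≤-refl i' (n≢2+n i'))) (trans (sym (cntc≡N x₀ w i')) (proj₁ (small-c-a i' NP.≤-refl x₀ w dwS)))

  valency≥i+2 : suc (suc i) ≤ countF S
  valency≥i+2 = subst (suc (suc i) ≤_) (sym valency-S₀) (NP.≤-trans (NP.≤-reflexive (NP.+-comm 2 i)) (NP.+-monoˡ-≤ 2 i≤valency₀))

  -- b_j ≥ 3 for j < i, as |S| ≥ i + 2
  b≥3 : ∀ j → suc j ≤ i → 3 ≤ bs j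
  b≥3 j le = NP.m+n≤o⇒m≤o∸n 3 (NP.≤-trans (ℕ.s≤s (ℕ.s≤s le)) valency≥i+2)

  module Signs = CF.Sign i b≥3

  w : Fin n
  w = geo i NP.≤-refl
  hw : Hs w ≡ true
  hw = geo∈H i NP.≤-refl
  dw : C0.Dist x₀ w i
  dw = geo-dist i NP.≤-refl
  dws : C.Dist x₀ (w ∙ s) (suc i)
  dws = dist-to-coset hx₀ hw dw NP.≤-refl (inj₁ refl)

  c : ℕ
  c = cnt-c S (suc i) x₀ (w ∙ s)

  hc : ∀ x y → C.Dist x y (suc i) → cnt-c S (suc i) x y ≡ c
  hc x y dd = DRc dd dws

  formulas : BlockFormula i' × BlockFormula i
  formulas = blockFormula-pair i' NP.≤-refl

  module AtLevelI = StepAt i' NP.≤-refl c (proj₁ formulas) (proj₂ formulas) hc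

  F' G' M' : ℕ → ℚ
  F' = Fq (suc i)
  G' = Gq (suc i)
  M' = Mq (suc i)

  p q r : List ℚ
  p = applyUpTo F' i
  q = applyUpTo G' i
  r = applyUpTo M' i'

  F'i : F' i ≡ 0ℚ
  F'i = cong ι (CF.F-parity i)
  F'si : F' (suc i) ≡ 1ℚ
  F'si = cong ι (CF.Vanishing.vF1 (CF.vanishing (suc i)))
  G'i : G' i ≡ 0ℚ
  G'i = cong ι (subst (λ u → CF.G (suc i) u ≡ ℤ.+ 0) (NP.+-identityʳ i) (CF.Vanishing.vG (CF.vanishing (suc i)) 0))
  G'si : G' (suc i) ≡ 0ℚ
  G'si = cong ι (subst (λ u → CF.G (suc i) u ≡ ℤ.+ 0) (CF.eq2 i) (CF.Vanishing.vG (CF.vanishing (suc i)) 1))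
  M'i' : M' i' ≡ 0ℚ
  M'i' = cong ι (CF.M-parity i')
  M'i : M' i ≡ fromℕ (suc i)
  M'i = cong ι (CF.M-lead i)
  M'si : M' (suc i) ≡ 0ℚ
  M'si = cong ι (subst (λ u → CF.M (suc i) u ≡ ℤ.+ 0) (NP.+-identityʳ (suc i)) (CF.Vanishing.vM (CF.vanishing (suc i)) 0))

  evalA-F : ∀ x y → evalA F' x y ≡ (A ^^ suc i) x y + polyAt A i F' x y
  evalA-F x y = trans (PA-top A (suc i) F' x y) (trans (cong₂ (λ a b → a + b * (A ^^ suc i) x y) (PA-top A i F' x y) F'si)
    (trans (cong (λ b → (polyAt A i F' x y + b * (A ^^ i) x y) + 1ℚ * (A ^^ suc i) x y) F'i)
      (solve 3 (λ a b e → (a :+ con 0ℚ :* b) :+ con 1ℚ :* e := e :+ a) refl (polyAt A i F' x y) ((A ^^ i) x y) ((A ^^ suc i) x y))))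

  evalA-G : ∀ x y → evalA G' x y ≡ polyAt A i G' x y
  evalA-G x y = trans (PA-ext1 A (suc i) G' G'si x y) (PA-ext1 A i G' G'i x y)

  offPoly : Mat
  offPoly = (fromℕ (suc i) ⊙ (A ^^ i)) ⊕ polyAt A i' M'

  evalA-M : ∀ x y → evalA M' x y ≡ offPoly x y
  evalA-M x y = trans (PA-ext1 A (suc i) M' M'si x y) (trans (PA-top A i M' x y)
    (trans (cong₂ (λ a b → a + b * (A ^^ i) x y) (trans (PA-top A i' M' x y) (cong (λ b → polyAt A i' M' x y + b * (A ^^ i') x y) M'i')) M'i)
      (solve 4 (λ a e b k → (a :+ con 0ℚ :* e) :+ k :* b := k :* b :+ a) refl (polyAt A i' M' x y) ((A ^^ i') x y) ((A ^^ i) x y) (fromℕ (suc i)))))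

  fact-out : ∀ (X : ℚ) → X ≡ invFact i * (fromℕ (i ℕ.!) * X)
  fact-out X = trans (sym (QP.*-identityˡ X)) (trans (cong (_* X) (sym (fact-inv i))) (QP.*-assoc (invFact i) (fromℕ (i ℕ.!)) X))

  M₁ M₂ : Mat
  M₁ = invFact i ⊙ ((A ^^ suc i) ⊕ (evalP p A ⊕ (evalP q A ⊗ P)))
  M₂ = invFact i ⊙ (((fromℕ (suc i) ⊙ (A ^^ i)) ⊕ evalP r A) ⊗ (P ⊕ Id))

  block₀₀ : ∀ x y → Hs x ≡ true → Hs y ≡ true → fromℕ c * ind (IsDist S x y (suc i)) ≡ M₁ x y
  block₀₀ x y hx hy = trans (fact-out _) (cong (invFact i *_) (trans (AtLevelI.res00 x y hx hy)
    (trans (cong₂ _+_ (evalA-F x y) (evalA-G x (y ∙ s2)))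
      (trans (QP.+-assoc ((A ^^ suc i) x y) (polyAt A i F' x y) (polyAt A i G' x (y ∙ s2)))
        (cong (λ z → (A ^^ suc i) x y + (polyAt A i F' x y + z)) (sym (⊗P (polyAt A i G') x y hy)))))))

  block₀₁ : ∀ x y → Hs x ≡ true → Hs y ≡ true → fromℕ c * ind (IsDist S x (y ∙ s) (suc i)) ≡ M₂ x y
  block₀₁ x y hx hy = trans (fact-out _) (cong (invFact i *_) (trans (AtLevelI.res01 x y hx hy)
    (trans (cong₂ _+_ (evalA-M x (y ∙ s2)) (evalA-M x y)) (sym (⊗PI offPoly x y hx hy)))))

  M₂-s2 : ∀ x y → Hs x ≡ true → Hs y ≡ true → M₂ x (y ∙ s2) ≡ M₂ x y
  M₂-s2 x y hx hy = cong (invFact i *_) (trans (⊗PI offPoly x (y ∙ s2) hx (H-mul hy s²∈H))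
    (trans (cong (λ z → offPoly x z + offPoly x (y ∙ s2)) (s²s²≡ε y)) (trans (QP.+-comm (offPoly x y) (offPoly x (y ∙ s2))) (sym (⊗PI offPoly x y hx hy)))))

  IsD-xs-y : ∀ x y m → IsDist S (x ∙ s) y m ≡ IsDist S x ((y ∙ s2) ∙ s) m
  IsD-xs-y x y m = trans (cong₂ (λ a b → IsDist S a b m) (comm x s) (sym e)) (C.IsDist-transl s x ((y ∙ s2) ∙ s) m)
    where
    e : s ∙ ((y ∙ s2) ∙ s) ≡ y
    e = trans (comm s _) (trans (assoc (y ∙ s2) s s) (s²s²≡ε y))

  IsD-xs-ys : ∀ x y m → IsDist S (x ∙ s) (y ∙ s) m ≡ IsDist S x y m
  IsD-xs-ys x y m = trans (cong₂ (λ a b → IsDist S a b m) (comm x s) (comm y s)) (C.IsDist-transl s x y m)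

  block₁₀ : ∀ x y → Hs x ≡ true → Hs y ≡ true → fromℕ c * ind (IsDist S (x ∙ s) y (suc i)) ≡ M₂ x y
  block₁₀ x y hx hy = trans (cong (λ b → fromℕ c * ind b) (IsD-xs-y x y (suc i))) (trans (block₀₁ x (y ∙ s2) hx (H-mul hy s²∈H)) (M₂-s2 x y hx hy))

  block₁₁ : ∀ x y → Hs x ≡ true → Hs y ≡ true → fromℕ c * ind (IsDist S (x ∙ s) (y ∙ s) (suc i)) ≡ M₁ x y
  block₁₁ x y hx hy = trans (cong (λ b → fromℕ c * ind b) (IsD-xs-ys x y (suc i))) (block₀₀ x y hx hy)

  last-applyUpTo : ∀ (f : ℕ → ℚ) k → last (applyUpTo f (suc k)) ≡ just (f k)
  last-applyUpTo f zero = refl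
  last-applyUpTo f (suc k) = last-applyUpTo (λ t → f (suc t)) k

  hdeg : ∀ k (f : ℕ → ℚ) → (∀ k'' → k ≡ suc k'' → ¬ f k'' ≡ 0ℚ) → HasDegree- (applyUpTo f k) k
  hdeg zero f h = refl
  hdeg (suc k) f h = LP.length-applyUpTo f (suc k) , f k , last-applyUpTo f k , h k refl

  negnz : ∀ l → 1 ≤ l → ¬ ι (ℤ.- (ℤ.+ l)) ≡ 0ℚ
  negnz (suc l) _ = ι-nz (ℤ.-[1+ l ]) (λ ())

  degp : HasDegree- p i
  degp = hdeg i F' (λ k'' e → subst (λ z → ¬ F' z ≡ 0ℚ) (NP.suc-injective e) nz)
    where
    L : Σ ℕ (λ l → 1 ≤ l × CF.F (suc i) i' ≡ ℤ.- (ℤ.+ l))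
    L = Signs.F-lead-neg i' NP.≤-refl
    nz : ¬ F' i' ≡ 0ℚ
    nz e = negnz (proj₁ L) (proj₁ (proj₂ L)) (trans (cong ι (sym (proj₂ (proj₂ L)))) e)

  degq : HasDegree- q i
  degq = hdeg i G' (λ k'' e → subst (λ z → ¬ G' z ≡ 0ℚ) (NP.suc-injective e) nz)
    where
    nz : ¬ G' i' ≡ 0ℚ
    nz e = ι-nz (ℤ.+ (suc i' ℕ.* suc (suc i'))) (λ ()) (trans (cong ι (sym (CF.G-lead i'))) e)

  leadq : LeadingCoeff q (fromℕ (i ℕ.* (i ℕ.+ 1)))
  leadq = trans (last-applyUpTo G' i') (cong just (trans (cong ι (CF.G-lead i')) (cong (λ z → fromℕ (suc i' ℕ.* z)) (NP.+-comm 1 (suc i')))))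

  degr : HasDegree- r (i ∸ 1)
  degr = hdeg i' M' aux
    where
    aux : ∀ k'' → i' ≡ suc k'' → ¬ M' k'' ≡ 0ℚ
    aux k'' e = subst (λ z → ¬ ι (CF.M (suc (suc z)) k'') ≡ 0ℚ) (sym e) nz
      where
      le : suc (suc k'') ≤ i
      le = subst (λ z → suc (suc k'') ≤ suc z) (sym e) NP.≤-refl
      R : Σ ℕ (λ r → 1 ≤ r × CF.M (suc (suc (suc k''))) k'' ≡ ℤ.- (ℤ.+ r))
      R = Signs.M-lead-neg k'' le
      nz : ¬ ι (CF.M (suc (suc (suc k''))) k'') ≡ 0ℚ
      nz e' = negnz (proj₁ R) (proj₁ (proj₂ R)) (trans (cong ι (sym (proj₂ (proj₂ R)))) e')

  part-i0 : ∀ x y → Hs x ≡ true → Hs y ≡ true → IsDist S0 x y i ≡ true → cnt-a S0 i x y ≡ 0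
  part-i0 x y hx hy e = trans (cnta≡N0 x y i) (trans (sym (nbrs-H-off hx hy dd0 NP.≤-refl i (λ q → NP.1+n≢n (sym q))))
    (trans (sym (cnta≡N x y i)) (proj₂ (small-c-a i' NP.≤-refl x y (dist-within-H hx hy dd0 (NP.n≤1+n i))))))
    where
    dd0 : C0.Dist x y i
    dd0 = C0.mkD {x} {y} {i} e

  part-iS : ∀ x y → IsDist S x y i ≡ true → cnt-a S i x y ≡ 0
  part-iS x y e = proj₂ (small-c-a i' NP.≤-refl x y (C.mkD e))

  part-ii0 : ∀ x y → Hs x ≡ true → Hs y ≡ true → IsDist S0 x y i ≡ true → cnt-c S0 i x y ≡ i
  part-ii0 x y hx hy e = trans (cntc≡N0 x y i') (trans (sym (nbrs-H-off hx hy dd0 NP.≤-refl i' (n≢2+n i')))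
    (trans (sym (cntc≡N x y i')) (proj₁ (small-c-a i' NP.≤-refl x y (dist-within-H hx hy dd0 (NP.n≤1+n i))))))
    where
    dd0 : C0.Dist x y i
    dd0 = C0.mkD {x} {y} {i} e

  part-iiS : ∀ x y → IsDist S x y i ≡ true → cnt-c S i x y ≡ i
  part-iiS x y e = proj₁ (small-c-a i' NP.≤-refl x y (C.mkD e))

  part-iv : ∀ x y → Hs x ≡ true → Hs y ≡ true → IsDist S0 x y i ≡ true →
    (IsDist S x y i ≡ true) × (IsDist S (x ∙ s) (y ∙ s) i ≡ true) ×
    (IsDist S x (y ∙ s) (suc i) ≡ true) × (IsDist S (x ∙ s) y (suc i) ≡ true)
  part-iv x y hx hy e = a , trans (IsD-xs-ys x y i) a , C.unD (dist-to-coset hx hy dd0 NP.≤-refl (inj₁ refl)) ,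
    trans (IsD-xs-y x y (suc i)) (C.unD (dist-to-coset hx hy dd0 NP.≤-refl (inj₂ refl)))
    where
    dd0 : C0.Dist x y i
    dd0 = C0.mkD {x} {y} {i} e
    a : IsDist S x y i ≡ true
    a = C.unD (dist-within-H hx hy dd0 (NP.n≤1+n i))

  cconst : ∀ x y → IsDist S x y (suc i) ≡ true → cnt-c S (suc i) x y ≡ c
  cconst x y e = hc x y (C.mkD e)

open import Defs
open import Data.Nat using (ℕ; zero; suc; _≤_; _∸_; _*_; _+_; _/_)
open import Data.Fin using (Fin)
open import Data.Bool using (Bool; true; false)
open import Data.List using (List)
open import Data.Product using (Σ; _×_; _,_)
open import Data.Rational using (ℚ) renaming (_*_ to _*ℚ_)
open import Algebra.Structures using (IsAbelianGroup)
open import Relation.Nullary using (¬_)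
open import Relation.Binary.PropositionalEquality using (_≡_; cong; trans; sym)
import Data.Nat.Properties as NatP
import Data.Nat.DivMod as DM

half-bound : ∀ i d → i ≤ d / 2 → i + i ≤ d
half-bound i d le = NatP.≤-trans (NatP.+-mono-≤ le le)
  (NatP.≤-trans (NatP.≤-reflexive halves) (DM.m/n*n≤m d 2))
  where
  halves : d / 2 + d / 2 ≡ d / 2 * 2
  halves = trans (cong (d / 2 +_) (sym (NatP.+-identityʳ (d / 2)))) (NatP.*-comm 2 (d / 2))

-- Lemma 7.2.  The case i = 0 is excluded by 1 ≤ i; for i ≥ 1 every part is
-- provided by Lemma7p2Parts.
lemma7p2 :
  (n : ℕ) (_∙_ : Fin n → Fin n → Fin n) (ε : Fin n) (_⁻¹ : Fin n → Fin n) →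
  IsAbelianGroup _≡_ _∙_ ε _⁻¹ →
  let open Grp _∙_ ε _⁻¹ in
  (S : Fin n → Bool) →
  S ε ≡ false →
  (∀ g → S g ≡ true → S (g ⁻¹) ≡ true) →
  3 ≤ countF S →
  (s : Fin n) → S s ≡ true →
  (Hs : Fin n → Bool) →
  (∀ g → Hs g ≡ true → InGen (remove± S s) g) →
  (∀ g → InGen (remove± S s) g → Hs g ≡ true) →
  Σ (Fin n) (λ g → Hs g ≡ false) →
  n ≡ 2 * countF Hs →
  HasOrder s 4 →
  Σ (Fin n) (λ g → ¬ InGen (λ t → t == s) g) →
  DistanceRegular S →
  (∀ x y → IsDist S x y 1 ≡ true → cnt-a S 1 x y ≡ 0) →
  (d : ℕ) (x₀ : Fin n) → Hs x₀ ≡ true →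
  IsDist (remove± S s) x₀ (x₀ ∙ (s ∙ s)) d ≡ true →
  (i : ℕ) → 1 ≤ i → i ≤ d / 2 →
  let open MatH Hs
      S₀ = remove± S s
      A : Mat
      A x y = ind (Adj S₀ x y)
      P : Mat
      P x y = ind (y == (x ∙ (s ∙ s)))
  in
  -- (i)
  ((∀ x y → Hs x ≡ true → Hs y ≡ true → IsDist S₀ x y i ≡ true → cnt-a S₀ i x y ≡ 0) ×
   (∀ x y → IsDist S x y i ≡ true → cnt-a S i x y ≡ 0)) ×
  -- (ii)
  ((∀ x y → Hs x ≡ true → Hs y ≡ true → IsDist S₀ x y i ≡ true → cnt-c S₀ i x y ≡ i) ×
   (∀ x y → IsDist S x y i ≡ true → cnt-c S i x y ≡ i)) ×
  -- (iii)
  Σ (List ℚ) (λ p → Σ (List ℚ) (λ q → Σ (List ℚ) (λ r →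
    HasDegree- p i × HasDegree- q i × HasDegree- r (i ∸ 1) ×
    LeadingCoeff q (fromℕ (i * (i + 1))) ×
    Σ ℕ (λ c →
      (∀ x y → IsDist S x y (suc i) ≡ true → cnt-c S (suc i) x y ≡ c) ×
      (let M₁ = invFact i ⊙ ((A ^^ suc i) ⊕ (evalP p A ⊕ (evalP q A ⊗ P)))
           M₂ = invFact i ⊙ (((fromℕ (suc i) ⊙ (A ^^ i)) ⊕ evalP r A) ⊗ (P ⊕ Id))
       in ∀ x y → Hs x ≡ true → Hs y ≡ true →
            ((fromℕ c *ℚ ind (IsDist S x y (suc i))) ≡ M₁ x y) ×
            ((fromℕ c *ℚ ind (IsDist S x (y ∙ s) (suc i))) ≡ M₂ x y) ×
            ((fromℕ c *ℚ ind (IsDist S (x ∙ s) y (suc i))) ≡ M₂ x y) ×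
            ((fromℕ c *ℚ ind (IsDist S (x ∙ s) (y ∙ s) (suc i))) ≡ M₁ x y)))))) ×
  -- (iv)
  (∀ x y → Hs x ≡ true → Hs y ≡ true → IsDist S₀ x y i ≡ true →
    (IsDist S x y i ≡ true) × (IsDist S (x ∙ s) (y ∙ s) i ≡ true) ×
    (IsDist S x (y ∙ s) (suc i) ≡ true) × (IsDist S (x ∙ s) y (suc i) ≡ true))
lemma7p2 n _∙_ ε _⁻¹ isAG S Sε Sinv _ s Ss Hs H→gen gen→H notAll _ ord4 _ DR a1 d x₀ hx₀ dx₀ zero () _
lemma7p2 n _∙_ ε _⁻¹ isAG S Sε Sinv _ s Ss Hs H→gen gen→H notAll _ ord4 _ DR a1 d x₀ hx₀ dx₀ (suc i') _ i≤d/2 =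
  (part-i0 , part-iS) ,
  (part-ii0 , part-iiS) ,
  (p , q , r , degp , degq , degr , leadq , c , cconst ,
    λ x y hx hy → block₀₀ x y hx hy , block₀₁ x y hx hy , block₁₀ x y hx hy , block₁₁ x y hx hy) ,
  part-iv
  where
  open Lemma7p2Parts _∙_ ε _⁻¹ isAG S Sε Sinv s Ss Hs H→gen gen→H notAll ord4 d x₀ hx₀ dx₀ i'
         (half-bound (suc i') d i≤d/2) DR a1
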